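{- Let $n\ge1$, let $\Delta\subset B_n$ be a proper ideal (a simplicial complex on a subset of $[1,n]$ with $\emptyset\in\Delta$, $[1,n]\notin\Delta$), and let $2\le k\le\lfloor\frac{n-1}2\rfloor$. The following are equivalent: (1) $g_k(\mathrm{Bier}(\Delta))=0$; (2) $f_k(\Delta)=0$ or $f_{n-k}(\Delta)=\binom{n}{k}$; (3) $\mathrm{Bier}(\Delta)$ is obtained (up to isomorphism) from the boundary complex of the $(n-1)$-simplex via a sequence of bistellar $i$-flips, with $i\le k-2$ at every flip.
   Context: $f_i(\Delta)$ is the number of sets of cardinality $i$ in $\Delta$. The Bier sphere $\mathrm{Bier}(\Delta)$ is the simplicial complex on the vertex set $\{v_i: \{i\}\in\Delta\}\cup\{w_j: [1,n]\setminus\{j\}\notin\Delta\}$ whose faces are the sets $\{v_i: i\in B\}\cup\{w_j: j\in[1,n]\setminus C\}$ for all $B\subseteq C\subseteq[1,n]$ with $B\in\Delta$, $C\notin\Delta$; it is a pure $(n-2)$-dimensional PL sphere. For a pure $(n-2)$-dimensional complex $\Gamma$ with $f_j(\Gamma)$ faces of cardinality $j$, $h_i(\Gamma)=\sum_{j=0}^{n-1}(-1)^{i+j}\binom{n-1-j}{n-1-i}f_j(\Gamma)$ for $0\le i\le n-1$ ($h_i=0$ otherwise) and $g_i(\Gamma)=h_i(\Gamma)-h_{i-1}(\Gamma)$. Bistellar flip: let $\Gamma$ be a simplicial $d$-manifold and $0\le i\le d$; if $A$ is a $(d-i)$-dimensional face of $\Gamma$ whose link is the boundary of an $i$-simplex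 $B$ (on vertices of $\Gamma$) with $B\notin\Gamma$, then the bistellar $i$-flip $\Phi_A$ replaces $\Gamma$ by the complex obtained by removing all faces $A\cup G$ with $G\subsetneq B$ and adding all faces $F\cup B$ with $F\subsetneq A$. -}

module Defs where

open import Data.Bool using (Bool; true; false; _∧_; not; if_then_else_)
open import Data.Nat using (ℕ; zero; suc; _+_; _*_; _∸_; _≤_; _≤ᵇ_; _≡ᵇ_)
open import Data.Nat.Combinatorics using (_C_)
open import Data.Integer as ℤ using (ℤ; +_; -_)
open import Data.Fin using (Fin)
open import Data.Fin.Subset using (Subset; _⊆_; _⊂_; _∪_; _∩_; _∈_; ∁; ∣_∣; Empty; ⁅_⁆)
open import Data.Fin.Subset.Properties using (_⊆?_; _⊂?_)
open import Data.List using (List; []; _∷_; _++_; map; foldr; upTo)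
open import Data.Vec using (Vec; take; drop) renaming ([] to []ᵥ; _∷_ to _∷ᵥ_)
open import Data.Product using (Σ; ∃; _×_; _,_)
open import Data.Sum using (_⊎_)
open import Relation.Nullary using (¬_; does)
open import Relation.Binary.PropositionalEquality using (_≡_)
open import Function.Bundles using (_⇔_)

Complex : ℕ → Set
Complex N = Subset N → Bool

allSubsets : (N : ℕ) → List (Subset N)
allSubsets zero = []ᵥ ∷ []
allSubsets (suc N) = map (true ∷ᵥ_) (allSubsets N) ++ map (false ∷ᵥ_) (allSubsets N)

f : {N : ℕ} → Complex N → ℕ → ℕ
f {N} Γ i = foldr _+_ 0
  (map (λ F → if Γ F ∧ (∣ F ∣ ≡ᵇ i) then 1 else 0) (allSubsets N))

ProperIdeal : {n : ℕ} → (Subset n → Bool) → Set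
ProperIdeal {n} Δ =
  (∀ (S T : Subset n) → S ⊆ T → Δ T ≡ true → Δ S ≡ true)
  × Δ Data.Fin.Subset.⊥ ≡ true
  × Δ Data.Fin.Subset.⊤ ≡ false

-- Bier sphere on the ambient vertex set Fin (n + n):
-- vertex inject i is v_i, vertex raise n j is w_j.
-- A set F is a face iff F = {v_i : i ∈ B} ∪ {w_j : j ∉ C} with
-- B ⊆ C, B ∈ Δ, C ∉ Δ  (here B = v-part of F, C = complement of w-part).
Bier : {n : ℕ} → (Subset n → Bool) → Complex (n + n)
Bier {n} Δ F = Δ B ∧ not (Δ C) ∧ does (B ⊆? C)
  where
  B : Subset n
  B = take n F
  C : Subset n
  C = ∁ (drop n F)

neg1^ : ℕ → ℤ
neg1^ zero = + 1
neg1^ (suc m) = - neg1^ m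

-- h_i(Γ) for a pure (n-2)-dimensional complex Γ
h : {N : ℕ} → (n : ℕ) → Complex N → ℕ → ℤ
h n Γ i = if i ≤ᵇ (n ∸ 1)
  then foldr ℤ._+_ (+ 0)
         (map (λ j → neg1^ (i + j) ℤ.* (+ (((n ∸ 1 ∸ j) C (n ∸ 1 ∸ i)) * f Γ j)))
              (upTo n))
  else + 0

g : {N : ℕ} → (n : ℕ) → Complex N → ℕ → ℤ
g n Γ zero = h n Γ zero
g n Γ (suc i) = h n Γ (suc i) ℤ.- h n Γ i

BoundarySimplex : {N : ℕ} → Subset N → Complex N
BoundarySimplex S F = does (F ⊂? S)

-- Bistellar i-flip of a simplicial d-manifold Γ (turning it into Γ'):
-- A is a (d-i)-dimensional face, lk(A) = ∂B with B an i-simplex, B ∉ Γ;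
-- remove A ∪ G (G ⊊ B), add F ∪ B (F ⊊ A).
record Flip {N : ℕ} (d i : ℕ) (Γ Γ' : Complex N) : Set where
  field
    A B : Subset N
    i≤d : i ≤ d
    cardA : ∣ A ∣ ≡ (d ∸ i) + 1
    cardB : ∣ B ∣ ≡ i + 1
    disjoint : Empty (A ∩ B)
    A∈Γ : Γ A ≡ true
    link : ∀ (G : Subset N) → ((Empty (G ∩ A) × Γ (A ∪ G) ≡ true) ⇔ G ⊂ B)
    B∉Γ : Γ B ≡ false
    result : ∀ (F : Subset N) →
      (Γ' F ≡ true ⇔
        ((Γ F ≡ true × ¬ (∃ λ G → G ⊂ B × F ≡ A ∪ G))
         ⊎ (∃ λ F' → F' ⊂ A × F ≡ F' ∪ B)))

data Flips {N : ℕ} (d m : ℕ) : Complex N → Complex N → Set where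
  done : ∀ {Γ} → Flips d m Γ Γ
  step : ∀ {Γ Γ' Γ''} (i : ℕ) → i ≤ m → Flip d i Γ Γ' → Flips d m Γ' Γ'' → Flips d m Γ Γ''

IsImage : {N M : ℕ} → (Fin N → Fin M) → Subset N → Subset M → Set
IsImage {N} φ F G = ∀ w → (w ∈ G ⇔ (∃ λ v → v ∈ F × φ v ≡ w))

Vertex : {N : ℕ} → Complex N → Fin N → Set
Vertex Γ v = Γ ⁅ v ⁆ ≡ true

Iso : {N M : ℕ} → Complex N → Complex M → Set
Iso {N} {M} Γ Γ' =
  Σ (Fin N → Fin M) λ φ → Σ (Fin M → Fin N) λ ψ →
    (∀ v → Vertex Γ v → ψ (φ v) ≡ v)
    × (∀ w → Vertex Γ' w → φ (ψ w) ≡ w)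
    × (∀ F G → IsImage φ F G → Γ F ≡ true → Γ' G ≡ true)
    × (∀ G F → IsImage ψ G F → Γ' G ≡ true → Γ F ≡ true)

-- Everything is linear in the face indicator, so the proof works with sums over all subsets. h_i(Γ) is the sum of
-- hWeight n i ∣ F ∣ over the faces F of Γ, and the g_k-weights summed over an interval [X, X ∪ Y] of subsets with
-- ∣ X ∣ + ∣ Y ∣ = n give [∣ X ∣ = k]. The faces of Bier Δ are the pairs P ⊆ C with P ∈ Δ and C ∉ Δ, hence
-- g_k(Bier Δ) = f_k(Δ) − f_{n−k}(Δ), and double counting k-faces inside (n−k)-sets shows that this vanishes only if
-- f_k(Δ) = 0 or f_{n−k}(Δ) = C(n, k).
-- A bistellar i-flip exchanges the faces of [A, A ∪ B] and [B, A ∪ B], where ∣ A ∣ + ∣ B ∣ = n and ∣ B ∣ = i + 1, so it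
-- preserves g_k when i ≤ k − 2; as g_k vanishes on the boundary of a simplex, (3) implies (1). Conversely, the Bier
-- spheres of the ideals {∅} and 2^[n] ∖ {[n]} are boundaries of simplices, and adding (resp. removing) the faces of Δ
-- one at a time, smallest (resp. largest) first, is a sequence of flips of index ∣ F ∣ − 1 (resp. n − 1 − ∣ F ∣),
-- which is at most k − 2 when f_k(Δ) = 0 (resp. f_{n−k}(Δ) = C(n, k)).

{-# OPTIONS --safe #-}
module Submission where

open import Defs
open import Level using (0ℓ)
open import Algebra.Bundles using (CommutativeSemiring)
open import Data.Bool using (Bool; true; false; _∧_; _∨_; not; if_then_else_)
open import Data.Bool.Properties using (∧-comm; ¬-not; ∧-conicalˡ; ∧-conicalʳ; ∧-zeroʳ; ∧-identityʳ; ∨-zeroʳ; ∨-identityʳ; not-involutive)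
import Data.Bool as Bool
open import Data.Nat as ℕ using (ℕ; zero; suc; _∸_; _≤_; _<_; s≤s; z≤n; _≤ᵇ_; _<ᵇ_; _≡ᵇ_; _≤?_; _<?_; ⌊_/2⌋)
import Data.Nat.Properties as ℕP
open import Data.Nat.Combinatorics using (_C_; nCk+nC[k+1]≡[n+1]C[k+1]; nCk≡nC[n∸k])
open import Data.Integer as ℤ using (ℤ; +_; -_)
import Data.Integer.Properties as ℤP
open import Data.Fin using (Fin)
import Data.Fin as Fin
open import Data.Fin.Properties using (any?)
open import Data.Fin.Subset using (Subset; ∁; _⊆_; _⊂_; _∪_; _∩_; _─_; _∈_; Empty; ∣_∣; ⁅_⁆) renaming (⊥ to ∅; ⊤ to full)
open import Data.Fin.Subset.Properties using (_⊆?_; _⊂?_; _∈?_)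
import Data.Fin.Subset.Properties as SP
open import Data.Vec using (Vec; []; _∷_; _++_; take; drop; tabulate)
open import Data.Vec.Properties using (≡-dec)
import Data.Vec.Properties as VP
open import Data.List using (List; foldr; map; upTo; applyUpTo) renaming (_++_ to _++ˡ_; [] to []ˡ; _∷_ to _∷ˡ_)
import Data.List.Properties as LP
open import Data.Nat.ListAction using (sum)
open import Data.Nat.ListAction.Properties using (sum-++)
open import Data.Product using (Σ; ∃; _×_; _,_; proj₁; proj₂)
open import Data.Sum using (_⊎_; inj₁; inj₂; [_,_]′)
open import Data.Empty using (⊥; ⊥-elim)
open import Function using (_∘_; id)
open import Function.Bundles using (_⇔_; mk⇔; Equivalence)
open import Function.Properties.Equivalence using () renaming (trans to ⇔-trans)
open import Relation.Nullary using (¬_; Dec; yes; no; does; _×-dec_)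
open import Relation.Nullary.Decidable using (dec-true; dec-false; does-⇔)
open import Data.Integer.Tactic.RingSolver using (solve-∀)
open import Data.Nat.Tactic.RingSolver using () renaming (solve-∀ to ℕ-solve-∀)
open import Relation.Binary.PropositionalEquality
open import Relation.Binary.Definitions using (tri<; tri≈; tri>)

open Equivalence using (to; from)

-- Booleans and subsets

true≢false : true ≢ false
true≢false ()

not≡true⇒≡false : ∀ {b} → not b ≡ true → b ≡ false
not≡true⇒≡false {false} _ = refl

of-does : ∀ {p} {P : Set p} (P? : Dec P) → does P? ≡ true → P
of-does (yes p) _ = p

∧-true³ : ∀ {a b c} → a ∧ b ∧ c ≡ true → a ≡ true × b ≡ true × c ≡ true
∧-true³ {true} {true} {true} _ = refl , refl , refl

∧-∧-not-true : ∀ {a b c} → a ≡ true → b ≡ true → c ≡ false → a ∧ b ∧ not c ≡ true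
∧-∧-not-true refl refl refl = refl

∧-not-∧-true : ∀ {a b c} → a ≡ true → b ≡ false → c ≡ true → a ∧ not b ∧ c ≡ true
∧-not-∧-true refl refl refl = refl

∧-exclusive₁ : ∀ x y z w → (x ≡ true → y ≡ true → ⊥) → x ∧ (z ∧ y) ∧ w ≡ false
∧-exclusive₁ false y     z w _         = refl
∧-exclusive₁ true  false z w _         rewrite ∧-zeroʳ z = refl
∧-exclusive₁ true  true  z w exclusive = ⊥-elim (exclusive refl refl)

∧-exclusive₂ : ∀ x y z w → (x ≡ true → y ≡ true → ⊥) → x ∧ (y ∧ z) ∧ w ≡ false
∧-exclusive₂ false y     z w _         = refl
∧-exclusive₂ true  false z w _         = refl
∧-exclusive₂ true  true  z w exclusive = ⊥-elim (exclusive refl refl)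

_⊆ᵇ_ _⊂ᵇ_ _==_ : ∀ {N} → Subset N → Subset N → Bool
X ⊆ᵇ Y = does (X ⊆? Y)
X ⊂ᵇ Y = does (X ⊂? Y)
X == Y = does (≡-dec Bool._≟_ X Y)

==-sound : ∀ {N} {X Y : Subset N} → X == Y ≡ true → X ≡ Y
==-sound {X = X} {Y} = of-does (≡-dec Bool._≟_ X Y)

==-complete : ∀ {N} {X Y : Subset N} → X ≡ Y → X == Y ≡ true
==-complete {X = X} {Y} = dec-true (≡-dec Bool._≟_ X Y)

==-refl : ∀ {N} (X : Subset N) → X == X ≡ true
==-refl X = ==-complete {X = X} refl

==-false⇒≢ : ∀ {N} {X Y : Subset N} → X == Y ≡ false → X ≢ Y
==-false⇒≢ X≠Y X≡Y = true≢false (trans (sym (==-complete X≡Y)) X≠Y)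

⊆ᵇ⇒⊆ : ∀ {N} {X Y : Subset N} → X ⊆ᵇ Y ≡ true → X ⊆ Y
⊆ᵇ⇒⊆ {X = X} {Y} = of-does (X ⊆? Y)

⊂ᵇ⇒⊂ : ∀ {N} {X Y : Subset N} → X ⊂ᵇ Y ≡ true → X ⊂ Y
⊂ᵇ⇒⊂ {X = X} {Y} = of-does (X ⊂? Y)

∅⊆ᵇ : ∀ {N} (X : Subset N) → ∅ ⊆ᵇ X ≡ true
∅⊆ᵇ X = dec-true (∅ ⊆? X) (SP.⊆-min X)

⊆ᵇ-refl : ∀ {N} (X : Subset N) → X ⊆ᵇ X ≡ true
⊆ᵇ-refl X = dec-true (X ⊆? X) SP.⊆-refl

⊆ᵇ-trans : ∀ {N} (X Y Z : Subset N) → X ⊆ᵇ Y ≡ true → Y ⊆ᵇ Z ≡ true → X ⊆ᵇ Z ≡ true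
⊆ᵇ-trans X Y Z X⊆Y Y⊆Z = dec-true (X ⊆? Z) (SP.⊆-trans (⊆ᵇ⇒⊆ {X = X} X⊆Y) (⊆ᵇ⇒⊆ {X = Y} Y⊆Z))

⊆ᵇ-antisym : ∀ {N} (X Y : Subset N) → X ⊆ᵇ Y ≡ true → Y ⊆ᵇ X ≡ true → X ≡ Y
⊆ᵇ-antisym X Y X⊆Y Y⊆X = SP.⊆-antisym (⊆ᵇ⇒⊆ {X = X} X⊆Y) (⊆ᵇ⇒⊆ {X = Y} Y⊆X)

⊆ᵇ-full : ∀ {N} (X : Subset N) → X ⊆ᵇ full ≡ true
⊆ᵇ-full X = dec-true (X ⊆? full) SP.⊆⊤

⊆ᵇ-∪ˡ : ∀ {N} (A G : Subset N) → A ⊆ᵇ (A ∪ G) ≡ true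
⊆ᵇ-∪ˡ A G = dec-true (A ⊆? (A ∪ G)) (SP.p⊆p∪q G)

⊆ᵇ-∪ʳ : ∀ {N} (A G : Subset N) → G ⊆ᵇ (A ∪ G) ≡ true
⊆ᵇ-∪ʳ A G = dec-true (G ⊆? (A ∪ G)) (SP.q⊆p∪q A G)

⊂ᵇ≡⊆ᵇ∧not== : ∀ {N} (X Y : Subset N) → X ⊂ᵇ Y ≡ (X ⊆ᵇ Y ∧ not (X == Y))
⊂ᵇ≡⊆ᵇ∧not== []          []          = refl
⊂ᵇ≡⊆ᵇ∧not== (true ∷ X)  (true ∷ Y)  = ⊂ᵇ≡⊆ᵇ∧not== X Y
⊂ᵇ≡⊆ᵇ∧not== (true ∷ X)  (false ∷ Y) = refl
⊂ᵇ≡⊆ᵇ∧not== (false ∷ X) (false ∷ Y) = ⊂ᵇ≡⊆ᵇ∧not== X Y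
⊂ᵇ≡⊆ᵇ∧not== (false ∷ X) (true ∷ Y)  with X ⊆ᵇ Y
... | true  = refl
... | false = refl

⊂ᵇ⇒⊆ᵇ : ∀ {N} (X Y : Subset N) → X ⊂ᵇ Y ≡ true → X ⊆ᵇ Y ≡ true
⊂ᵇ⇒⊆ᵇ X Y X⊂Y rewrite ⊂ᵇ≡⊆ᵇ∧not== X Y = ∧-conicalˡ _ _ X⊂Y

⊂ᵇ⇒not== : ∀ {N} (X Y : Subset N) → X ⊂ᵇ Y ≡ true → X == Y ≡ false
⊂ᵇ⇒not== X Y X⊂Y rewrite ⊂ᵇ≡⊆ᵇ∧not== X Y = trans (sym (not-involutive _)) (cong not (∧-conicalʳ (X ⊆ᵇ Y) _ X⊂Y))

⊆ᵇ∧not==⇒⊂ᵇ : ∀ {N} (X Y : Subset N) → X ⊆ᵇ Y ≡ true → X == Y ≡ false → X ⊂ᵇ Y ≡ true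
⊆ᵇ∧not==⇒⊂ᵇ X Y X⊆Y X≠Y rewrite ⊂ᵇ≡⊆ᵇ∧not== X Y | X⊆Y | X≠Y = refl

∅⊂ᵇ : ∀ {N} (A : Subset N) → 1 ≤ ∣ A ∣ → ∅ ⊂ᵇ A ≡ true
∅⊂ᵇ (true ∷ A)  _     = ∅⊆ᵇ A
∅⊂ᵇ (false ∷ A) 1≤∣A∣ = ∅⊂ᵇ A 1≤∣A∣

==-false-antisym : ∀ {N} (X Y : Subset N) → X == Y ≡ false → X ⊆ᵇ Y ≡ true → Y ⊆ᵇ X ≡ true → ⊥
==-false-antisym X Y X≠Y X⊆Y Y⊆X = ==-false⇒≢ X≠Y (⊆ᵇ-antisym X Y X⊆Y Y⊆X)

⊆ᵇ∅⇒≡∅ : ∀ {N} (G : Subset N) → G ⊆ᵇ ∅ ≡ true → G ≡ ∅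
⊆ᵇ∅⇒≡∅ G G⊆∅ = SP.⊆-antisym (⊆ᵇ⇒⊆ G⊆∅) (SP.⊆-min G)

⊆ᵇ∅≡==∅ : ∀ {N} (P : Subset N) → P ⊆ᵇ ∅ ≡ P == ∅
⊆ᵇ∅≡==∅ []          = refl
⊆ᵇ∅≡==∅ (true ∷ P)  = refl
⊆ᵇ∅≡==∅ (false ∷ P) = ⊆ᵇ∅≡==∅ P

∣X∣≡0⇒X≡∅ : ∀ {N} (X : Subset N) → ∣ X ∣ ≡ 0 → X ≡ ∅
∣X∣≡0⇒X≡∅ []          _ = refl
∣X∣≡0⇒X≡∅ (false ∷ X) e = cong (false ∷_) (∣X∣≡0⇒X≡∅ X e)

∁-involutive : ∀ {N} (X : Subset N) → ∁ (∁ X) ≡ X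
∁-involutive X = trans (sym (VP.map-∘ not not X)) (trans (VP.map-cong not-involutive X) (VP.map-id X))

∁∅ : ∀ {N} → ∁ (∅ {N}) ≡ full
∁∅ {zero}  = refl
∁∅ {suc N} = cong (true ∷_) ∁∅

∁==∅ : ∀ {N} (Q : Subset N) → ∁ Q == ∅ ≡ Q == full
∁==∅ []          = refl
∁==∅ (true ∷ Q)  = ∁==∅ Q
∁==∅ (false ∷ Q) = refl

∁==full : ∀ {N} (Q : Subset N) → ∁ Q == full ≡ Q == ∅
∁==full []          = refl
∁==full (true ∷ Q)  = refl
∁==full (false ∷ Q) = ∁==full Q

⊆ᵇ-∁-swap : ∀ {N} (X Y : Subset N) → X ⊆ᵇ ∁ Y ≡ Y ⊆ᵇ ∁ X
⊆ᵇ-∁-swap []          []          = refl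
⊆ᵇ-∁-swap (true ∷ X)  (true ∷ Y)  = refl
⊆ᵇ-∁-swap (true ∷ X)  (false ∷ Y) = ⊆ᵇ-∁-swap X Y
⊆ᵇ-∁-swap (false ∷ X) (true ∷ Y)  = ⊆ᵇ-∁-swap X Y
⊆ᵇ-∁-swap (false ∷ X) (false ∷ Y) = ⊆ᵇ-∁-swap X Y

∁⊆ᵇ-swap : ∀ {N} (F Q : Subset N) → ∁ F ⊆ᵇ Q ≡ ∁ Q ⊆ᵇ F
∁⊆ᵇ-swap []          []          = refl
∁⊆ᵇ-swap (true ∷ F)  (true ∷ Q)  = ∁⊆ᵇ-swap F Q
∁⊆ᵇ-swap (true ∷ F)  (false ∷ Q) = ∁⊆ᵇ-swap F Q
∁⊆ᵇ-swap (false ∷ F) (true ∷ Q)  = ∁⊆ᵇ-swap F Q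
∁⊆ᵇ-swap (false ∷ F) (false ∷ Q) = refl

==-∁-swap : ∀ {N} (Q F : Subset N) → Q == ∁ F ≡ ∁ Q == F
==-∁-swap []          []          = refl
==-∁-swap (true ∷ Q)  (true ∷ F)  = refl
==-∁-swap (true ∷ Q)  (false ∷ F) = ==-∁-swap Q F
==-∁-swap (false ∷ Q) (true ∷ F)  = ==-∁-swap Q F
==-∁-swap (false ∷ Q) (false ∷ F) = refl

Empty∩⇒⊆ᵇ∁ : ∀ {N} (X Y : Subset N) → Empty (X ∩ Y) → X ⊆ᵇ ∁ Y ≡ true
Empty∩⇒⊆ᵇ∁ X Y empty = dec-true (X ⊆? ∁ Y) (λ x∈X → SP.x∉p⇒x∈∁p (λ x∈Y → empty (_ , SP.x∈p∩q⁺ (x∈X , x∈Y))))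

⊆ᵇ∁⇒Empty∩ : ∀ {N} (X Y : Subset N) → X ⊆ᵇ ∁ Y ≡ true → Empty (X ∩ Y)
⊆ᵇ∁⇒Empty∩ X Y X⊆∁Y (x , x∈X∩Y) =
  let x∈X , x∈Y = SP.x∈p∩q⁻ X Y x∈X∩Y in SP.x∈∁p⇒x∉p (⊆ᵇ⇒⊆ {X = X} X⊆∁Y x∈X) x∈Y

⊆ᵇ∁-sym : ∀ {N} (X Y : Subset N) → X ⊆ᵇ ∁ Y ≡ true → Y ⊆ᵇ ∁ X ≡ true
⊆ᵇ∁-sym X Y X⊆∁Y = trans (⊆ᵇ-∁-swap Y X) X⊆∁Y

∪-monoʳ-⊆ᵇ : ∀ {N} (A G B : Subset N) → G ⊆ᵇ B ≡ true → (A ∪ G) ⊆ᵇ (A ∪ B) ≡ true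
∪-monoʳ-⊆ᵇ []          []          []          _   = refl
∪-monoʳ-⊆ᵇ (true ∷ A)  (false ∷ G) (b ∷ B)     G⊆B = ∪-monoʳ-⊆ᵇ A G B G⊆B
∪-monoʳ-⊆ᵇ (true ∷ A)  (true ∷ G)  (true ∷ B)  G⊆B = ∪-monoʳ-⊆ᵇ A G B G⊆B
∪-monoʳ-⊆ᵇ (false ∷ A) (false ∷ G) (b ∷ B)     G⊆B = ∪-monoʳ-⊆ᵇ A G B G⊆B
∪-monoʳ-⊆ᵇ (false ∷ A) (true ∷ G)  (true ∷ B)  G⊆B = ∪-monoʳ-⊆ᵇ A G B G⊆B

∪-least-⊆ᵇ : ∀ {N} (A B F : Subset N) → A ⊆ᵇ F ≡ true → B ⊆ᵇ F ≡ true → (A ∪ B) ⊆ᵇ F ≡ true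
∪-least-⊆ᵇ []          []          []          _   _   = refl
∪-least-⊆ᵇ (true ∷ A)  (true ∷ B)  (true ∷ F)  A⊆F B⊆F = ∪-least-⊆ᵇ A B F A⊆F B⊆F
∪-least-⊆ᵇ (true ∷ A)  (false ∷ B) (true ∷ F)  A⊆F B⊆F = ∪-least-⊆ᵇ A B F A⊆F B⊆F
∪-least-⊆ᵇ (false ∷ A) (true ∷ B)  (true ∷ F)  A⊆F B⊆F = ∪-least-⊆ᵇ A B F A⊆F B⊆F
∪-least-⊆ᵇ (false ∷ A) (false ∷ B) (f ∷ F)     A⊆F B⊆F = ∪-least-⊆ᵇ A B F A⊆F B⊆F

∪-cancelˡ : ∀ {N} (A G B : Subset N) → A ⊆ᵇ ∁ B ≡ true → G ⊆ᵇ B ≡ true → A ∪ G ≡ A ∪ B → G ≡ B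
∪-cancelˡ []          []          []          _    _   _  = refl
∪-cancelˡ (true ∷ A)  (false ∷ G) (false ∷ B) A⊆∁B G⊆B eq = cong (false ∷_) (∪-cancelˡ A G B A⊆∁B G⊆B (VP.∷-injectiveʳ eq))
∪-cancelˡ (false ∷ A) (true ∷ G)  (true ∷ B)  A⊆∁B G⊆B eq = cong (true ∷_) (∪-cancelˡ A G B A⊆∁B G⊆B (VP.∷-injectiveʳ eq))
∪-cancelˡ (false ∷ A) (false ∷ G) (false ∷ B) A⊆∁B G⊆B eq = cong (false ∷_) (∪-cancelˡ A G B A⊆∁B G⊆B (VP.∷-injectiveʳ eq))
∪-cancelˡ (false ∷ A) (false ∷ G) (true ∷ B)  A⊆∁B G⊆B ()

∪─-id : ∀ {N} (A F : Subset N) → A ⊆ᵇ F ≡ true → F ≡ A ∪ (F ─ A)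
∪─-id []          []          _   = refl
∪─-id (true ∷ A)  (true ∷ F)  A⊆F = cong (true ∷_) (∪─-id A F A⊆F)
∪─-id (false ∷ A) (true ∷ F)  A⊆F = cong (true ∷_) (∪─-id A F A⊆F)
∪─-id (false ∷ A) (false ∷ F) A⊆F = cong (false ∷_) (∪─-id A F A⊆F)

─-⊆ᵇ-∪ : ∀ {N} (A B F : Subset N) → F ⊆ᵇ (A ∪ B) ≡ true → (F ─ A) ⊆ᵇ B ≡ true
─-⊆ᵇ-∪ []          []          []          _      = refl
─-⊆ᵇ-∪ (true ∷ A)  (b ∷ B)     (true ∷ F)  F⊆A∪B = ─-⊆ᵇ-∪ A B F F⊆A∪B
─-⊆ᵇ-∪ (true ∷ A)  (b ∷ B)     (false ∷ F) F⊆A∪B = ─-⊆ᵇ-∪ A B F F⊆A∪B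
─-⊆ᵇ-∪ (false ∷ A) (b ∷ B)     (false ∷ F) F⊆A∪B = ─-⊆ᵇ-∪ A B F F⊆A∪B
─-⊆ᵇ-∪ (false ∷ A) (true ∷ B)  (true ∷ F)  F⊆A∪B = ─-⊆ᵇ-∪ A B F F⊆A∪B

─-⊆ᵇ∁ : ∀ {N} (A F : Subset N) → (F ─ A) ⊆ᵇ ∁ A ≡ true
─-⊆ᵇ∁ []          []          = refl
─-⊆ᵇ∁ (true ∷ A)  (f ∷ F)     = ─-⊆ᵇ∁ A F
─-⊆ᵇ∁ (false ∷ A) (true ∷ F)  = ─-⊆ᵇ∁ A F
─-⊆ᵇ∁ (false ∷ A) (false ∷ F) = ─-⊆ᵇ∁ A F

─-⊆ᵇ : ∀ {N} (A F : Subset N) → (F ─ A) ⊆ᵇ F ≡ true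
─-⊆ᵇ A F = dec-true ((F ─ A) ⊆? F) (SP.p─q⊆p F A)

─-monoˡ-⊆ᵇ : ∀ {N} (B X Y : Subset N) → X ⊆ᵇ Y ≡ true → (X ─ B) ⊆ᵇ (Y ─ B) ≡ true
─-monoˡ-⊆ᵇ []          []          []          _   = refl
─-monoˡ-⊆ᵇ (true ∷ B)  (false ∷ X) (y ∷ Y)     X⊆Y = ─-monoˡ-⊆ᵇ B X Y X⊆Y
─-monoˡ-⊆ᵇ (true ∷ B)  (true ∷ X)  (true ∷ Y)  X⊆Y = ─-monoˡ-⊆ᵇ B X Y X⊆Y
─-monoˡ-⊆ᵇ (false ∷ B) (false ∷ X) (y ∷ Y)     X⊆Y = ─-monoˡ-⊆ᵇ B X Y X⊆Y
─-monoˡ-⊆ᵇ (false ∷ B) (true ∷ X)  (true ∷ Y)  X⊆Y = ─-monoˡ-⊆ᵇ B X Y X⊆Y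

∪─⊆ᵇ : ∀ {N} (F B : Subset N) → ((F ∪ B) ─ B) ⊆ᵇ F ≡ true
∪─⊆ᵇ []          []          = refl
∪─⊆ᵇ (f ∷ F)     (true ∷ B)  = ∪─⊆ᵇ F B
∪─⊆ᵇ (true ∷ F)  (false ∷ B) = ∪─⊆ᵇ F B
∪─⊆ᵇ (false ∷ F) (false ∷ B) = ∪─⊆ᵇ F B

⊆ᵇ-∪-∁ : ∀ {N} (A F B : Subset N) → A ⊆ᵇ (F ∪ B) ≡ true → A ⊆ᵇ ∁ B ≡ true → A ⊆ᵇ F ≡ true
⊆ᵇ-∪-∁ []          []          []          _     _    = refl
⊆ᵇ-∪-∁ (false ∷ A) (f ∷ F)     (true ∷ B)  A⊆F∪B A⊆∁B = ⊆ᵇ-∪-∁ A F B A⊆F∪B A⊆∁B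
⊆ᵇ-∪-∁ (false ∷ A) (f ∷ F)     (false ∷ B) A⊆F∪B A⊆∁B = ⊆ᵇ-∪-∁ A F B A⊆F∪B A⊆∁B
⊆ᵇ-∪-∁ (true ∷ A)  (true ∷ F)  (false ∷ B) A⊆F∪B A⊆∁B = ⊆ᵇ-∪-∁ A F B A⊆F∪B A⊆∁B

∪-cancel-disjoint : ∀ {N} (B G F : Subset N) → G ⊆ᵇ ∁ B ≡ true → F ⊆ᵇ ∁ B ≡ true → B ∪ G ≡ F ∪ B → G ≡ F
∪-cancel-disjoint B G F G⊆∁B F⊆∁B eq = ⊆ᵇ-antisym G F
  (⊆ᵇ-∪-∁ G F B (subst (λ Z → G ⊆ᵇ Z ≡ true) eq (⊆ᵇ-∪ʳ B G)) G⊆∁B)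
  (⊆ᵇ-∪-∁ F G B (subst (λ Z → F ⊆ᵇ Z ≡ true) (trans (sym eq) (SP.∪-comm B G)) (⊆ᵇ-∪ˡ F B)) F⊆∁B)

⊆ᵇ-∪─ : ∀ {N} (A X : Subset N) → X ⊆ᵇ (A ∪ (X ─ A)) ≡ true
⊆ᵇ-∪─ []          []          = refl
⊆ᵇ-∪─ (true ∷ A)  (true ∷ X)  = ⊆ᵇ-∪─ A X
⊆ᵇ-∪─ (true ∷ A)  (false ∷ X) = ⊆ᵇ-∪─ A X
⊆ᵇ-∪─ (false ∷ A) (true ∷ X)  = ⊆ᵇ-∪─ A X
⊆ᵇ-∪─ (false ∷ A) (false ∷ X) = ⊆ᵇ-∪─ A X

∪─-cancel : ∀ {N} (A B : Subset N) → A ⊆ᵇ ∁ B ≡ true → (A ∪ B) ─ A ≡ B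
∪─-cancel []          []          _    = refl
∪─-cancel (true ∷ A)  (false ∷ B) A⊆∁B = cong (false ∷_) (∪─-cancel A B A⊆∁B)
∪─-cancel (false ∷ A) (true ∷ B)  A⊆∁B = cong (true ∷_) (∪─-cancel A B A⊆∁B)
∪─-cancel (false ∷ A) (false ∷ B) A⊆∁B = cong (false ∷_) (∪─-cancel A B A⊆∁B)

∁[∁F∪G]⊆ᵇF : ∀ {N} (F G : Subset N) → ∁ (∁ F ∪ G) ⊆ᵇ F ≡ true
∁[∁F∪G]⊆ᵇF []          []          = refl
∁[∁F∪G]⊆ᵇF (true ∷ F)  (true ∷ G)  = ∁[∁F∪G]⊆ᵇF F G
∁[∁F∪G]⊆ᵇF (true ∷ F)  (false ∷ G) = ∁[∁F∪G]⊆ᵇF F G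
∁[∁F∪G]⊆ᵇF (false ∷ F) (g ∷ G)     = ∁[∁F∪G]⊆ᵇF F G

∁[∁F∪G]⊂ᵇF : ∀ {N} (F G : Subset N) → G ⊆ᵇ F ≡ true → G == ∅ ≡ false → ∁ (∁ F ∪ G) ⊂ᵇ F ≡ true
∁[∁F∪G]⊂ᵇF (true ∷ F)  (true ∷ G)  _   _   = ∁[∁F∪G]⊆ᵇF F G
∁[∁F∪G]⊂ᵇF (true ∷ F)  (false ∷ G) G⊆F G≠∅ = ∁[∁F∪G]⊂ᵇF F G G⊆F G≠∅
∁[∁F∪G]⊂ᵇF (false ∷ F) (false ∷ G) G⊆F G≠∅ = ∁[∁F∪G]⊂ᵇF F G G⊆F G≠∅

∁[∁F∪∅]≡F : ∀ {N} (F : Subset N) → ∁ (∁ F ∪ ∅) ≡ F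
∁[∁F∪∅]≡F F = trans (cong ∁ (SP.∪-identityʳ (∁ F))) (∁-involutive F)

∣∪∣≤ : ∀ {M} (X Y : Subset M) → ∣ X ∪ Y ∣ ≤ ∣ X ∣ ℕ.+ ∣ Y ∣
∣∪∣≤ []          []          = z≤n
∣∪∣≤ (true ∷ X)  (true ∷ Y)  = s≤s (ℕP.≤-trans (∣∪∣≤ X Y) (ℕP.≤-trans (ℕP.n≤1+n _) (ℕP.≤-reflexive (sym (ℕP.+-suc ∣ X ∣ ∣ Y ∣)))))
∣∪∣≤ (true ∷ X)  (false ∷ Y) = s≤s (∣∪∣≤ X Y)
∣∪∣≤ (false ∷ X) (true ∷ Y)  = subst (suc ∣ X ∪ Y ∣ ≤_) (sym (ℕP.+-suc ∣ X ∣ ∣ Y ∣)) (s≤s (∣∪∣≤ X Y))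
∣∪∣≤ (false ∷ X) (false ∷ Y) = ∣∪∣≤ X Y

take-++ : ∀ {A : Set} {m k} (X : Vec A m) (Y : Vec A k) → take m (X ++ Y) ≡ X
take-++ {m = m} X Y = VP.++-injectiveˡ _ X (VP.take++drop≡id m (X ++ Y))

drop-++ : ∀ {A : Set} {m k} (X : Vec A m) (Y : Vec A k) → drop m (X ++ Y) ≡ Y
drop-++ {m = m} X Y = VP.++-injectiveʳ _ X (VP.take++drop≡id m (X ++ Y))

take++drop : ∀ {n} (X : Subset (n ℕ.+ n)) → X ≡ take n X ++ drop n X
take++drop {n} X = sym (VP.take++drop≡id n X)

∣++∣ : ∀ {m k} (X : Subset m) (Y : Subset k) → ∣ X ++ Y ∣ ≡ ∣ X ∣ ℕ.+ ∣ Y ∣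
∣++∣ []          Y = refl
∣++∣ (true ∷ X)  Y = cong suc (∣++∣ X Y)
∣++∣ (false ∷ X) Y = ∣++∣ X Y

⊆ᵇ-++ : ∀ {m k} (X Y : Subset m) (X′ Y′ : Subset k) → (X ++ X′) ⊆ᵇ (Y ++ Y′) ≡ (X ⊆ᵇ Y ∧ X′ ⊆ᵇ Y′)
⊆ᵇ-++ []          []          X′ Y′ = refl
⊆ᵇ-++ (false ∷ X) (y ∷ Y)     X′ Y′ = ⊆ᵇ-++ X Y X′ Y′
⊆ᵇ-++ (true ∷ X)  (true ∷ Y)  X′ Y′ = ⊆ᵇ-++ X Y X′ Y′
⊆ᵇ-++ (true ∷ X)  (false ∷ Y) X′ Y′ = refl

==-++ : ∀ {m k} (X Y : Subset m) (X′ Y′ : Subset k) → (X ++ X′) == (Y ++ Y′) ≡ (X == Y ∧ X′ == Y′)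
==-++ []          []          X′ Y′ = refl
==-++ (false ∷ X) (false ∷ Y) X′ Y′ = ==-++ X Y X′ Y′
==-++ (true ∷ X)  (true ∷ Y)  X′ Y′ = ==-++ X Y X′ Y′
==-++ (true ∷ X)  (false ∷ Y) X′ Y′ = refl
==-++ (false ∷ X) (true ∷ Y)  X′ Y′ = refl

∪-++ : ∀ {m k} (X Y : Subset m) (X′ Y′ : Subset k) → (X ++ X′) ∪ (Y ++ Y′) ≡ (X ∪ Y) ++ (X′ ∪ Y′)
∪-++ []      []      X′ Y′ = refl
∪-++ (x ∷ X) (y ∷ Y) X′ Y′ = cong ((x ∨ y) ∷_) (∪-++ X Y X′ Y′)

∁-++ : ∀ {m k} (X : Subset m) (X′ : Subset k) → ∁ (X ++ X′) ≡ ∁ X ++ ∁ X′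
∁-++ X X′ = VP.map-++ not X X′

subset-of-size : ∀ {N} (S : Subset N) m → m ≤ ∣ S ∣ → Σ (Subset N) λ T → T ⊆ S × ∣ T ∣ ≡ m
subset-of-size []          zero    _         = [] , SP.⊆-refl , refl
subset-of-size {suc N} (true ∷ S) zero _     = ∅ , SP.⊆-min (true ∷ S) , SP.∣⊥∣≡0 (suc N)
subset-of-size (true ∷ S)  (suc m) (s≤s m≤S) = let T , T⊆S , ∣T∣≡m = subset-of-size S m m≤S in true ∷ T , SP.s⊆s T⊆S , cong suc ∣T∣≡m
subset-of-size (false ∷ S) m       m≤S       = let T , T⊆S , ∣T∣≡m = subset-of-size S m m≤S in false ∷ T , SP.s⊆s T⊆S , ∣T∣≡m

superset-of-size : ∀ {N} (T : Subset N) m → ∣ T ∣ ≤ m → m ≤ N → Σ (Subset N) λ S → T ⊆ S × ∣ S ∣ ≡ m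
superset-of-size []          zero    _         _         = [] , SP.⊆-refl , refl
superset-of-size (true ∷ T)  (suc m) (s≤s T≤m) (s≤s m≤N) =
  let S , T⊆S , ∣S∣≡m = superset-of-size T m T≤m m≤N in true ∷ S , SP.s⊆s T⊆S , cong suc ∣S∣≡m
superset-of-size {suc N} (false ∷ T) m T≤m m≤1+N with ∣ T ∣ <? m
... | yes T<m with m
...   | suc m′ = let S , T⊆S , ∣S∣≡m = superset-of-size T m′ (ℕP.≤-pred T<m) (ℕP.≤-pred m≤1+N) in true ∷ S , SP.out⊆ T⊆S , cong suc ∣S∣≡m
superset-of-size {suc N} (false ∷ T) m T≤m m≤1+N | no T≮m =
  let T≡m = ℕP.≤-antisym T≤m (ℕP.≮⇒≥ T≮m)
      S , T⊆S , ∣S∣≡m = superset-of-size T m T≤m (subst (_≤ N) T≡m (SP.∣p∣≤n T))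
  in false ∷ S , SP.s⊆s T⊆S , ∣S∣≡m

DownClosed : ∀ {N} → (Subset N → Bool) → Set
DownClosed {N} Γ = ∀ (S T : Subset N) → S ⊆ T → Γ T ≡ true → Γ S ≡ true

-- Sums over all subsets

module SubsetSums (R : CommutativeSemiring 0ℓ 0ℓ) where

  open CommutativeSemiring R renaming (refl to ≈-refl; sym to ≈-sym; trans to ≈-trans)
  open import Algebra.Properties.CommutativeSemigroup +-commutativeSemigroup using (interchange)

  ∑ : (N : ℕ) → (Subset N → Carrier) → Carrier
  ∑ zero    φ = φ []
  ∑ (suc N) φ = ∑ N (φ ∘ (true ∷_)) + ∑ N (φ ∘ (false ∷_))

  when : Bool → Carrier → Carrier
  when b x = if b then x else 0#

  ⟦_⟧ : Bool → Carrier
  ⟦ b ⟧ = when b 1#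

  ∑-cong : ∀ N {φ ψ : Subset N → Carrier} → (∀ F → φ F ≈ ψ F) → ∑ N φ ≈ ∑ N ψ
  ∑-cong zero    e = e []
  ∑-cong (suc N) e = +-cong (∑-cong N (e ∘ (true ∷_))) (∑-cong N (e ∘ (false ∷_)))

  ∑-zero : ∀ N → ∑ N (λ _ → 0#) ≈ 0#
  ∑-zero zero    = ≈-refl
  ∑-zero (suc N) = ≈-trans (+-cong (∑-zero N) (∑-zero N)) (+-identityˡ 0#)

  ∑-+ : ∀ N (φ ψ : Subset N → Carrier) → ∑ N (λ F → φ F + ψ F) ≈ ∑ N φ + ∑ N ψ
  ∑-+ zero    φ ψ = ≈-refl
  ∑-+ (suc N) φ ψ = ≈-trans (+-cong (∑-+ N _ _) (∑-+ N _ _)) (interchange _ _ _ _)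

  ∑-*ˡ : ∀ N c (φ : Subset N → Carrier) → ∑ N (λ F → c * φ F) ≈ c * ∑ N φ
  ∑-*ˡ zero    c φ = ≈-refl
  ∑-*ˡ (suc N) c φ = ≈-trans (+-cong (∑-*ˡ N c _) (∑-*ˡ N c _)) (≈-sym (distribˡ c _ _))

  ∑-comm : ∀ N M (φ : Subset N → Subset M → Carrier) →
    ∑ N (λ F → ∑ M (φ F)) ≈ ∑ M (λ G → ∑ N (λ F → φ F G))
  ∑-comm zero    M φ = ≈-refl
  ∑-comm (suc N) M φ = ≈-trans (+-cong (∑-comm N M _) (∑-comm N M _)) (≈-sym (∑-+ M _ _))

  ∑-∁ : ∀ N (φ : Subset N → Carrier) → ∑ N (φ ∘ ∁) ≈ ∑ N φ
  ∑-∁ zero    φ = ≈-refl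
  ∑-∁ (suc N) φ = ≈-trans (+-cong (∑-∁ N _) (∑-∁ N _)) (+-comm _ _)

  ∑-++ : ∀ m n (φ : Subset (m ℕ.+ n) → Carrier) → ∑ (m ℕ.+ n) φ ≈ ∑ m (λ X → ∑ n (λ Y → φ (X ++ Y)))
  ∑-++ zero    n φ = ≈-refl
  ∑-++ (suc m) n φ = +-cong (∑-++ m n _) (∑-++ m n _)

  ∑-when-== : ∀ N (S : Subset N) (φ : Subset N → Carrier) → ∑ N (λ F → when (F == S) (φ F)) ≈ φ S
  ∑-when-== zero    []          φ = ≈-refl
  ∑-when-== (suc N) (true ∷ S)  φ = ≈-trans (+-cong (∑-when-== N S _) (∑-zero N)) (+-identityʳ _)
  ∑-when-== (suc N) (false ∷ S) φ = ≈-trans (+-cong (∑-zero N) (∑-when-== N S _)) (+-identityˡ _)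

open SubsetSums ℤP.+-*-commutativeSemiring public
open SubsetSums ℕP.+-*-commutativeSemiring public using () renaming
  (∑ to ∑ℕ; ⟦_⟧ to ⟦_⟧ₙ; ∑-cong to ∑ℕ-cong; ∑-zero to ∑ℕ-zero; ∑-+ to ∑ℕ-+; ∑-*ˡ to ∑ℕ-*ˡ;
   ∑-comm to ∑ℕ-comm; ∑-∁ to ∑ℕ-∁; ∑-when-== to ∑ℕ-when-==)

∑-neg : ∀ N (φ : Subset N → ℤ) → ∑ N (λ F → - φ F) ≡ - ∑ N φ
∑-neg zero    φ = refl
∑-neg (suc N) φ = trans (cong₂ ℤ._+_ (∑-neg N _) (∑-neg N _))
  (sym (ℤP.neg-distrib-+ (∑ N (φ ∘ (true ∷_))) (∑ N (φ ∘ (false ∷_)))))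

∑-minus : ∀ N (φ ψ : Subset N → ℤ) → ∑ N (λ F → φ F ℤ.- ψ F) ≡ ∑ N φ ℤ.- ∑ N ψ
∑-minus N φ ψ = trans (∑-+ N φ (λ F → - ψ F)) (cong (ℤ._+_ (∑ N φ)) (∑-neg N ψ))

pos-∑ℕ : ∀ N (φ : Subset N → ℕ) → + ∑ℕ N φ ≡ ∑ N (+_ ∘ φ)
pos-∑ℕ zero    φ = refl
pos-∑ℕ (suc N) φ = trans (ℤP.pos-+ (∑ℕ N (φ ∘ (true ∷_))) (∑ℕ N (φ ∘ (false ∷_))))
  (cong₂ ℤ._+_ (pos-∑ℕ N _) (pos-∑ℕ N _))

∑-when-false : ∀ N {b : Subset N → Bool} (φ : Subset N → ℤ) → (∀ F → b F ≡ false) →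
  ∑ N (λ F → when (b F) (φ F)) ≡ + 0
∑-when-false N φ b≡false = trans (∑-cong N (λ F → cong (λ b → when b (φ F)) (b≡false F))) (∑-zero N)

∑ℕ-mono-≤ : ∀ N {φ ψ : Subset N → ℕ} → (∀ F → φ F ≤ ψ F) → ∑ℕ N φ ≤ ∑ℕ N ψ
∑ℕ-mono-≤ zero    φ≤ψ = φ≤ψ []
∑ℕ-mono-≤ (suc N) φ≤ψ = ℕP.+-mono-≤ (∑ℕ-mono-≤ N (φ≤ψ ∘ (true ∷_))) (∑ℕ-mono-≤ N (φ≤ψ ∘ (false ∷_)))

∑ℕ-mono-< : ∀ N {φ ψ : Subset N → ℕ} → (∀ F → φ F ≤ ψ F) → ∀ F → φ F < ψ F → ∑ℕ N φ < ∑ℕ N ψ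
∑ℕ-mono-< zero    φ≤ψ []          φ<ψ = φ<ψ
∑ℕ-mono-< (suc N) φ≤ψ (true ∷ F)  φ<ψ =
  ℕP.+-mono-<-≤ (∑ℕ-mono-< N (φ≤ψ ∘ (true ∷_)) F φ<ψ) (∑ℕ-mono-≤ N (φ≤ψ ∘ (false ∷_)))
∑ℕ-mono-< (suc N) φ≤ψ (false ∷ F) φ<ψ =
  ℕP.+-mono-≤-< (∑ℕ-mono-≤ N (φ≤ψ ∘ (true ∷_))) (∑ℕ-mono-< N (φ≤ψ ∘ (false ∷_)) F φ<ψ)

term≤∑ℕ : ∀ N (φ : Subset N → ℕ) F → φ F ≤ ∑ℕ N φ
term≤∑ℕ zero    φ []          = ℕP.≤-refl
term≤∑ℕ (suc N) φ (true ∷ F)  = ℕP.≤-trans (term≤∑ℕ N _ F) (ℕP.m≤m+n _ _)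
term≤∑ℕ (suc N) φ (false ∷ F) = ℕP.≤-trans (term≤∑ℕ N _ F) (ℕP.m≤n+m _ _)

count : ∀ {N} → (Subset N → Bool) → ℕ
count {N} P = ∑ℕ N (λ X → ⟦ P X ⟧ₙ)

count≡0⇒false : ∀ {N} (P : Subset N → Bool) → count P ≡ 0 → ∀ X → P X ≡ false
count≡0⇒false {N} P count≡0 X with P X in PX
... | false = refl
... | true  = ⊥-elim (ℕP.1+n≰n (subst (λ b → ⟦ b ⟧ₙ ≤ 0) PX (subst (_ ≤_) count≡0 (term≤∑ℕ N _ X))))

count≢0⇒witness : ∀ {N} (P : Subset N → Bool) → count P ≢ 0 → ∃ λ X → P X ≡ true
count≢0⇒witness {zero} P count≢0 with P [] in P[]
... | true  = [] , P[]
... | false = ⊥-elim (count≢0 refl)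
count≢0⇒witness {suc N} P count≢0 with count (P ∘ (true ∷_)) ℕ.≟ 0
... | no  ≢0 = let X , PX = count≢0⇒witness _ ≢0 in true ∷ X , PX
... | yes ≡0 = let X , PX = count≢0⇒witness _ (λ ≡0′ → count≢0 (cong₂ ℕ._+_ ≡0 ≡0′)) in false ∷ X , PX

count-false : ∀ {N} (P : Subset N → Bool) → (∀ X → P X ≡ false) → count P ≡ 0
count-false {N} P P≡false = trans (∑ℕ-cong N (λ X → cong ⟦_⟧ₙ (P≡false X))) (∑ℕ-zero N)

count-δ : ∀ {n} (P : Subset n → Bool) (F : Subset n) → P F ≡ true → (P′ : Subset n → Bool) →
  (∀ X → X == F ≡ false → P′ X ≡ P X) → P′ F ≡ false → count P ≡ suc (count P′)
count-δ {n} P F PF P′ P′≗P P′F = begin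
  count P                                       ≡⟨ ∑ℕ-cong n split ⟩
  ∑ℕ n (λ X → ⟦ P′ X ⟧ₙ ℕ.+ ⟦ X == F ⟧ₙ)         ≡⟨ ∑ℕ-+ n _ _ ⟩
  count P′ ℕ.+ ∑ℕ n (λ X → ⟦ X == F ⟧ₙ)         ≡⟨ cong (count P′ ℕ.+_) (∑ℕ-when-== n F (λ _ → 1)) ⟩
  count P′ ℕ.+ 1                                ≡⟨ ℕP.+-comm (count P′) 1 ⟩
  suc (count P′) ∎
  where
  open ≡-Reasoning
  split : ∀ X → ⟦ P X ⟧ₙ ≡ ⟦ P′ X ⟧ₙ ℕ.+ ⟦ X == F ⟧ₙ
  split X with X == F in X≟F
  ... | true  rewrite ==-sound {X = X} X≟F | PF | P′F = refl
  ... | false rewrite P′≗P X X≟F = sym (ℕP.+-identityʳ _)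

foldr-allSubsets : ∀ N (φ : Subset N → ℕ) → foldr ℕ._+_ 0 (map φ (allSubsets N)) ≡ ∑ℕ N φ
foldr-allSubsets zero    φ = ℕP.+-identityʳ _
foldr-allSubsets (suc N) φ = begin
  sum (map φ (map (true ∷_) S ++ˡ map (false ∷_) S))
    ≡⟨ cong sum (LP.map-++ φ (map (true ∷_) S) _) ⟩
  sum (map φ (map (true ∷_) S) ++ˡ map φ (map (false ∷_) S))
    ≡⟨ sum-++ (map φ (map (true ∷_) S)) _ ⟩
  sum (map φ (map (true ∷_) S)) ℕ.+ sum (map φ (map (false ∷_) S))
    ≡⟨ cong₂ ℕ._+_ (cong sum (sym (LP.map-∘ S))) (cong sum (sym (LP.map-∘ S))) ⟩
  sum (map (φ ∘ (true ∷_)) S) ℕ.+ sum (map (φ ∘ (false ∷_)) S)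
    ≡⟨ cong₂ ℕ._+_ (foldr-allSubsets N _) (foldr-allSubsets N _) ⟩
  ∑ℕ (suc N) φ ∎
  where open ≡-Reasoning
        S = allSubsets N

f≡count : ∀ {N} (Γ : Complex N) i → f Γ i ≡ count (λ F → Γ F ∧ (∣ F ∣ ≡ᵇ i))
f≡count {N} Γ i = foldr-allSubsets N _

count-subsets-of-size : ∀ {N} (Y : Subset N) j → count (λ T → T ⊆ᵇ Y ∧ (∣ T ∣ ≡ᵇ j)) ≡ ∣ Y ∣ C j
count-subsets-of-size []          zero    = refl
count-subsets-of-size []          (suc j) = refl
count-subsets-of-size (true ∷ Y)  zero    =
  cong₂ ℕ._+_ (count-false _ (λ T → ∧-zeroʳ (T ⊆ᵇ Y))) (count-subsets-of-size Y zero)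
count-subsets-of-size (true ∷ Y)  (suc j) =
  trans (cong₂ ℕ._+_ (count-subsets-of-size Y j) (count-subsets-of-size Y (suc j))) (nCk+nC[k+1]≡[n+1]C[k+1] ∣ Y ∣ j)
count-subsets-of-size {suc N} (false ∷ Y) j = cong₂ ℕ._+_ (∑ℕ-zero N) (count-subsets-of-size Y j)

count-of-size : ∀ n j → count (λ (X : Subset n) → ∣ X ∣ ≡ᵇ j) ≡ n C j
count-of-size n j = begin
  count (λ (X : Subset n) → ∣ X ∣ ≡ᵇ j)
    ≡⟨ ∑ℕ-cong n (λ X → cong (λ b → ⟦ b ∧ (∣ X ∣ ≡ᵇ j) ⟧ₙ) (sym (dec-true (X ⊆? full) SP.⊆⊤))) ⟩
  count (λ (X : Subset n) → X ⊆ᵇ full ∧ (∣ X ∣ ≡ᵇ j))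
    ≡⟨ count-subsets-of-size (full {n}) j ⟩
  ∣ full {n} ∣ C j
    ≡⟨ cong (_C j) (SP.∣⊤∣≡n n) ⟩
  n C j ∎
  where open ≡-Reasoning

size-indicator : ∀ {N} (X : Subset N) j → ∣ X ∣ ≡ j → (∣ X ∣ ≡ᵇ j) ≡ true
size-indicator X j = dec-true (∣ X ∣ ℕ.≟ j)

pos-⟦∧⟧ : ∀ a b → + ⟦ a ∧ b ⟧ₙ ≡ when a ⟦ b ⟧
pos-⟦∧⟧ false b     = refl
pos-⟦∧⟧ true  false = refl
pos-⟦∧⟧ true  true  = refl

when-∧-not : ∀ a c s (v : ℤ) → when (a ∧ not c ∧ s) v ≡ when (a ∧ s) v ℤ.- when (a ∧ c ∧ s) v
when-∧-not false c     s     v = refl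
when-∧-not true  false false v = refl
when-∧-not true  false true  v = sym (ℤP.+-identityʳ v)
when-∧-not true  true  false v = refl
when-∧-not true  true  true  v = sym (ℤP.+-inverseʳ v)

when-when : ∀ a b (v : ℤ) → when a (when b v) ≡ when (a ∧ b) v
when-when true  b v = refl
when-when false b v = refl

when-⊂ᵇ : ∀ {N} (F S : Subset N) (v : ℤ) → when (F ⊂ᵇ S) v ≡ when (F ⊆ᵇ S) v ℤ.- when (F == S) v
when-⊂ᵇ F S v rewrite ⊂ᵇ≡⊆ᵇ∧not== F S with F == S in F≟S
... | true  rewrite ==-sound {X = F} F≟S | ⊆ᵇ-refl S = sym (ℤP.+-inverseʳ v)
... | false with F ⊆ᵇ S
...   | true  = sym (ℤP.+-identityʳ v)
...   | false = refl

-- The h- and g-vectors as weighted face sums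

-- binomialSum ψ a b = ∑ⱼ (a choose j) · ψ (b + j)
binomialSum : (ℕ → ℤ) → ℕ → ℕ → ℤ
binomialSum ψ zero    b = ψ b
binomialSum ψ (suc a) b = binomialSum ψ a b ℤ.+ binomialSum ψ a (suc b)

binomialSum-minus : ∀ φ ψ a b → binomialSum (λ m → φ m ℤ.- ψ m) a b ≡ binomialSum φ a b ℤ.- binomialSum ψ a b
binomialSum-minus φ ψ zero    b = refl
binomialSum-minus φ ψ (suc a) b =
  trans (cong₂ ℤ._+_ (binomialSum-minus φ ψ a b) (binomialSum-minus φ ψ a (suc b)))
        (interchange-minus (binomialSum φ a b) (binomialSum ψ a b) (binomialSum φ a (suc b)) (binomialSum ψ a (suc b)))
  where interchange-minus : ∀ x y z t → (x ℤ.- y) ℤ.+ (z ℤ.- t) ≡ (x ℤ.+ z) ℤ.- (y ℤ.+ t)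
        interchange-minus = solve-∀

∑-interval : ∀ N (X Y : Subset N) → X ⊆ᵇ Y ≡ true → (ψ : ℕ → ℤ) (c : ℕ) →
  ∑ N (λ F → when (X ⊆ᵇ F ∧ F ⊆ᵇ Y) (ψ (c ℕ.+ ∣ F ∣))) ≡ binomialSum ψ ∣ Y ─ X ∣ (c ℕ.+ ∣ X ∣)
∑-interval zero    []          []          _ ψ c = refl
∑-interval (suc N) (false ∷ X) (false ∷ Y) X⊆Y ψ c =
  trans (cong₂ ℤ._+_ (∑-when-false N _ (λ F → ∧-zeroʳ (X ⊆ᵇ F))) (∑-interval N X Y X⊆Y ψ c)) (ℤP.+-identityˡ _)
∑-interval (suc N) (false ∷ X) (true ∷ Y)  X⊆Y ψ c =
  trans (cong₂ ℤ._+_ (trans (∑-cong N (λ F → cong (λ m → when (X ⊆ᵇ F ∧ F ⊆ᵇ Y) (ψ m)) (ℕP.+-suc c ∣ F ∣)))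
                            (∑-interval N X Y X⊆Y ψ (suc c)))
                     (∑-interval N X Y X⊆Y ψ c))
        (ℤP.+-comm (binomialSum ψ ∣ Y ─ X ∣ (suc c ℕ.+ ∣ X ∣)) (binomialSum ψ ∣ Y ─ X ∣ (c ℕ.+ ∣ X ∣)))
∑-interval (suc N) (true ∷ X)  (true ∷ Y)  X⊆Y ψ c =
  trans (cong₂ ℤ._+_ (trans (∑-cong N (λ F → cong (λ m → when (X ⊆ᵇ F ∧ F ⊆ᵇ Y) (ψ m)) (ℕP.+-suc c ∣ F ∣)))
                            (∑-interval N X Y X⊆Y ψ (suc c)))
                     (∑-zero N))
        (trans (ℤP.+-identityʳ _) (cong (binomialSum ψ ∣ Y ─ X ∣) (sym (ℕP.+-suc c ∣ X ∣))))

∑-subsets : ∀ N (Y : Subset N) (ψ : ℕ → ℤ) c → ∑ N (λ F → when (F ⊆ᵇ Y) (ψ (c ℕ.+ ∣ F ∣))) ≡ binomialSum ψ ∣ Y ∣ c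
∑-subsets N Y ψ c = begin
  ∑ N (λ F → when (F ⊆ᵇ Y) (ψ (c ℕ.+ ∣ F ∣)))
    ≡⟨ ∑-cong N (λ F → cong (λ b → when (b ∧ F ⊆ᵇ Y) (ψ (c ℕ.+ ∣ F ∣))) (sym (∅⊆ᵇ F))) ⟩
  ∑ N (λ F → when (∅ ⊆ᵇ F ∧ F ⊆ᵇ Y) (ψ (c ℕ.+ ∣ F ∣)))
    ≡⟨ ∑-interval N ∅ Y (∅⊆ᵇ Y) ψ c ⟩
  binomialSum ψ (∣ Y ─ ∅ ∣) (c ℕ.+ ∣ (∅ {N}) ∣)
    ≡⟨ cong₂ (binomialSum ψ) (cong ∣_∣ (SP.p─⊥≡p Y)) (trans (cong (c ℕ.+_) (SP.∣⊥∣≡0 N)) (ℕP.+-identityʳ c)) ⟩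
  binomialSum ψ (∣ Y ∣) c ∎
  where open ≡-Reasoning

neg1^-suc : ∀ i b → neg1^ (i ℕ.+ suc b) ≡ - neg1^ (i ℕ.+ b)
neg1^-suc i b = cong neg1^ (ℕP.+-suc i b)

neg1^-double : ∀ i → neg1^ (i ℕ.+ i) ≡ + 1
neg1^-double zero    = refl
neg1^-double (suc i) = trans (cong -_ (neg1^-suc i i)) (trans (ℤP.neg-involutive _) (neg1^-double i))

m∸n≡1+m∸[1+n] : ∀ {m n} → n < m → m ∸ n ≡ suc (m ∸ suc n)
m∸n≡1+m∸[1+n] {suc m} {zero}  _         = refl
m∸n≡1+m∸[1+n] {suc m} {suc n} (s≤s n<m) = m∸n≡1+m∸[1+n] n<m

-- The coefficient of f_m in h_i; the definition of h only sums over m < n.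
hWeight : ℕ → ℕ → ℕ → ℤ
hWeight n i m = if m <ᵇ n then neg1^ (i ℕ.+ m) ℤ.* + ((n ∸ 1 ∸ m) C (n ∸ 1 ∸ i)) else + 0

gWeight : ℕ → ℕ → ℕ → ℤ
gWeight n k m = hWeight n (suc k) m ℤ.- hWeight n k m

hWeightBinomial : ℕ → ℕ → ℕ → ℕ → ℤ
hWeightBinomial n i a b =
  if a ≤ᵇ (n ∸ 1 ∸ i) then neg1^ (i ℕ.+ b) ℤ.* + ((n ∸ 1 ∸ (a ℕ.+ b)) C ((n ∸ 1 ∸ i) ∸ a)) else + 0

binomialSum-hWeight : ∀ n i a b → suc (a ℕ.+ b) ≤ n → binomialSum (hWeight n i) a b ≡ hWeightBinomial n i a b
binomialSum-hWeight n i zero    b a+b<n rewrite dec-true (b <? n) a+b<n = refl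
binomialSum-hWeight n i (suc a) b a+b<n = begin
  binomialSum (hWeight n i) a b ℤ.+ binomialSum (hWeight n i) a (suc b)
    ≡⟨ cong₂ ℤ._+_ (binomialSum-hWeight n i a b (ℕP.<⇒≤ a+b<n))
                   (binomialSum-hWeight n i a (suc b) (subst (λ z → suc z ≤ n) (sym (ℕP.+-suc a b)) a+b<n)) ⟩
  hWeightBinomial n i a b ℤ.+ hWeightBinomial n i a (suc b)
    ≡⟨ sym pascal ⟩
  hWeightBinomial n i (suc a) b ∎
  where
  open ≡-Reasoning
  p = n ∸ 1 ∸ i
  q = n ∸ 1 ∸ (suc a ℕ.+ b)
  s = neg1^ (i ℕ.+ b)
  split : ∀ s x y → s ℤ.* x ≡ s ℤ.* (x ℤ.+ y) ℤ.+ (- s) ℤ.* y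
  split = solve-∀
  cancel : ∀ s → + 0 ≡ s ℤ.* + 1 ℤ.+ (- s) ℤ.* + 1
  cancel = solve-∀
  pascal : hWeightBinomial n i (suc a) b ≡ hWeightBinomial n i a b ℤ.+ hWeightBinomial n i a (suc b)
  pascal with ℕP.<-cmp a p
  ... | tri< a<p _ _
    rewrite dec-true (a ≤? p) (ℕP.<⇒≤ a<p) | dec-true (suc a ≤? p) a<p
          | m∸n≡1+m∸[1+n] {n ∸ 1} {a ℕ.+ b} (ℕP.∸-monoˡ-≤ 1 a+b<n) | cong (n ∸ 1 ∸_) (ℕP.+-suc a b)
          | neg1^-suc i b | m∸n≡1+m∸[1+n] a<p =
    trans (split s (+ (q C (p ∸ suc a))) (+ (q C suc (p ∸ suc a))))
          (cong (λ z → s ℤ.* z ℤ.+ (- s) ℤ.* (+ (q C suc (p ∸ suc a))))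
                (trans (sym (ℤP.pos-+ (q C (p ∸ suc a)) _)) (cong +_ (nCk+nC[k+1]≡[n+1]C[k+1] q (p ∸ suc a)))))
  ... | tri≈ _ refl _
    rewrite dec-true (a ≤? a) ℕP.≤-refl | dec-false (suc a ≤? a) (ℕP.n≮n a)
          | m∸n≡1+m∸[1+n] {n ∸ 1} {a ℕ.+ b} (ℕP.∸-monoˡ-≤ 1 a+b<n) | cong (n ∸ 1 ∸_) (ℕP.+-suc a b)
          | neg1^-suc i b | ℕP.n∸n≡0 a = cancel s
  ... | tri> _ _ p<a
    rewrite dec-false (a ≤? p) (ℕP.<⇒≱ p<a) | dec-false (suc a ≤? p) (ℕP.<⇒≱ (ℕP.m<n⇒m<1+n p<a)) = refl

binomialSum-hWeight-top : ∀ n i → i < n → ∀ a b → a ℕ.+ b ≡ n → binomialSum (hWeight n i) a b ≡ ⟦ b ≤ᵇ i ⟧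
binomialSum-hWeight-top n i i<n zero    b refl rewrite dec-false (b <? b) (ℕP.n≮n b) | dec-false (b ≤? i) (ℕP.<⇒≱ i<n) = refl
binomialSum-hWeight-top n i i<n (suc a) b a+b≡n = begin
  binomialSum (hWeight n i) a b ℤ.+ binomialSum (hWeight n i) a (suc b)
    ≡⟨ cong₂ ℤ._+_ (binomialSum-hWeight n i a b (ℕP.≤-reflexive a+b≡n))
                   (binomialSum-hWeight-top n i i<n a (suc b) (trans (ℕP.+-suc a b) a+b≡n)) ⟩
  hWeightBinomial n i a b ℤ.+ ⟦ suc b ≤ᵇ i ⟧
    ≡⟨ last-step ⟩
  ⟦ b ≤ᵇ i ⟧ ∎
  where
  open ≡-Reasoning
  p = n ∸ 1 ∸ i
  top : n ∸ 1 ∸ (a ℕ.+ b) ≡ 0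
  top = subst (λ z → z ∸ 1 ∸ (a ℕ.+ b) ≡ 0) a+b≡n (ℕP.n∸n≡0 (a ℕ.+ b))
  a+b≡p+i : a ℕ.+ b ≡ p ℕ.+ i
  a+b≡p+i = trans (cong (_∸ 1) a+b≡n) (sym (ℕP.m∸n+n≡m (ℕP.∸-monoˡ-≤ 1 i<n)))
  a<p : i < b → a < p
  a<p i<b = ℕP.+-cancelʳ-< b a p (subst (ℕ._< p ℕ.+ b) (sym a+b≡p+i) (ℕP.+-monoʳ-< p i<b))
  last-step : hWeightBinomial n i a b ℤ.+ ⟦ suc b ≤ᵇ i ⟧ ≡ ⟦ b ≤ᵇ i ⟧
  last-step with ℕP.<-cmp b i
  ... | tri< b<i _ _
    rewrite top | dec-true (b ≤? i) (ℕP.<⇒≤ b<i) | dec-true (suc b ≤? i) b<i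
          | dec-false (a ≤? p) (λ a≤p → ℕP.<⇒≱ b<i (ℕP.+-cancelˡ-≤ p i b (subst (ℕ._≤ p ℕ.+ b) a+b≡p+i (ℕP.+-monoˡ-≤ b a≤p)))) = refl
  ... | tri≈ _ refl _
    rewrite top | dec-true (b ≤? b) ℕP.≤-refl | dec-false (suc b ≤? b) (ℕP.n≮n b) | ℕP.+-cancelʳ-≡ b a p a+b≡p+i
          | dec-true (p ≤? p) ℕP.≤-refl | ℕP.n∸n≡0 p | neg1^-double b = refl
  ... | tri> _ _ i<b
    rewrite top | dec-false (b ≤? i) (ℕP.<⇒≱ i<b) | dec-false (suc b ≤? i) (ℕP.<⇒≱ (ℕP.m<n⇒m<1+n i<b)) with a ≤ᵇ p in a≤ᵇp
  ...   | false = refl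
  ...   | true rewrite m∸n≡1+m∸[1+n] {p ∸ a} {0} (ℕP.m<n⇒0<n∸m (a<p i<b)) =
    trans (ℤP.+-identityʳ _) (ℤP.*-zeroʳ (neg1^ (i ℕ.+ b)))

binomialSum-gWeight-top : ∀ n k → suc k < n → ∀ a b → a ℕ.+ b ≡ n → binomialSum (gWeight n k) a b ≡ ⟦ b ≡ᵇ suc k ⟧
binomialSum-gWeight-top n k k<n a b a+b≡n = begin
  binomialSum (gWeight n k) a b
    ≡⟨ binomialSum-minus (hWeight n (suc k)) (hWeight n k) a b ⟩
  binomialSum (hWeight n (suc k)) a b ℤ.- binomialSum (hWeight n k) a b
    ≡⟨ cong₂ ℤ._-_ (binomialSum-hWeight-top n (suc k) k<n a b a+b≡n)
                   (binomialSum-hWeight-top n k (ℕP.<-trans (ℕP.n<1+n k) k<n) a b a+b≡n) ⟩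
  ⟦ b ≤ᵇ suc k ⟧ ℤ.- ⟦ b ≤ᵇ k ⟧
    ≡⟨ difference ⟩
  ⟦ b ≡ᵇ suc k ⟧ ∎
  where
  open ≡-Reasoning
  difference : ⟦ b ≤ᵇ suc k ⟧ ℤ.- ⟦ b ≤ᵇ k ⟧ ≡ ⟦ b ≡ᵇ suc k ⟧
  difference with ℕP.<-cmp b (suc k)
  ... | tri< b<1+k b≢1+k _
    rewrite dec-true (b ≤? suc k) (ℕP.<⇒≤ b<1+k) | dec-true (b ≤? k) (ℕP.≤-pred b<1+k) | dec-false (b ℕ.≟ suc k) b≢1+k = refl
  ... | tri≈ _ refl _
    rewrite dec-true (b ≤? b) ℕP.≤-refl | dec-false (suc k ≤? k) (ℕP.n≮n k) | dec-true (b ℕ.≟ b) refl = refl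
  ... | tri> _ b≢1+k 1+k<b
    rewrite dec-false (b ≤? suc k) (ℕP.<⇒≱ 1+k<b) | dec-false (b ≤? k) (ℕP.<⇒≱ (ℕP.<-trans (ℕP.n<1+n k) 1+k<b))
          | dec-false (b ℕ.≟ suc k) b≢1+k = refl

faceSum : ∀ {N} → (ℕ → ℤ) → Complex N → ℤ
faceSum {N} ψ Γ = ∑ N (λ F → when (Γ F) (ψ ∣ F ∣))

sum-map-∑ : ∀ N (js : List ℕ) (φ : ℕ → Subset N → ℤ) →
  foldr ℤ._+_ (+ 0) (map (λ j → ∑ N (φ j)) js) ≡ ∑ N (λ F → foldr ℤ._+_ (+ 0) (map (λ j → φ j F) js))
sum-map-∑ N []ˡ       φ = sym (∑-zero N)
sum-map-∑ N (j ∷ˡ js) φ = trans (cong (ℤ._+_ (∑ N (φ j))) (sum-map-∑ N js φ)) (sym (∑-+ N (φ j) _))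

sum-applyUpTo-zero : ∀ n (G : ℕ → ℤ) → (∀ j → G j ≡ + 0) → foldr ℤ._+_ (+ 0) (applyUpTo G n) ≡ + 0
sum-applyUpTo-zero zero    G G≡0 = refl
sum-applyUpTo-zero (suc n) G G≡0 = cong₂ ℤ._+_ (G≡0 0) (sum-applyUpTo-zero n (G ∘ suc) (G≡0 ∘ suc))

sum-applyUpTo-δ : ∀ n (G : ℕ → ℕ → ℤ) → (∀ j → G j 0 ≡ + 0) → ∀ m →
  foldr ℤ._+_ (+ 0) (applyUpTo (λ j → G j ⟦ m ≡ᵇ j ⟧ₙ) n) ≡ (if m <ᵇ n then G m 1 else + 0)
sum-applyUpTo-δ zero    G G0≡0 m       = refl
sum-applyUpTo-δ (suc n) G G0≡0 zero    =
  trans (cong (ℤ._+_ (G 0 1)) (sum-applyUpTo-zero n (λ j → G (suc j) 0) (G0≡0 ∘ suc))) (ℤP.+-identityʳ _)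
sum-applyUpTo-δ (suc n) G G0≡0 (suc m) =
  trans (cong₂ ℤ._+_ (G0≡0 0) (sum-applyUpTo-δ n (G ∘ suc) (G0≡0 ∘ suc) m)) (ℤP.+-identityˡ _)

h≡faceSum : ∀ {N} n (Γ : Complex N) i → i ≤ n ∸ 1 → h n Γ i ≡ faceSum (hWeight n i) Γ
h≡faceSum {N} n Γ i i≤n-1 rewrite dec-true (i ≤? n ∸ 1) i≤n-1 = begin
  foldr ℤ._+_ (+ 0) (map (λ j → neg1^ (i ℕ.+ j) ℤ.* (+ (c j ℕ.* f Γ j))) (upTo n))
    ≡⟨ cong (foldr ℤ._+_ (+ 0)) (LP.map-cong term≡∑ (upTo n)) ⟩
  foldr ℤ._+_ (+ 0) (map (λ j → ∑ N (term j)) (upTo n))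
    ≡⟨ sum-map-∑ N (upTo n) term ⟩
  ∑ N (λ F → foldr ℤ._+_ (+ 0) (map (λ j → term j F) (upTo n)))
    ≡⟨ ∑-cong N terms≡weight ⟩
  faceSum (hWeight n i) Γ ∎
  where
  open ≡-Reasoning
  c : ℕ → ℕ
  c j = (n ∸ 1 ∸ j) C (n ∸ 1 ∸ i)
  G : ℕ → ℕ → ℤ
  G j v = neg1^ (i ℕ.+ j) ℤ.* + (c j ℕ.* v)
  term : ℕ → Subset N → ℤ
  term j F = G j ⟦ Γ F ∧ (∣ F ∣ ≡ᵇ j) ⟧ₙ
  G0≡0 : ∀ j → G j 0 ≡ + 0
  G0≡0 j rewrite ℕP.*-zeroʳ (c j) = ℤP.*-zeroʳ (neg1^ (i ℕ.+ j))
  term≡∑ : ∀ j → G j (f Γ j) ≡ ∑ N (term j)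
  term≡∑ j = begin
    neg1^ (i ℕ.+ j) ℤ.* (+ (c j ℕ.* f Γ j))
      ≡⟨ cong (λ z → neg1^ (i ℕ.+ j) ℤ.* + z) (trans (cong (c j ℕ.*_) (f≡count Γ j)) (sym (∑ℕ-*ˡ N (c j) _))) ⟩
    neg1^ (i ℕ.+ j) ℤ.* (+ ∑ℕ N (λ F → c j ℕ.* ⟦ Γ F ∧ (∣ F ∣ ≡ᵇ j) ⟧ₙ))
      ≡⟨ cong (neg1^ (i ℕ.+ j) ℤ.*_) (pos-∑ℕ N _) ⟩
    neg1^ (i ℕ.+ j) ℤ.* ∑ N (λ F → + (c j ℕ.* ⟦ Γ F ∧ (∣ F ∣ ≡ᵇ j) ⟧ₙ))
      ≡⟨ sym (∑-*ˡ N (neg1^ (i ℕ.+ j)) _) ⟩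
    ∑ N (term j) ∎
  terms≡weight : ∀ F → foldr ℤ._+_ (+ 0) (map (λ j → term j F) (upTo n)) ≡ when (Γ F) (hWeight n i ∣ F ∣)
  terms≡weight F with Γ F
  ... | false = trans (cong (foldr ℤ._+_ (+ 0)) (LP.map-applyUpTo (λ x → x) (λ j → G j 0) n))
                      (sum-applyUpTo-zero n (λ j → G j 0) G0≡0)
  ... | true  = trans (cong (foldr ℤ._+_ (+ 0)) (LP.map-applyUpTo (λ x → x) (λ j → G j ⟦ ∣ F ∣ ≡ᵇ j ⟧ₙ) n))
                      (trans (sum-applyUpTo-δ n G G0≡0 ∣ F ∣) pick)
    where
    pick : (if ∣ F ∣ <ᵇ n then G ∣ F ∣ 1 else + 0) ≡ hWeight n i ∣ F ∣
    pick with ∣ F ∣ <ᵇ n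
    ... | false = refl
    ... | true  = cong (λ z → neg1^ (i ℕ.+ ∣ F ∣) ℤ.* + z) (ℕP.*-identityʳ _)

g≡faceSum : ∀ {N} n (Γ : Complex N) k → suc k ≤ n ∸ 1 → g n Γ (suc k) ≡ faceSum (gWeight n k) Γ
g≡faceSum {N} n Γ k k<n-1 = begin
  h n Γ (suc k) ℤ.- h n Γ k
    ≡⟨ cong₂ ℤ._-_ (h≡faceSum n Γ (suc k) k<n-1) (h≡faceSum n Γ k (ℕP.<⇒≤ k<n-1)) ⟩
  faceSum (hWeight n (suc k)) Γ ℤ.- faceSum (hWeight n k) Γ
    ≡⟨ sym (∑-minus N (λ F → when (Γ F) (hWeight n (suc k) ∣ F ∣)) (λ F → when (Γ F) (hWeight n k ∣ F ∣))) ⟩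
  ∑ N (λ F → when (Γ F) (hWeight n (suc k) ∣ F ∣) ℤ.- when (Γ F) (hWeight n k ∣ F ∣))
    ≡⟨ ∑-cong N when-─ ⟩
  faceSum (gWeight n k) Γ ∎
  where
  open ≡-Reasoning
  when-─ : ∀ F → when (Γ F) (hWeight n (suc k) ∣ F ∣) ℤ.- when (Γ F) (hWeight n k ∣ F ∣) ≡ when (Γ F) (gWeight n k ∣ F ∣)
  when-─ F with Γ F
  ... | true  = refl
  ... | false = refl

-- The g-vector of a Bier sphere

Bier-++ : ∀ {n} (Δ : Subset n → Bool) (X Y : Subset n) → Bier Δ (X ++ Y) ≡ (Δ X ∧ not (Δ (∁ Y)) ∧ X ⊆ᵇ ∁ Y)
Bier-++ Δ X Y rewrite take-++ X Y | drop-++ X Y = refl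

Bier-cong : ∀ {n} (Δ Δ′ : Subset n → Bool) → (∀ X → Δ X ≡ Δ′ X) → ∀ F → Bier Δ F ≡ Bier Δ′ F
Bier-cong {n} Δ Δ′ Δ≗Δ′ F rewrite Δ≗Δ′ (take n F) | Δ≗Δ′ (∁ (drop n F)) = refl

Bier-closed : ∀ {n} (Δ : Subset n → Bool) → DownClosed Δ → DownClosed (Bier Δ)
Bier-closed {n} Δ Δ-closed X Y X⊆Y Y∈Bier
  rewrite take++drop {n} X | take++drop {n} Y | Bier-++ Δ (take n X) (drop n X) | Bier-++ Δ (take n Y) (drop n Y)
  with Δ (take n Y) in tY∈Δ | Δ (∁ (drop n Y)) in ∁dY∈?Δ | take n Y ⊆ᵇ ∁ (drop n Y) in tY⊆∁dY | Y∈Bier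
... | true | false | true | _ = ∧-not-∧-true tX∈Δ ∁dX∉Δ tX⊆∁dX
  where
  parts : (take n X ⊆ᵇ take n Y ∧ drop n X ⊆ᵇ drop n Y) ≡ true
  parts = trans (sym (⊆ᵇ-++ (take n X) (take n Y) (drop n X) (drop n Y)))
                (dec-true ((take n X ++ drop n X) ⊆? (take n Y ++ drop n Y)) X⊆Y)
  tX⊆tY = ∧-conicalˡ (take n X ⊆ᵇ take n Y) _ parts
  ∁dY⊆∁dX : ∁ (drop n Y) ⊆ᵇ ∁ (drop n X) ≡ true
  ∁dY⊆∁dX = dec-true (∁ (drop n Y) ⊆? ∁ (drop n X)) (SP.p⊆q⇒∁p⊇∁q (⊆ᵇ⇒⊆ (∧-conicalʳ (take n X ⊆ᵇ take n Y) _ parts)))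
  tX∈Δ : Δ (take n X) ≡ true
  tX∈Δ = Δ-closed (take n X) (take n Y) (⊆ᵇ⇒⊆ tX⊆tY) tY∈Δ
  ∁dX∉Δ : Δ (∁ (drop n X)) ≡ false
  ∁dX∉Δ = ¬-not (λ ∁dX∈Δ → true≢false (trans (sym (Δ-closed _ _ (⊆ᵇ⇒⊆ ∁dY⊆∁dX) ∁dX∈Δ)) ∁dY∈?Δ))
  tX⊆∁dX : take n X ⊆ᵇ ∁ (drop n X) ≡ true
  tX⊆∁dX = ⊆ᵇ-trans (take n X) (take n Y) (∁ (drop n X)) tX⊆tY (⊆ᵇ-trans (take n Y) (∁ (drop n Y)) (∁ (drop n X)) tY⊆∁dY ∁dY⊆∁dX)

faceSum-Bier-pairs : ∀ {n} (Δ : Subset n → Bool) (ψ : ℕ → ℤ) →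
  faceSum ψ (Bier Δ) ≡ ∑ n (λ X → ∑ n (λ Y → when (Δ X ∧ not (Δ Y) ∧ X ⊆ᵇ Y) (ψ (∣ X ∣ ℕ.+ ∣ ∁ Y ∣))))
faceSum-Bier-pairs {n} Δ ψ = begin
  faceSum ψ (Bier Δ)
    ≡⟨ ∑-++ n n _ ⟩
  ∑ n (λ X → ∑ n (λ Y → when (Bier Δ (X ++ Y)) (ψ ∣ X ++ Y ∣)))
    ≡⟨ ∑-cong n (λ X → ∑-cong n (λ Y → cong₂ when (Bier-++ Δ X Y) (cong ψ (∣++∣ X Y)))) ⟩
  ∑ n (λ X → ∑ n (λ Y → when (Δ X ∧ not (Δ (∁ Y)) ∧ X ⊆ᵇ ∁ Y) (ψ (∣ X ∣ ℕ.+ ∣ Y ∣))))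
    ≡⟨ ∑-cong n (λ X → sym (∑-∁ n _)) ⟩
  ∑ n (λ X → ∑ n (λ Y → when (Δ X ∧ not (Δ (∁ (∁ Y))) ∧ X ⊆ᵇ ∁ (∁ Y)) (ψ (∣ X ∣ ℕ.+ ∣ ∁ Y ∣))))
    ≡⟨ ∑-cong n (λ X → ∑-cong n (λ Y →
         cong (λ Z → when (Δ X ∧ not (Δ Z) ∧ X ⊆ᵇ Z) (ψ (∣ X ∣ ℕ.+ ∣ ∁ Y ∣))) (∁-involutive Y))) ⟩
  ∑ n (λ X → ∑ n (λ Y → when (Δ X ∧ not (Δ Y) ∧ X ⊆ᵇ Y) (ψ (∣ X ∣ ℕ.+ ∣ ∁ Y ∣)))) ∎
  where open ≡-Reasoning

-- Faces of Bier Δ are the pairs X ⊆ Y with X ∈ Δ and Y ∉ Δ; count all pairs with X ∈ Δ and subtract those with Y ∈ Δ.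
faceSum-Bier : ∀ {n} (Δ : Subset n → Bool) → DownClosed Δ → (ψ : ℕ → ℤ) →
  faceSum ψ (Bier Δ) ≡
    ∑ n (λ X → when (Δ X) (binomialSum ψ ∣ ∁ X ∣ ∣ X ∣)) ℤ.- ∑ n (λ Y → when (Δ Y) (binomialSum ψ ∣ Y ∣ ∣ ∁ Y ∣))
faceSum-Bier {n} Δ Δ-closed ψ = begin
  faceSum ψ (Bier Δ)
    ≡⟨ faceSum-Bier-pairs Δ ψ ⟩
  ∑ n (λ X → ∑ n (λ Y → when (Δ X ∧ not (Δ Y) ∧ X ⊆ᵇ Y) (v X Y)))
    ≡⟨ ∑-cong n (λ X → ∑-cong n (λ Y → when-∧-not (Δ X) (Δ Y) (X ⊆ᵇ Y) (v X Y))) ⟩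
  ∑ n (λ X → ∑ n (λ Y → when (Δ X ∧ X ⊆ᵇ Y) (v X Y) ℤ.- when (Δ X ∧ Δ Y ∧ X ⊆ᵇ Y) (v X Y)))
    ≡⟨ ∑-cong n (λ X → ∑-minus n (λ Y → when (Δ X ∧ X ⊆ᵇ Y) (v X Y)) (λ Y → when (Δ X ∧ Δ Y ∧ X ⊆ᵇ Y) (v X Y))) ⟩
  ∑ n (λ X → ∑ n (λ Y → when (Δ X ∧ X ⊆ᵇ Y) (v X Y)) ℤ.- ∑ n (λ Y → when (Δ X ∧ Δ Y ∧ X ⊆ᵇ Y) (v X Y)))
    ≡⟨ ∑-minus n (λ X → ∑ n (λ Y → when (Δ X ∧ X ⊆ᵇ Y) (v X Y))) (λ X → ∑ n (λ Y → when (Δ X ∧ Δ Y ∧ X ⊆ᵇ Y) (v X Y))) ⟩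
  ∑ n (λ X → ∑ n (λ Y → when (Δ X ∧ X ⊆ᵇ Y) (v X Y))) ℤ.- ∑ n (λ X → ∑ n (λ Y → when (Δ X ∧ Δ Y ∧ X ⊆ᵇ Y) (v X Y)))
    ≡⟨ cong₂ ℤ._-_ (∑-cong n supersets) (trans (∑-comm n n _) (∑-cong n subsets)) ⟩
  ∑ n (λ X → when (Δ X) (binomialSum ψ ∣ ∁ X ∣ ∣ X ∣)) ℤ.- ∑ n (λ Y → when (Δ Y) (binomialSum ψ ∣ Y ∣ ∣ ∁ Y ∣)) ∎
  where
  open ≡-Reasoning
  v : Subset n → Subset n → ℤ
  v X Y = ψ (∣ X ∣ ℕ.+ ∣ ∁ Y ∣)
  supersets : ∀ X → ∑ n (λ Y → when (Δ X ∧ X ⊆ᵇ Y) (v X Y)) ≡ when (Δ X) (binomialSum ψ ∣ ∁ X ∣ ∣ X ∣)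
  supersets X with Δ X
  ... | false = ∑-zero n
  ... | true  = begin
    ∑ n (λ Y → when (X ⊆ᵇ Y) (v X Y))
      ≡⟨ sym (∑-∁ n _) ⟩
    ∑ n (λ D → when (X ⊆ᵇ ∁ D) (ψ (∣ X ∣ ℕ.+ ∣ ∁ (∁ D) ∣)))
      ≡⟨ ∑-cong n (λ D → cong₂ (λ b Z → when b (ψ (∣ X ∣ ℕ.+ ∣ Z ∣))) (⊆ᵇ-∁-swap X D) (∁-involutive D)) ⟩
    ∑ n (λ D → when (D ⊆ᵇ ∁ X) (ψ (∣ X ∣ ℕ.+ ∣ D ∣)))
      ≡⟨ ∑-subsets n (∁ X) ψ ∣ X ∣ ⟩
    binomialSum ψ ∣ ∁ X ∣ ∣ X ∣ ∎
  subsets : ∀ Y → ∑ n (λ X → when (Δ X ∧ Δ Y ∧ X ⊆ᵇ Y) (v X Y)) ≡ when (Δ Y) (binomialSum ψ ∣ Y ∣ ∣ ∁ Y ∣)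
  subsets Y with Δ Y in ΔY
  ... | false = ∑-when-false n _ (λ X → ∧-zeroʳ (Δ X))
  ... | true  = trans (∑-cong n face-below) (∑-subsets n Y ψ ∣ ∁ Y ∣)
    where
    face-below : ∀ X → when (Δ X ∧ X ⊆ᵇ Y) (v X Y) ≡ when (X ⊆ᵇ Y) (ψ (∣ ∁ Y ∣ ℕ.+ ∣ X ∣))
    face-below X rewrite ℕP.+-comm ∣ X ∣ ∣ ∁ Y ∣ with X ⊆ᵇ Y in X⊆Y
    ... | false = cong (λ b → when b _) (∧-zeroʳ (Δ X))
    ... | true  rewrite Δ-closed X Y (of-does (X ⊆? Y) X⊆Y) ΔY = refl

∣∁X∣≡ᵇ : ∀ {n} (X : Subset n) j → j ≤ n → (∣ ∁ X ∣ ≡ᵇ j) ≡ (∣ X ∣ ≡ᵇ n ∸ j)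
∣∁X∣≡ᵇ {n} X j j≤n = does-⇔ (mk⇔ to′ from′) (∣ ∁ X ∣ ℕ.≟ j) (∣ X ∣ ℕ.≟ n ∸ j)
  where
  to′ : ∣ ∁ X ∣ ≡ j → ∣ X ∣ ≡ n ∸ j
  to′ e = trans (sym (ℕP.m∸[m∸n]≡n (SP.∣p∣≤n X))) (cong (n ∸_) (trans (sym (SP.∣∁p∣≡n∸∣p∣ X)) e))
  from′ : ∣ X ∣ ≡ n ∸ j → ∣ ∁ X ∣ ≡ j
  from′ e = trans (SP.∣∁p∣≡n∸∣p∣ X) (trans (cong (n ∸_) e) (ℕP.m∸[m∸n]≡n j≤n))

g-Bier : ∀ {n} (Δ : Subset n → Bool) → DownClosed Δ → ∀ k → suc k < n →
  g n (Bier Δ) (suc k) ≡ + f Δ (suc k) ℤ.- + f Δ (n ∸ suc k)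
g-Bier {n} Δ Δ-closed k k<n = begin
  g n (Bier Δ) (suc k)
    ≡⟨ g≡faceSum n (Bier Δ) k (ℕP.∸-monoˡ-≤ 1 k<n) ⟩
  faceSum (gWeight n k) (Bier Δ)
    ≡⟨ faceSum-Bier Δ Δ-closed (gWeight n k) ⟩
  ∑ n (λ X → when (Δ X) (binomialSum (gWeight n k) ∣ ∁ X ∣ ∣ X ∣))
    ℤ.- ∑ n (λ Y → when (Δ Y) (binomialSum (gWeight n k) ∣ Y ∣ ∣ ∁ Y ∣))
    ≡⟨ cong₂ ℤ._-_ (∑-cong n (λ X → cong (when (Δ X)) (binomialSum-gWeight-top n k k<n ∣ ∁ X ∣ ∣ X ∣ (∣∁X∣+∣X∣≡n X))))
                   (∑-cong n (λ Y → cong (when (Δ Y)) (binomialSum-gWeight-top n k k<n ∣ Y ∣ ∣ ∁ Y ∣ (∣X∣+∣∁X∣≡n Y)))) ⟩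
  ∑ n (λ X → when (Δ X) ⟦ ∣ X ∣ ≡ᵇ suc k ⟧) ℤ.- ∑ n (λ Y → when (Δ Y) ⟦ ∣ ∁ Y ∣ ≡ᵇ suc k ⟧)
    ≡⟨ cong₂ ℤ._-_ (sym (count-as-∑ (suc k))) (∑-cong n (λ Y → cong (λ b → when (Δ Y) ⟦ b ⟧) (∣∁X∣≡ᵇ Y (suc k) (ℕP.<⇒≤ k<n)))) ⟩
  + f Δ (suc k) ℤ.- ∑ n (λ Y → when (Δ Y) ⟦ ∣ Y ∣ ≡ᵇ n ∸ suc k ⟧)
    ≡⟨ cong (ℤ._-_ (+ f Δ (suc k))) (sym (count-as-∑ (n ∸ suc k))) ⟩
  + f Δ (suc k) ℤ.- + f Δ (n ∸ suc k) ∎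
  where
  open ≡-Reasoning
  ∣X∣+∣∁X∣≡n : ∀ X → ∣ X ∣ ℕ.+ ∣ ∁ X ∣ ≡ n
  ∣X∣+∣∁X∣≡n X = trans (cong (∣ X ∣ ℕ.+_) (SP.∣∁p∣≡n∸∣p∣ X)) (ℕP.m+[n∸m]≡n (SP.∣p∣≤n X))
  ∣∁X∣+∣X∣≡n : ∀ X → ∣ ∁ X ∣ ℕ.+ ∣ X ∣ ≡ n
  ∣∁X∣+∣X∣≡n X = trans (ℕP.+-comm ∣ ∁ X ∣ ∣ X ∣) (∣X∣+∣∁X∣≡n X)
  count-as-∑ : ∀ j → + f Δ j ≡ ∑ n (λ X → when (Δ X) ⟦ ∣ X ∣ ≡ᵇ j ⟧)
  count-as-∑ j = trans (cong +_ (f≡count Δ j)) (trans (pos-∑ℕ n _) (∑-cong n (λ X → pos-⟦∧⟧ (Δ X) (∣ X ∣ ≡ᵇ j))))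

g-Bier≡0⇔f-balanced : ∀ {n} (Δ : Subset n → Bool) → DownClosed Δ → ∀ k → suc k < n →
  (g n (Bier Δ) (suc k) ≡ + 0) ⇔ (f Δ (suc k) ≡ f Δ (n ∸ suc k))
g-Bier≡0⇔f-balanced {n} Δ Δ-closed k k<n = mk⇔
  (λ g≡0 → ℤP.+-injective (ℤP.i-j≡0⇒i≡j _ _ (trans (sym (g-Bier Δ Δ-closed k k<n)) g≡0)))
  (λ balanced → trans (g-Bier Δ Δ-closed k k<n)
                       (trans (cong (λ m → + m ℤ.- + f Δ (n ∸ suc k)) balanced) (ℤP.+-inverseʳ (+ f Δ (n ∸ suc k)))))

-- Face numbers of an ideal

all-of-size⇒f≡C : ∀ {n} (Δ : Subset n → Bool) j → (∀ X → ∣ X ∣ ≡ j → Δ X ≡ true) → f Δ j ≡ n C j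
all-of-size⇒f≡C {n} Δ j all = trans (f≡count Δ j) (trans (∑ℕ-cong n agree) (count-of-size n j))
  where
  agree : ∀ X → ⟦ Δ X ∧ (∣ X ∣ ≡ᵇ j) ⟧ₙ ≡ ⟦ ∣ X ∣ ≡ᵇ j ⟧ₙ
  agree X with ∣ X ∣ ≡ᵇ j in ∣X∣≡ᵇj
  ... | false = cong ⟦_⟧ₙ (∧-zeroʳ (Δ X))
  ... | true  rewrite all X (of-does (∣ X ∣ ℕ.≟ j) ∣X∣≡ᵇj) = refl

f≡C⇒all-of-size : ∀ {n} (Δ : Subset n → Bool) j → f Δ j ≡ n C j → ∀ X → ∣ X ∣ ≡ j → Δ X ≡ true
f≡C⇒all-of-size {n} Δ j f≡C X ∣X∣≡j with Δ X in X∈?Δ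
... | true  = refl
... | false = ⊥-elim (ℕP.<-irrefl (trans (sym (f≡count Δ j)) (trans f≡C (sym (count-of-size n j)))) fewer)
  where
  fewer : count (λ X → Δ X ∧ (∣ X ∣ ≡ᵇ j)) < count (λ (X : Subset n) → ∣ X ∣ ≡ᵇ j)
  fewer = ∑ℕ-mono-< n (λ Y → ≤ (Δ Y) (∣ Y ∣ ≡ᵇ j)) X (subst (λ b → ⟦ Δ X ∧ b ⟧ₙ < ⟦ b ⟧ₙ) (sym (size-indicator X j ∣X∣≡j))
                                                          (subst (λ b → ⟦ b ∧ true ⟧ₙ < 1) (sym X∈?Δ) ℕP.≤-refl))
    where ≤ : ∀ a b → ⟦ a ∧ b ⟧ₙ ≤ ⟦ b ⟧ₙ
          ≤ true  b     = ℕP.≤-refl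
          ≤ false false = z≤n
          ≤ false true  = z≤n

f≡0⇒none-of-size : ∀ {n} (Δ : Subset n → Bool) j → f Δ j ≡ 0 → ∀ X → ∣ X ∣ ≡ j → Δ X ≡ false
f≡0⇒none-of-size Δ j f≡0 X ∣X∣≡j =
  trans (sym (∧-identityʳ (Δ X)))
        (subst (λ b → (Δ X ∧ b) ≡ false) (size-indicator X j ∣X∣≡j)
               (count≡0⇒false _ (trans (sym (f≡count Δ j)) f≡0) X))

record FaceInNonFace {N} (Δ : Subset N → Bool) (k m : ℕ) : Set where
  constructor faceInNonFace
  field
    T S   : Subset N
    ∣T∣≡k : ∣ T ∣ ≡ k
    ∣S∣≡m : ∣ S ∣ ≡ m
    T⊆S   : T ⊆ S
    T∈Δ   : Δ T ≡ true
    S∉Δ   : Δ S ≡ false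

-- Induction on the ground set: split S₁ and S₂ according to the first point, restricting Δ to its link or
-- its deletion; when S₁ and S₂ disagree on it, a set S″ of size m inside the other part serves as pivot.
face-in-nonFace : ∀ {N} (Δ : Subset N → Bool) → DownClosed Δ → ∀ k m → k < m → (S₁ S₂ : Subset N) →
  ∣ S₁ ∣ ≡ m → ∣ S₂ ∣ ≡ m → Δ S₁ ≡ true → Δ S₂ ≡ false → FaceInNonFace Δ k m
face-in-nonFace {N} Δ Δ-closed zero m _ S₁ S₂ _ ∣S₂∣≡m S₁∈Δ S₂∉Δ =
  faceInNonFace ∅ S₂ (SP.∣⊥∣≡0 N) ∣S₂∣≡m (SP.⊆-min S₂) (Δ-closed ∅ S₁ (SP.⊆-min S₁) S₁∈Δ) S₂∉Δ
face-in-nonFace {zero} Δ Δ-closed (suc k) (suc m) _ [] [] _ _ S₁∈Δ S₂∉Δ with trans (sym S₁∈Δ) S₂∉Δ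
... | ()
face-in-nonFace {suc N} Δ Δ-closed (suc k) (suc m) (s≤s k<m) (true ∷ S₁) (true ∷ S₂) ∣S₁∣≡m ∣S₂∣≡m S₁∈Δ S₂∉Δ =
  let faceInNonFace T S ∣T∣≡k ∣S∣≡m T⊆S T∈Δ S∉Δ =
        face-in-nonFace (Δ ∘ (true ∷_)) (λ S T → Δ-closed (true ∷ S) (true ∷ T) ∘ SP.s⊆s) k m k<m S₁ S₂
                        (ℕP.suc-injective ∣S₁∣≡m) (ℕP.suc-injective ∣S₂∣≡m) S₁∈Δ S₂∉Δ
  in faceInNonFace (true ∷ T) (true ∷ S) (cong suc ∣T∣≡k) (cong suc ∣S∣≡m) (SP.s⊆s T⊆S) T∈Δ S∉Δ
face-in-nonFace {suc N} Δ Δ-closed (suc k) (suc m) k<m (false ∷ S₁) (false ∷ S₂) ∣S₁∣≡m ∣S₂∣≡m S₁∈Δ S₂∉Δ =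
  let faceInNonFace T S ∣T∣≡k ∣S∣≡m T⊆S T∈Δ S∉Δ =
        face-in-nonFace (Δ ∘ (false ∷_)) (λ S T → Δ-closed (false ∷ S) (false ∷ T) ∘ SP.s⊆s) (suc k) (suc m) k<m S₁ S₂
                        ∣S₁∣≡m ∣S₂∣≡m S₁∈Δ S₂∉Δ
  in faceInNonFace (false ∷ T) (false ∷ S) ∣T∣≡k ∣S∣≡m (SP.s⊆s T⊆S) T∈Δ S∉Δ
face-in-nonFace {suc N} Δ Δ-closed (suc k) (suc m) (s≤s k<m) (true ∷ S₁) (false ∷ S₂) ∣S₁∣≡m ∣S₂∣≡m S₁∈Δ S₂∉Δ
  with subset-of-size S₂ m (subst (m ≤_) (sym ∣S₂∣≡m) (ℕP.n≤1+n m))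
... | S″ , S″⊆S₂ , ∣S″∣≡m with Δ (true ∷ S″) in S″∈?Δ
...   | false =
  let faceInNonFace T S ∣T∣≡k ∣S∣≡m T⊆S T∈Δ S∉Δ =
        face-in-nonFace (Δ ∘ (true ∷_)) (λ S T → Δ-closed (true ∷ S) (true ∷ T) ∘ SP.s⊆s) k m k<m S₁ S″
                        (ℕP.suc-injective ∣S₁∣≡m) ∣S″∣≡m S₁∈Δ S″∈?Δ
  in faceInNonFace (true ∷ T) (true ∷ S) (cong suc ∣T∣≡k) (cong suc ∣S∣≡m) (SP.s⊆s T⊆S) T∈Δ S∉Δ
...   | true =
  let T , T⊆S″ , ∣T∣≡k = subset-of-size S″ (suc k) (subst (suc k ≤_) (sym ∣S″∣≡m) k<m)
      S″∈Δ = Δ-closed (false ∷ S″) (true ∷ S″) (SP.out⊆ SP.⊆-refl) S″∈?Δ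
  in faceInNonFace (false ∷ T) (false ∷ S₂) ∣T∣≡k ∣S₂∣≡m (SP.s⊆s (SP.⊆-trans T⊆S″ S″⊆S₂))
                   (Δ-closed (false ∷ T) (false ∷ S″) (SP.s⊆s T⊆S″) S″∈Δ) S₂∉Δ
face-in-nonFace {suc N} Δ Δ-closed (suc k) (suc m) (s≤s k<m) (false ∷ S₁) (true ∷ S₂) ∣S₁∣≡m ∣S₂∣≡m S₁∈Δ S₂∉Δ
  with subset-of-size S₁ m (subst (m ≤_) (sym ∣S₁∣≡m) (ℕP.n≤1+n m))
... | S″ , S″⊆S₁ , ∣S″∣≡m with Δ (true ∷ S″) in S″∈?Δ
...   | true =
  let faceInNonFace T S ∣T∣≡k ∣S∣≡m T⊆S T∈Δ S∉Δ =
        face-in-nonFace (Δ ∘ (true ∷_)) (λ S T → Δ-closed (true ∷ S) (true ∷ T) ∘ SP.s⊆s) k m k<m S″ S₂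
                        ∣S″∣≡m (ℕP.suc-injective ∣S₂∣≡m) S″∈?Δ S₂∉Δ
  in faceInNonFace (true ∷ T) (true ∷ S) (cong suc ∣T∣≡k) (cong suc ∣S∣≡m) (SP.s⊆s T⊆S) T∈Δ S∉Δ
...   | false =
  let T , T⊆S″ , ∣T∣≡k = subset-of-size S″ (suc k) (subst (suc k ≤_) (sym ∣S″∣≡m) k<m)
  in faceInNonFace (false ∷ T) (true ∷ S″) ∣T∣≡k (cong suc ∣S″∣≡m) (SP.out⊆ T⊆S″)
                   (Δ-closed (false ∷ T) (false ∷ S₁) (SP.s⊆s (SP.⊆-trans T⊆S″ S″⊆S₁)) S₁∈Δ) S″∈?Δ

sizedPair : ∀ {n} → ℕ → ℕ → Subset n → Subset n → Bool
sizedPair k m T S = (∣ T ∣ ≡ᵇ k) ∧ (∣ S ∣ ≡ᵇ m) ∧ T ⊆ᵇ S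

count-sizedPairs-below : ∀ {n} k m (S : Subset n) → count (λ T → sizedPair k m T S) ≡ (m C k) ℕ.* ⟦ ∣ S ∣ ≡ᵇ m ⟧ₙ
count-sizedPairs-below {n} k m S with ∣ S ∣ ≡ᵇ m in ∣S∣≡ᵇm
... | false = trans (count-false {n} _ (λ T → ∧-zeroʳ (∣ T ∣ ≡ᵇ k))) (sym (ℕP.*-zeroʳ (m C k)))
... | true  = begin
  count (λ T → (∣ T ∣ ≡ᵇ k) ∧ T ⊆ᵇ S)  ≡⟨ ∑ℕ-cong n (λ T → cong ⟦_⟧ₙ (∧-comm (∣ T ∣ ≡ᵇ k) (T ⊆ᵇ S))) ⟩
  count (λ T → T ⊆ᵇ S ∧ (∣ T ∣ ≡ᵇ k))  ≡⟨ count-subsets-of-size S k ⟩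
  ∣ S ∣ C k                             ≡⟨ cong (_C k) (of-does (∣ S ∣ ℕ.≟ m) ∣S∣≡ᵇm) ⟩
  m C k                                 ≡⟨ sym (ℕP.*-identityʳ (m C k)) ⟩
  (m C k) ℕ.* 1 ∎
  where open ≡-Reasoning

count-sizedPairs-above : ∀ {n} k → k ≤ n → (T : Subset n) →
  count (λ S → sizedPair k (n ∸ k) T S) ≡ ((n ∸ k) C k) ℕ.* ⟦ ∣ T ∣ ≡ᵇ k ⟧ₙ
count-sizedPairs-above {n} k k≤n T with ∣ T ∣ ≡ᵇ k in ∣T∣≡ᵇk
... | false = trans (∑ℕ-zero n) (sym (ℕP.*-zeroʳ ((n ∸ k) C k)))
... | true  = begin
  count (λ S → (∣ S ∣ ≡ᵇ n ∸ k) ∧ T ⊆ᵇ S)      ≡⟨ sym (∑ℕ-∁ n _) ⟩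
  count (λ S → (∣ ∁ S ∣ ≡ᵇ n ∸ k) ∧ T ⊆ᵇ ∁ S)  ≡⟨ ∑ℕ-cong n (λ S → cong ⟦_⟧ₙ (complement S)) ⟩
  count (λ S → S ⊆ᵇ ∁ T ∧ (∣ S ∣ ≡ᵇ k))         ≡⟨ count-subsets-of-size (∁ T) k ⟩
  ∣ ∁ T ∣ C k                                   ≡⟨ cong (_C k) (trans (SP.∣∁p∣≡n∸∣p∣ T) (cong (n ∸_) (of-does (∣ T ∣ ℕ.≟ k) ∣T∣≡ᵇk))) ⟩
  (n ∸ k) C k                                   ≡⟨ sym (ℕP.*-identityʳ ((n ∸ k) C k)) ⟩
  ((n ∸ k) C k) ℕ.* 1 ∎
  where
  open ≡-Reasoning
  complement : ∀ S → ((∣ ∁ S ∣ ≡ᵇ n ∸ k) ∧ T ⊆ᵇ ∁ S) ≡ (S ⊆ᵇ ∁ T ∧ (∣ S ∣ ≡ᵇ k))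
  complement S rewrite ∣∁X∣≡ᵇ S (n ∸ k) (ℕP.m∸n≤m n k) | ℕP.m∸[m∸n]≡n k≤n | ⊆ᵇ-∁-swap T S = ∧-comm (∣ S ∣ ≡ᵇ k) (S ⊆ᵇ ∁ T)

-- Each (n ∸ k)-face contains ((n ∸ k) C k) k-faces and each k-face lies in as many (n ∸ k)-sets;
-- a k-face inside an (n ∸ k)-non-face makes the second count strictly larger.
double-count : ∀ {n} (Δ : Subset n → Bool) → DownClosed Δ → ∀ k → k ≤ n → FaceInNonFace Δ k (n ∸ k) →
  ((n ∸ k) C k) ℕ.* f Δ (n ∸ k) < ((n ∸ k) C k) ℕ.* f Δ k
double-count {n} Δ Δ-closed k k≤n (faceInNonFace T₀ S₀ ∣T₀∣≡k ∣S₀∣≡m T₀⊆S₀ T₀∈Δ S₀∉Δ) = begin-strict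
  c ℕ.* f Δ m                                               ≡⟨ cong (c ℕ.*_) (f≡count Δ m) ⟩
  c ℕ.* count (λ S → Δ S ∧ (∣ S ∣ ≡ᵇ m))                   ≡⟨ sym (∑ℕ-*ˡ n c _) ⟩
  ∑ℕ n (λ S → c ℕ.* ⟦ Δ S ∧ (∣ S ∣ ≡ᵇ m) ⟧ₙ)               ≡⟨ sym (∑ℕ-cong n faces-below) ⟩
  ∑ℕ n (λ S → ∑ℕ n (λ T → ⟦ pair T S ∧ Δ S ⟧ₙ))            ≡⟨ ∑ℕ-comm n n (λ S T → ⟦ pair T S ∧ Δ S ⟧ₙ) ⟩
  ∑ℕ n (λ T → ∑ℕ n (λ S → ⟦ pair T S ∧ Δ S ⟧ₙ))
    <⟨ ∑ℕ-mono-< n (λ T → ∑ℕ-mono-≤ n (λ S → closed T S)) T₀ (∑ℕ-mono-< n (closed T₀) S₀ witness) ⟩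
  ∑ℕ n (λ T → ∑ℕ n (λ S → ⟦ pair T S ∧ Δ T ⟧ₙ))            ≡⟨ ∑ℕ-cong n sets-above ⟩
  ∑ℕ n (λ T → c ℕ.* ⟦ Δ T ∧ (∣ T ∣ ≡ᵇ k) ⟧ₙ)               ≡⟨ ∑ℕ-*ˡ n c _ ⟩
  c ℕ.* count (λ T → Δ T ∧ (∣ T ∣ ≡ᵇ k))                   ≡⟨ cong (c ℕ.*_) (sym (f≡count Δ k)) ⟩
  c ℕ.* f Δ k ∎
  where
  open ℕP.≤-Reasoning
  m = n ∸ k
  c = m C k
  pair = sizedPair k m
  closed : ∀ T S → ⟦ pair T S ∧ Δ S ⟧ₙ ≤ ⟦ pair T S ∧ Δ T ⟧ₙ
  closed T S with pair T S in pairTS | Δ S in S∈?Δ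
  ... | false | _     = z≤n
  ... | true  | false = z≤n
  ... | true  | true  rewrite Δ-closed T S (⊆ᵇ⇒⊆ (∧-conicalʳ (∣ S ∣ ≡ᵇ m) _ (∧-conicalʳ (∣ T ∣ ≡ᵇ k) _ pairTS))) S∈?Δ = ℕP.≤-refl
  witness : ⟦ pair T₀ S₀ ∧ Δ S₀ ⟧ₙ < ⟦ pair T₀ S₀ ∧ Δ T₀ ⟧ₙ
  witness rewrite size-indicator T₀ k ∣T₀∣≡k | size-indicator S₀ m ∣S₀∣≡m | dec-true (T₀ ⊆? S₀) T₀⊆S₀ | T₀∈Δ | S₀∉Δ = ℕP.≤-refl
  faces-below : ∀ S → ∑ℕ n (λ T → ⟦ pair T S ∧ Δ S ⟧ₙ) ≡ c ℕ.* ⟦ Δ S ∧ (∣ S ∣ ≡ᵇ m) ⟧ₙ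
  faces-below S with Δ S
  ... | false = trans (count-false {n} _ (λ T → ∧-zeroʳ (pair T S))) (sym (ℕP.*-zeroʳ c))
  ... | true  = trans (∑ℕ-cong n (λ T → cong ⟦_⟧ₙ (∧-identityʳ (pair T S)))) (count-sizedPairs-below k m S)
  sets-above : ∀ T → ∑ℕ n (λ S → ⟦ pair T S ∧ Δ T ⟧ₙ) ≡ c ℕ.* ⟦ Δ T ∧ (∣ T ∣ ≡ᵇ k) ⟧ₙ
  sets-above T with Δ T
  ... | false = trans (count-false {n} _ (λ S → ∧-zeroʳ (pair T S))) (sym (ℕP.*-zeroʳ c))
  ... | true  = trans (∑ℕ-cong n (λ S → cong ⟦_⟧ₙ (∧-identityʳ (pair T S)))) (count-sizedPairs-above k k≤n T)

face-of-size : ∀ {n} (Δ : Subset n → Bool) j → f Δ j ≢ 0 → Σ (Subset n) λ X → ∣ X ∣ ≡ j × Δ X ≡ true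
face-of-size Δ j f≢0 =
  let X , X∈Δ∧∣X∣≡j = count≢0⇒witness _ (λ count≡0 → f≢0 (trans (f≡count Δ j) count≡0))
  in X , of-does (∣ X ∣ ℕ.≟ j) (∧-conicalʳ (Δ X) _ X∈Δ∧∣X∣≡j) , ∧-conicalˡ _ _ X∈Δ∧∣X∣≡j

f≡0-upward : ∀ {n} (Δ : Subset n → Bool) → DownClosed Δ → ∀ {k m} → k ≤ m → f Δ k ≡ 0 → f Δ m ≡ 0
f≡0-upward Δ Δ-closed {k} {m} k≤m fk≡0 with f Δ m ℕ.≟ 0
... | yes fm≡0 = fm≡0
... | no  fm≢0 =
  let X , ∣X∣≡m , X∈Δ = face-of-size Δ m fm≢0
      T , T⊆X , ∣T∣≡k = subset-of-size X k (subst (k ≤_) (sym ∣X∣≡m) k≤m)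
  in ⊥-elim (true≢false (trans (sym (Δ-closed T X T⊆X X∈Δ)) (f≡0⇒none-of-size Δ k fk≡0 T ∣T∣≡k)))

f≡C-downward : ∀ {n} (Δ : Subset n → Bool) → DownClosed Δ → ∀ {k m} → k ≤ m → m ≤ n → f Δ m ≡ n C m → f Δ k ≡ n C k
f≡C-downward Δ Δ-closed {k} {m} k≤m m≤n fm≡C = all-of-size⇒f≡C Δ k all-k
  where
  all-k : ∀ X → ∣ X ∣ ≡ k → Δ X ≡ true
  all-k X ∣X∣≡k =
    let S , X⊆S , ∣S∣≡m = superset-of-size X m (subst (_≤ m) (sym ∣X∣≡k) k≤m) m≤n
    in Δ-closed X S X⊆S (f≡C⇒all-of-size Δ m fm≡C S ∣S∣≡m)

extremal⇒f-balanced : ∀ {n} (Δ : Subset n → Bool) → DownClosed Δ → ∀ k → k ≤ n ∸ k →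
  f Δ k ≡ 0 ⊎ f Δ (n ∸ k) ≡ n C k → f Δ k ≡ f Δ (n ∸ k)
extremal⇒f-balanced Δ Δ-closed k k≤m (inj₁ fk≡0) = trans fk≡0 (sym (f≡0-upward Δ Δ-closed k≤m fk≡0))
extremal⇒f-balanced {n} Δ Δ-closed k k≤m (inj₂ fm≡C) =
  trans (f≡C-downward Δ Δ-closed k≤m (ℕP.m∸n≤m n k) (trans fm≡C nCk≡nCm)) (trans nCk≡nCm (sym (trans fm≡C nCk≡nCm)))
  where nCk≡nCm = nCk≡nC[n∸k] (ℕP.≤-trans k≤m (ℕP.m∸n≤m n k))

f-balanced⇒extremal : ∀ {n} (Δ : Subset n → Bool) → DownClosed Δ → ∀ k → k < n ∸ k →
  f Δ k ≡ f Δ (n ∸ k) → f Δ k ≡ 0 ⊎ f Δ (n ∸ k) ≡ n C k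
f-balanced⇒extremal {n} Δ Δ-closed k k<m fk≡fm with f Δ k ℕ.≟ 0
... | yes fk≡0 = inj₁ fk≡0
... | no  fk≢0 with count (λ X → (∣ X ∣ ≡ᵇ n ∸ k) ∧ not (Δ X)) ℕ.≟ 0
...   | yes none = inj₂ (trans (all-of-size⇒f≡C Δ (n ∸ k) all-m) (sym (nCk≡nC[n∸k] k≤n)))
  where
  k≤n = ℕP.≤-trans (ℕP.<⇒≤ k<m) (ℕP.m∸n≤m n k)
  all-m : ∀ X → ∣ X ∣ ≡ n ∸ k → Δ X ≡ true
  all-m X ∣X∣≡m with Δ X in X∈?Δ
  ... | true  = refl
  ... | false = ⊥-elim (true≢false (trans (sym counted) (count≡0⇒false _ none X)))
    where counted : ((∣ X ∣ ≡ᵇ n ∸ k) ∧ not (Δ X)) ≡ true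
          counted rewrite size-indicator X (n ∸ k) ∣X∣≡m | X∈?Δ = refl
...   | no  some =
  let S₁ , ∣S₁∣≡m , S₁∈Δ = face-of-size Δ (n ∸ k) (λ fm≡0 → fk≢0 (trans fk≡fm fm≡0))
      S₂ , S₂-counted = count≢0⇒witness _ some
      violation = face-in-nonFace Δ Δ-closed k (n ∸ k) k<m S₁ S₂ ∣S₁∣≡m
                    (of-does (∣ S₂ ∣ ℕ.≟ n ∸ k) (∧-conicalˡ _ _ S₂-counted))
                    S₁∈Δ (not≡true⇒≡false (∧-conicalʳ (∣ S₂ ∣ ≡ᵇ n ∸ k) _ S₂-counted))
  in ⊥-elim (ℕP.<-irrefl (cong (((n ∸ k) C k) ℕ.*_) (sym fk≡fm))
                         (double-count Δ Δ-closed k (ℕP.≤-trans (ℕP.<⇒≤ k<m) (ℕP.m∸n≤m n k)) violation))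

f-balanced⇔extremal : ∀ {n} (Δ : Subset n → Bool) → DownClosed Δ → ∀ k → k < n ∸ k →
  (f Δ k ≡ f Δ (n ∸ k)) ⇔ (f Δ k ≡ 0 ⊎ f Δ (n ∸ k) ≡ n C k)
f-balanced⇔extremal Δ Δ-closed k k<m =
  mk⇔ (f-balanced⇒extremal Δ Δ-closed k k<m) (extremal⇒f-balanced Δ Δ-closed k (ℕP.<⇒≤ k<m))

-- Bistellar flips

Removed Added : ∀ {N} → Subset N → Subset N → Subset N → Set
Removed A B F = ∃ λ G → G ⊂ B × F ≡ A ∪ G
Added   A B F = ∃ λ F′ → F′ ⊂ A × F ≡ F′ ∪ B

Added⇒Removed : ∀ {N} (A B F : Subset N) → Added A B F → Removed B A F
Added⇒Removed A B F (F′ , F′⊂A , F≡F′∪B) = F′ , F′⊂A , trans F≡F′∪B (SP.∪-comm F′ B)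

Removed⇒Added : ∀ {N} (A B F : Subset N) → Removed B A F → Added A B F
Removed⇒Added A B F (F′ , F′⊂A , F≡B∪F′) = F′ , F′⊂A , trans F≡B∪F′ (SP.∪-comm B F′)

strictlyBetween : ∀ {N} → Subset N → Subset N → Subset N → Bool
strictlyBetween A B F = A ⊆ᵇ F ∧ F ⊆ᵇ (A ∪ B) ∧ not (F == (A ∪ B))

Removed⇒strictlyBetween : ∀ {N} (A B F : Subset N) → A ⊆ᵇ ∁ B ≡ true → Removed A B F → strictlyBetween A B F ≡ true
Removed⇒strictlyBetween A B F A⊆∁B (G , G⊂B , refl) =
  ∧-∧-not-true (⊆ᵇ-∪ˡ A G) (∪-monoʳ-⊆ᵇ A G B (⊂ᵇ⇒⊆ᵇ G B G⊂ᵇB)) A∪G≠A∪B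
  where
  G⊂ᵇB : G ⊂ᵇ B ≡ true
  G⊂ᵇB = dec-true (G ⊂? B) G⊂B
  A∪G≠A∪B : (A ∪ G) == (A ∪ B) ≡ false
  A∪G≠A∪B with (A ∪ G) == (A ∪ B) in eq
  ... | false = refl
  ... | true  = ⊥-elim (==-false⇒≢ (⊂ᵇ⇒not== G B G⊂ᵇB) (∪-cancelˡ A G B A⊆∁B (⊂ᵇ⇒⊆ᵇ G B G⊂ᵇB) (==-sound eq)))

strictlyBetween⇒Removed : ∀ {N} (A B F : Subset N) → strictlyBetween A B F ≡ true → Removed A B F
strictlyBetween⇒Removed A B F between with A ⊆ᵇ F in A⊆F | F ⊆ᵇ (A ∪ B) in F⊆A∪B | F == (A ∪ B) in F≟A∪B
strictlyBetween⇒Removed A B F refl | true | true | false =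
  F ─ A , ⊂ᵇ⇒⊂ (⊆ᵇ∧not==⇒⊂ᵇ (F ─ A) B (─-⊆ᵇ-∪ A B F F⊆A∪B) F─A≠B) , ∪─-id A F A⊆F
  where
  F─A≠B : (F ─ A) == B ≡ false
  F─A≠B with (F ─ A) == B in eq
  ... | false = refl
  ... | true  = ⊥-elim (==-false⇒≢ F≟A∪B (trans (∪─-id A F A⊆F) (cong (A ∪_) (==-sound eq))))

strictlyBetween⇒⊆ᵇ : ∀ {N} (A B F : Subset N) → strictlyBetween A B F ≡ true → A ⊆ᵇ F ∧ F ⊆ᵇ (A ∪ B) ≡ true
strictlyBetween⇒⊆ᵇ A B F between with A ⊆ᵇ F | F ⊆ᵇ (A ∪ B) | between
... | true | true | _ = refl

module FlipFaces {N d i} {Γ Γ′ : Complex N} (flip : Flip d i Γ Γ′) (Γ-closed : DownClosed Γ) where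

  open Flip flip

  A⊆∁B : A ⊆ᵇ ∁ B ≡ true
  A⊆∁B = Empty∩⇒⊆ᵇ∁ A B disjoint

  B⊆∁A : B ⊆ᵇ ∁ A ≡ true
  B⊆∁A = ⊆ᵇ∁-sym A B A⊆∁B

  inRem inAdd : Subset N → Bool
  inRem F = A ⊆ᵇ F ∧ F ⊆ᵇ (A ∪ B)
  inAdd F = B ⊆ᵇ F ∧ F ⊆ᵇ (B ∪ A)

  Γ-above-B : ∀ F → B ⊆ᵇ F ≡ true → Γ F ≡ false
  Γ-above-B F B⊆F with Γ F in F∈?Γ
  ... | false = refl
  ... | true  = ⊥-elim (true≢false (trans (sym (Γ-closed B F (⊆ᵇ⇒⊆ B⊆F) F∈?Γ)) B∉Γ))

  Removed⇒Γ : ∀ F → Removed A B F → Γ F ≡ true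
  Removed⇒Γ F (G , G⊂B , refl) = proj₂ (from (link G) G⊂B)

  Removed⇒inRem : ∀ F → Removed A B F → inRem F ≡ true
  Removed⇒inRem F removed = strictlyBetween⇒⊆ᵇ A B F (Removed⇒strictlyBetween A B F A⊆∁B removed)

  Added⇒inAdd : ∀ F → Added A B F → inAdd F ≡ true
  Added⇒inAdd F added = strictlyBetween⇒⊆ᵇ B A F (Removed⇒strictlyBetween B A F B⊆∁A (Added⇒Removed A B F added))

  not-Γ′ : ∀ F → ¬ (Γ F ≡ true × ¬ Removed A B F) → ¬ Added A B F → Γ′ F ≡ false
  not-Γ′ F not-kept not-added = ¬-not (λ F∈Γ′ → [ not-kept , not-added ]′ (to (result F) F∈Γ′))

  inRem⇒Removed : ∀ F → F == (A ∪ B) ≡ false → inRem F ≡ true → Removed A B F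
  inRem⇒Removed F F≠A∪B F∈rem =
    strictlyBetween⇒Removed A B F (∧-∧-not-true (∧-conicalˡ (A ⊆ᵇ F) _ F∈rem) (∧-conicalʳ (A ⊆ᵇ F) _ F∈rem) F≠A∪B)

  inAdd⇒Added : ∀ F → F == (A ∪ B) ≡ false → inAdd F ≡ true → Added A B F
  inAdd⇒Added F F≠A∪B F∈add = Removed⇒Added A B F (strictlyBetween⇒Removed B A F
    (∧-∧-not-true (∧-conicalˡ (B ⊆ᵇ F) _ F∈add) (∧-conicalʳ (B ⊆ᵇ F) _ F∈add) (subst (λ Z → F == Z ≡ false) (SP.∪-comm A B) F≠A∪B)))

  inRem∧inAdd⇒top : ∀ F → inRem F ≡ true → inAdd F ≡ true → F == (A ∪ B) ≡ true
  inRem∧inAdd⇒top F F∈rem F∈add = ==-complete {X = F}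
    (⊆ᵇ-antisym F (A ∪ B) (∧-conicalʳ (A ⊆ᵇ F) _ F∈rem) (∪-least-⊆ᵇ A B F (∧-conicalˡ (A ⊆ᵇ F) _ F∈rem) (∧-conicalˡ (B ⊆ᵇ F) _ F∈add)))

  top-not-Added : ∀ F → F == (A ∪ B) ≡ true → ¬ Added A B F
  top-not-Added F F≡A∪B added with Removed⇒strictlyBetween B A F B⊆∁A (Added⇒Removed A B F added)
  ... | between rewrite ==-sound {X = F} F≡A∪B | SP.∪-comm B A | ⊆ᵇ-∪ʳ A B | ⊆ᵇ-refl (A ∪ B) | ==-refl (A ∪ B) = true≢false (sym between)

  -- The closed intervals [A, A ∪ B] and [B, A ∪ B] share their top A ∪ B, which lies in neither Γ nor Γ′.
  when-Γ′ : ∀ F (v : ℤ) → when (Γ′ F) v ≡ (when (Γ F) v ℤ.+ when (inAdd F) v) ℤ.- when (inRem F) v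
  when-Γ′ F v with F == (A ∪ B) in F≟A∪B | inRem F in F∈?rem | inAdd F in F∈?add
  ... | true  | true  | true
    rewrite not-Γ′ F (λ (F∈Γ , _) → true≢false (trans (sym F∈Γ) (Γ-above-B F (∧-conicalˡ (B ⊆ᵇ F) _ F∈?add)))) (top-not-Added F F≟A∪B)
          | Γ-above-B F (∧-conicalˡ (B ⊆ᵇ F) _ F∈?add) = sym (trans (cong (ℤ._- v) (ℤP.+-identityˡ v)) (ℤP.+-inverseʳ v))
  ... | true  | false | _     = ⊥-elim (true≢false (trans (sym (top∈rem (==-sound {X = F} F≟A∪B))) F∈?rem))
    where top∈rem : F ≡ A ∪ B → inRem F ≡ true
          top∈rem refl rewrite ⊆ᵇ-∪ˡ A B | ⊆ᵇ-refl (A ∪ B) = refl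
  ... | true  | true  | false = ⊥-elim (true≢false (trans (sym (top∈add (==-sound {X = F} F≟A∪B))) F∈?add))
    where top∈add : F ≡ A ∪ B → inAdd F ≡ true
          top∈add refl rewrite ⊆ᵇ-∪ʳ A B | SP.∪-comm B A | ⊆ᵇ-refl (A ∪ B) = refl
  ... | false | true  | true  = ⊥-elim (true≢false (trans (sym (inRem∧inAdd⇒top F F∈?rem F∈?add)) F≟A∪B))
  ... | false | true  | false
    rewrite Removed⇒Γ F (inRem⇒Removed F F≟A∪B F∈?rem)
          | not-Γ′ F (λ (_ , not-removed) → not-removed (inRem⇒Removed F F≟A∪B F∈?rem))
                     (λ added → true≢false (trans (sym (Added⇒inAdd F added)) F∈?add)) =
    sym (trans (cong (ℤ._- v) (ℤP.+-identityʳ v)) (ℤP.+-inverseʳ v))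
  ... | false | false | true
    rewrite from (result F) (inj₂ (inAdd⇒Added F F≟A∪B F∈?add)) | Γ-above-B F (∧-conicalˡ (B ⊆ᵇ F) _ F∈?add) =
    sym (trans (ℤP.+-identityʳ (+ 0 ℤ.+ v)) (ℤP.+-identityˡ v))
  ... | false | false | false with Γ F in F∈?Γ
  ...   | true
    rewrite from (result F) (inj₁ (F∈?Γ , λ removed → true≢false (trans (sym (Removed⇒inRem F removed)) F∈?rem))) =
    sym (trans (ℤP.+-identityʳ (v ℤ.+ + 0)) (ℤP.+-identityʳ v))
  ...   | false
    rewrite not-Γ′ F (λ (F∈Γ , _) → true≢false (trans (sym F∈Γ) F∈?Γ))
                     (λ added → true≢false (trans (sym (Added⇒inAdd F added)) F∈?add)) = refl

  ⊂A⇒not-⊇A : ∀ F′ → F′ ⊂ A → ¬ (A ⊆ᵇ F′ ≡ true)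
  ⊂A⇒not-⊇A F′ F′⊂A A⊆F′ = SP.⊂-irref refl (SP.⊂-⊆-trans F′⊂A (⊆ᵇ⇒⊆ A⊆F′))

  Γ′-closed : DownClosed Γ′
  Γ′-closed X Y X⊆Y Y∈Γ′ with to (result Y) Y∈Γ′
  ... | inj₁ (Y∈Γ , Y-kept) = from (result X) (inj₁ (Γ-closed X Y X⊆Y Y∈Γ , X-kept))
    where
    X-kept : ¬ Removed A B X
    X-kept removed = Y-kept (Y ─ A , to (link (Y ─ A)) (⊆ᵇ∁⇒Empty∩ (Y ─ A) A (─-⊆ᵇ∁ A Y) , subst (λ Z → Γ Z ≡ true) Y≡A∪Y─A Y∈Γ) , Y≡A∪Y─A)
      where
      A⊆Y : A ⊆ᵇ Y ≡ true
      A⊆Y = ⊆ᵇ-trans A X Y (∧-conicalˡ (A ⊆ᵇ X) _ (Removed⇒inRem X removed)) (dec-true (X ⊆? Y) X⊆Y)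
      Y≡A∪Y─A = ∪─-id A Y A⊆Y
  ... | inj₂ (F′ , F′⊂A , refl) with B ⊆ᵇ X in B⊆X
  ...   | true  = from (result X) (inj₂ (X ─ B , ⊂ᵇ⇒⊂ (⊆ᵇ∧not==⇒⊂ᵇ (X ─ B) A X─B⊆A X─B≠A) , X≡X─B∪B))
    where
    X─B⊆F′ : (X ─ B) ⊆ᵇ F′ ≡ true
    X─B⊆F′ = ⊆ᵇ-trans (X ─ B) ((F′ ∪ B) ─ B) F′ (─-monoˡ-⊆ᵇ B X (F′ ∪ B) (dec-true (X ⊆? (F′ ∪ B)) X⊆Y)) (∪─⊆ᵇ F′ B)
    X─B⊆A : (X ─ B) ⊆ᵇ A ≡ true
    X─B⊆A = ⊆ᵇ-trans (X ─ B) F′ A X─B⊆F′ (dec-true (F′ ⊆? A) (SP.p⊂q⇒p⊆q F′⊂A))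
    X─B≠A : (X ─ B) == A ≡ false
    X─B≠A with (X ─ B) == A in eq
    ... | false = refl
    ... | true  = ⊥-elim (⊂A⇒not-⊇A F′ F′⊂A (subst (λ Z → Z ⊆ᵇ F′ ≡ true) (==-sound {X = X ─ B} eq) X─B⊆F′))
    X≡X─B∪B : X ≡ (X ─ B) ∪ B
    X≡X─B∪B = trans (∪─-id B X B⊆X) (SP.∪-comm B (X ─ B))
  ...   | false = from (result X) (inj₁ (X∈Γ , X-kept))
    where
    X⊆A∪B : X ⊆ᵇ (A ∪ B) ≡ true
    X⊆A∪B = ⊆ᵇ-trans X (F′ ∪ B) (A ∪ B) (dec-true (X ⊆? (F′ ∪ B)) X⊆Y)
              (subst₂ (λ P Q → P ⊆ᵇ Q ≡ true) (SP.∪-comm B F′) (SP.∪-comm B A)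
                      (∪-monoʳ-⊆ᵇ B F′ A (dec-true (F′ ⊆? A) (SP.p⊂q⇒p⊆q F′⊂A))))
    X─A≠B : (X ─ A) == B ≡ false
    X─A≠B with (X ─ A) == B in eq
    ... | false = refl
    ... | true  = sym (trans (sym B⊆X) (subst (λ Z → Z ⊆ᵇ X ≡ true) (==-sound {X = X ─ A} eq) (─-⊆ᵇ A X)))
    X∈Γ : Γ X ≡ true
    X∈Γ = Γ-closed X (A ∪ (X ─ A)) (⊆ᵇ⇒⊆ (⊆ᵇ-∪─ A X))
            (proj₂ (from (link (X ─ A)) (⊂ᵇ⇒⊂ (⊆ᵇ∧not==⇒⊂ᵇ (X ─ A) B (─-⊆ᵇ-∪ A B X X⊆A∪B) X─A≠B))))
    X-kept : ¬ Removed A B X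
    X-kept removed = ⊂A⇒not-⊇A F′ F′⊂A
      (⊆ᵇ-∪-∁ A F′ B (⊆ᵇ-trans A X (F′ ∪ B) (∧-conicalˡ (A ⊆ᵇ X) _ (Removed⇒inRem X removed)) (dec-true (X ⊆? (F′ ∪ B)) X⊆Y)) A⊆∁B)

  faceSum-flip : ∀ ψ → faceSum ψ Γ′ ≡ (faceSum ψ Γ ℤ.+ binomialSum ψ ∣ A ∣ ∣ B ∣) ℤ.- binomialSum ψ ∣ B ∣ ∣ A ∣
  faceSum-flip ψ = begin
    faceSum ψ Γ′
      ≡⟨ ∑-cong N (λ F → when-Γ′ F (ψ ∣ F ∣)) ⟩
    ∑ N (λ F → (when (Γ F) (ψ ∣ F ∣) ℤ.+ when (inAdd F) (ψ ∣ F ∣)) ℤ.- when (inRem F) (ψ ∣ F ∣))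
      ≡⟨ ∑-minus N _ (λ F → when (inRem F) (ψ ∣ F ∣)) ⟩
    ∑ N (λ F → when (Γ F) (ψ ∣ F ∣) ℤ.+ when (inAdd F) (ψ ∣ F ∣)) ℤ.- ∑ N (λ F → when (inRem F) (ψ ∣ F ∣))
      ≡⟨ cong (ℤ._- ∑ N (λ F → when (inRem F) (ψ ∣ F ∣))) (∑-+ N (λ F → when (Γ F) (ψ ∣ F ∣)) (λ F → when (inAdd F) (ψ ∣ F ∣))) ⟩
    (faceSum ψ Γ ℤ.+ ∑ N (λ F → when (inAdd F) (ψ ∣ F ∣))) ℤ.- ∑ N (λ F → when (inRem F) (ψ ∣ F ∣))
      ≡⟨ cong₂ (λ a r → (faceSum ψ Γ ℤ.+ a) ℤ.- r) (interval B A B⊆∁A) (interval A B A⊆∁B) ⟩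
    (faceSum ψ Γ ℤ.+ binomialSum ψ ∣ A ∣ ∣ B ∣) ℤ.- binomialSum ψ ∣ B ∣ ∣ A ∣ ∎
    where
    open ≡-Reasoning
    interval : ∀ X Y → X ⊆ᵇ ∁ Y ≡ true →
      ∑ N (λ F → when (X ⊆ᵇ F ∧ F ⊆ᵇ (X ∪ Y)) (ψ ∣ F ∣)) ≡ binomialSum ψ ∣ Y ∣ ∣ X ∣
    interval X Y X⊆∁Y = trans (∑-interval N X (X ∪ Y) (⊆ᵇ-∪ˡ X Y) ψ 0) (cong (λ Z → binomialSum ψ ∣ Z ∣ ∣ X ∣) (∪─-cancel X Y X⊆∁Y))

Flip-reverse : ∀ {N d i} {Γ Γ′ : Complex N} → Flip d i Γ Γ′ → DownClosed Γ → Flip d (d ∸ i) Γ′ Γ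
Flip-reverse {N} {d} {i} {Γ} {Γ′} flip Γ-closed = record
  { A        = B
  ; B        = A
  ; i≤d      = ℕP.m∸n≤m d i
  ; cardA    = trans cardB (cong (ℕ._+ 1) (sym (ℕP.m∸[m∸n]≡n i≤d)))
  ; cardB    = cardA
  ; disjoint = ⊆ᵇ∁⇒Empty∩ B A B⊆∁A
  ; A∈Γ      = from (result B) (inj₂ (∅ , ⊂ᵇ⇒⊂ (∅⊂ᵇ A A-nonempty) , sym (SP.∪-identityˡ B)))
  ; link     = λ G → mk⇔ (link-to G) (link-from G)
  ; B∉Γ      = A∉Γ′
  ; result   = λ X → mk⇔ (result-to X) (result-from X) }
  where
  open Flip flip
  open FlipFaces flip Γ-closed using (A⊆∁B; B⊆∁A; Removed⇒Γ; Γ-above-B)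
  A-nonempty : 1 ≤ ∣ A ∣
  A-nonempty = subst (1 ≤_) (sym (trans cardA (ℕP.+-comm _ 1))) (s≤s z≤n)
  B-nonempty : 1 ≤ ∣ B ∣
  B-nonempty = subst (1 ≤_) (sym (trans cardB (ℕP.+-comm i 1))) (s≤s z≤n)
  ⊂A⇒⊆ᵇ∁B : ∀ G → G ⊂ A → G ⊆ᵇ ∁ B ≡ true
  ⊂A⇒⊆ᵇ∁B G G⊂A = ⊆ᵇ-trans G A (∁ B) (dec-true (G ⊆? A) (SP.p⊂q⇒p⊆q G⊂A)) A⊆∁B
  link-to : ∀ G → (Empty (G ∩ B) × Γ′ (B ∪ G) ≡ true) → G ⊂ A
  link-to G (G∩B-empty , B∪G∈Γ′) with to (result (B ∪ G)) B∪G∈Γ′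
  ... | inj₁ (B∪G∈Γ , _)       = ⊥-elim (true≢false (trans (sym B∪G∈Γ) (Γ-above-B (B ∪ G) (⊆ᵇ-∪ˡ B G))))
  ... | inj₂ (F′ , F′⊂A , eq) =
    subst (_⊂ A) (sym (∪-cancel-disjoint B G F′ (Empty∩⇒⊆ᵇ∁ G B G∩B-empty) (⊂A⇒⊆ᵇ∁B F′ F′⊂A) eq)) F′⊂A
  link-from : ∀ G → G ⊂ A → Empty (G ∩ B) × Γ′ (B ∪ G) ≡ true
  link-from G G⊂A = ⊆ᵇ∁⇒Empty∩ G B (⊂A⇒⊆ᵇ∁B G G⊂A) , from (result (B ∪ G)) (inj₂ (G , G⊂A , SP.∪-comm B G))
  A∉Γ′ : Γ′ A ≡ false
  A∉Γ′ = ¬-not A∈Γ′-impossible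
    where
    A∈Γ′-impossible : ¬ (Γ′ A ≡ true)
    A∈Γ′-impossible A∈Γ′ with to (result A) A∈Γ′
    ... | inj₁ (_ , A-kept) = A-kept (∅ , ⊂ᵇ⇒⊂ (∅⊂ᵇ B B-nonempty) , sym (SP.∪-identityʳ A))
    ... | inj₂ (F′ , _ , A≡F′∪B) = ℕP.<-irrefl refl (ℕP.<-≤-trans B-nonempty (ℕP.≤-trans (SP.p⊆q⇒∣p∣≤∣q∣ B⊆∅) (ℕP.≤-reflexive (SP.∣⊥∣≡0 N))))
      where
      B⊆∅ : B ⊆ ∅
      B⊆∅ x∈B = ⊥-elim (SP.x∈∁p⇒x∉p (⊆ᵇ⇒⊆ B⊆∁A x∈B) (subst (_ ∈_) (sym A≡F′∪B) (SP.q⊆p∪q F′ B x∈B)))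
  result-to : ∀ X → Γ X ≡ true → (Γ′ X ≡ true × ¬ Removed B A X) ⊎ Added B A X
  result-to X X∈Γ with strictlyBetween A B X in X-between
  ... | true  = inj₂ (Removed⇒Added B A X (strictlyBetween⇒Removed A B X X-between))
  ... | false = inj₁ (from (result X) (inj₁ (X∈Γ , X-kept)) , X-not-added)
    where
    X-kept : ¬ Removed A B X
    X-kept removed = true≢false (trans (sym (Removed⇒strictlyBetween A B X A⊆∁B removed)) X-between)
    X-not-added : ¬ Removed B A X
    X-not-added (G , _ , refl) = true≢false (trans (sym X∈Γ) (Γ-above-B (B ∪ G) (⊆ᵇ-∪ˡ B G)))
  result-from : ∀ X → (Γ′ X ≡ true × ¬ Removed B A X) ⊎ Added B A X → Γ X ≡ true
  result-from X (inj₁ (X∈Γ′ , X-kept)) with to (result X) X∈Γ′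
  ... | inj₁ (X∈Γ , _) = X∈Γ
  ... | inj₂ added     = ⊥-elim (X-kept (Added⇒Removed A B X added))
  result-from X (inj₂ added) = Removed⇒Γ X (Added⇒Removed B A X added)

Flip-congˡ : ∀ {N d i} {Γ₁ Γ₂ Γ′ : Complex N} → (∀ X → Γ₁ X ≡ Γ₂ X) → Flip d i Γ₁ Γ′ → Flip d i Γ₂ Γ′
Flip-congˡ {Γ₁ = Γ₁} {Γ₂} {Γ′} Γ₁≗Γ₂ flip = record
  { A = A ; B = B ; i≤d = i≤d ; cardA = cardA ; cardB = cardB ; disjoint = disjoint
  ; A∈Γ    = trans (sym (Γ₁≗Γ₂ A)) A∈Γ
  ; link   = λ G → ⇔-trans (mk⇔ (λ (G∩A-empty , A∪G∈Γ₂) → G∩A-empty , trans (Γ₁≗Γ₂ (A ∪ G)) A∪G∈Γ₂)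
                                (λ (G∩A-empty , A∪G∈Γ₁) → G∩A-empty , trans (sym (Γ₁≗Γ₂ (A ∪ G))) A∪G∈Γ₁))
                           (link G)
  ; B∉Γ    = trans (sym (Γ₁≗Γ₂ B)) B∉Γ
  ; result = λ F → ⇔-trans (result F) (mk⇔ (kept-in (sym ∘ Γ₁≗Γ₂) F) (kept-in Γ₁≗Γ₂ F)) }
  where
  open Flip flip
  kept-in : ∀ {Γ Γ* : Complex _} → (∀ X → Γ* X ≡ Γ X) → ∀ F →
    (Γ F ≡ true × ¬ Removed A B F) ⊎ Added A B F → (Γ* F ≡ true × ¬ Removed A B F) ⊎ Added A B F
  kept-in Γ*≗Γ F (inj₁ (F∈Γ , F-kept)) = inj₁ (trans (Γ*≗Γ F) F∈Γ , F-kept)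
  kept-in Γ*≗Γ F (inj₂ added)          = inj₂ added

Flips-congˡ : ∀ {N d m} {Γ₁ Γ₂ Γ : Complex N} → (∀ X → Γ₁ X ≡ Γ₂ X) → Flips d m Γ₁ Γ →
  Σ (Complex N) λ Γ′ → Flips d m Γ₂ Γ′ × (∀ X → Γ′ X ≡ Γ X)
Flips-congˡ {Γ₂ = Γ₂} Γ₁≗Γ₂ done                = Γ₂ , done , sym ∘ Γ₁≗Γ₂
Flips-congˡ           Γ₁≗Γ₂ (step i i≤m flip flips) = _ , step i i≤m (Flip-congˡ Γ₁≗Γ₂ flip) flips , λ _ → refl

BoundarySimplex-closed : ∀ {N} (S : Subset N) → DownClosed (BoundarySimplex S)
BoundarySimplex-closed S X Y X⊆Y Y⊂S = dec-true (X ⊂? S) (SP.⊆-⊂-trans X⊆Y (⊂ᵇ⇒⊂ Y⊂S))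

faceSum-gWeight-boundary : ∀ {N} n k → suc k < n → (S : Subset N) → ∣ S ∣ ≡ n →
  faceSum (gWeight n k) (BoundarySimplex S) ≡ + 0
faceSum-gWeight-boundary {N} n k k<n S ∣S∣≡n = begin
  ∑ N (λ F → when (F ⊂ᵇ S) (ω ∣ F ∣))
    ≡⟨ ∑-cong N (λ F → when-⊂ᵇ F S (ω ∣ F ∣)) ⟩
  ∑ N (λ F → when (F ⊆ᵇ S) (ω ∣ F ∣) ℤ.- when (F == S) (ω ∣ F ∣))
    ≡⟨ ∑-minus N (λ F → when (F ⊆ᵇ S) (ω ∣ F ∣)) (λ F → when (F == S) (ω ∣ F ∣)) ⟩
  ∑ N (λ F → when (F ⊆ᵇ S) (ω ∣ F ∣)) ℤ.- ∑ N (λ F → when (F == S) (ω ∣ F ∣))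
    ≡⟨ cong₂ ℤ._-_ (∑-subsets N S ω 0) (∑-when-== N S (ω ∘ ∣_∣)) ⟩
  binomialSum ω (∣ S ∣) 0 ℤ.- ω (∣ S ∣)
    ≡⟨ cong (λ s → binomialSum ω s 0 ℤ.- ω s) ∣S∣≡n ⟩
  binomialSum ω n 0 ℤ.- ω n
    ≡⟨ cong₂ ℤ._-_ (binomialSum-gWeight-top n k k<n n 0 (ℕP.+-identityʳ n)) ω-top ⟩
  + 0 ∎
  where
  open ≡-Reasoning
  ω = gWeight n k
  ω-top : ω n ≡ + 0
  ω-top rewrite dec-false (n <? n) (ℕP.n≮n n) = refl

∣A∣+∣B∣≡n : ∀ {N n i} {Γ Γ′ : Complex N} → 2 ≤ n → (flip : Flip (n ∸ 2) i Γ Γ′) → ∣ Flip.A flip ∣ ℕ.+ ∣ Flip.B flip ∣ ≡ n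
∣A∣+∣B∣≡n {n = n} {i} 2≤n flip = begin
  ∣ A ∣ ℕ.+ ∣ B ∣               ≡⟨ cong₂ ℕ._+_ cardA cardB ⟩
  (n ∸ 2 ∸ i ℕ.+ 1) ℕ.+ (i ℕ.+ 1) ≡⟨ regroup (n ∸ 2 ∸ i) i ⟩
  (n ∸ 2 ∸ i ℕ.+ i) ℕ.+ 2       ≡⟨ cong (ℕ._+ 2) (ℕP.m∸n+n≡m i≤d) ⟩
  n ∸ 2 ℕ.+ 2                   ≡⟨ ℕP.m∸n+n≡m 2≤n ⟩
  n ∎
  where
  open ≡-Reasoning
  open Flip flip
  regroup : ∀ a b → (a ℕ.+ 1) ℕ.+ (b ℕ.+ 1) ≡ (a ℕ.+ b) ℕ.+ 2
  regroup = ℕ-solve-∀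

-- A flip exchanges the faces of [A, A ∪ B] and [B, A ∪ B]; when ∣ B ∣ < K < ∣ A ∣ neither interval meets g_K.
faceSum-gWeight-flip : ∀ {N n m i} {Γ Γ′ : Complex N} → suc (suc m) ℕ.+ suc (suc m) < n → i ≤ m →
  Flip (n ∸ 2) i Γ Γ′ → DownClosed Γ → faceSum (gWeight n (suc m)) Γ′ ≡ faceSum (gWeight n (suc m)) Γ
faceSum-gWeight-flip {n = n} {m} {i} {Γ} {Γ′} 2K<n i≤m flip Γ-closed = begin
  faceSum ω Γ′
    ≡⟨ FlipFaces.faceSum-flip flip Γ-closed ω ⟩
  (faceSum ω Γ ℤ.+ binomialSum ω ∣ A ∣ ∣ B ∣) ℤ.- binomialSum ω ∣ B ∣ ∣ A ∣
    ≡⟨ cong₂ (λ a b → (faceSum ω Γ ℤ.+ a) ℤ.- b)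
             (trans (binomialSum-gWeight-top n (suc m) K<n ∣ A ∣ ∣ B ∣ ∣A∣+∣B∣≡n′) (cong ⟦_⟧ (dec-false (∣ B ∣ ℕ.≟ K) (ℕP.<⇒≢ B<K))))
             (trans (binomialSum-gWeight-top n (suc m) K<n ∣ B ∣ ∣ A ∣ ∣B∣+∣A∣≡n) (cong ⟦_⟧ (dec-false (∣ A ∣ ℕ.≟ K) (ℕP.>⇒≢ K<A)))) ⟩
  (faceSum ω Γ ℤ.+ + 0) ℤ.- + 0
    ≡⟨ trans (ℤP.+-identityʳ _) (ℤP.+-identityʳ _) ⟩
  faceSum ω Γ ∎
  where
  open ≡-Reasoning
  open Flip flip
  K = suc (suc m)
  ω = gWeight n (suc m)
  K<n : K < n
  K<n = ℕP.<-≤-trans (ℕP.m<m+n K (s≤s z≤n)) (ℕP.<⇒≤ 2K<n)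
  ∣A∣+∣B∣≡n′ : ∣ A ∣ ℕ.+ ∣ B ∣ ≡ n
  ∣A∣+∣B∣≡n′ = ∣A∣+∣B∣≡n (ℕP.≤-trans (s≤s (s≤s z≤n)) (ℕP.<⇒≤ K<n)) flip
  ∣B∣+∣A∣≡n : ∣ B ∣ ℕ.+ ∣ A ∣ ≡ n
  ∣B∣+∣A∣≡n = trans (ℕP.+-comm ∣ B ∣ ∣ A ∣) ∣A∣+∣B∣≡n′
  B<K : ∣ B ∣ < K
  B<K = subst (_< K) (sym (trans cardB (ℕP.+-comm i 1))) (s≤s (s≤s i≤m))
  K<A : K < ∣ A ∣
  K<A = ℕP.≰⇒> (λ A≤K → ℕP.<-irrefl refl (ℕP.<-≤-trans 2K<n (subst (_≤ K ℕ.+ K) ∣A∣+∣B∣≡n′ (ℕP.+-mono-≤ A≤K (ℕP.<⇒≤ B<K)))))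

faceSum-gWeight-flips : ∀ {N n m} {Γ Γ″ : Complex N} → suc (suc m) ℕ.+ suc (suc m) < n →
  Flips (n ∸ 2) m Γ Γ″ → DownClosed Γ → DownClosed Γ″ × faceSum (gWeight n (suc m)) Γ″ ≡ faceSum (gWeight n (suc m)) Γ
faceSum-gWeight-flips 2K<n done                    Γ-closed = Γ-closed , refl
faceSum-gWeight-flips 2K<n (step i i≤m flip flips) Γ-closed =
  let Γ″-closed , same = faceSum-gWeight-flips 2K<n flips (FlipFaces.Γ′-closed flip Γ-closed)
  in Γ″-closed , trans same (faceSum-gWeight-flip 2K<n i≤m flip Γ-closed)

-- Isomorphic complexes

image : ∀ {N M} → (Fin N → Fin M) → Subset N → Subset M
image φ F = tabulate (λ w → does (any? (λ v → v ∈? F ×-dec φ v Fin.≟ w)))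

image-isImage : ∀ {N M} (φ : Fin N → Fin M) F → IsImage φ F (image φ F)
image-isImage φ F w = mk⇔
  (λ w∈image → of-does (any? _) (trans (sym (VP.lookup∘tabulate _ w)) (VP.[]=⇒lookup w∈image)))
  (λ preimage → VP.lookup⇒[]= w _ (trans (VP.lookup∘tabulate _ w) (dec-true (any? _) preimage)))

∣image∣≤ : ∀ {N M} (φ : Fin N → Fin M) F → ∣ image φ F ∣ ≤ ∣ F ∣
∣image∣≤ {zero} {M} φ [] = ℕP.≤-trans (SP.p⊆q⇒∣p∣≤∣q∣ image⊆∅) (ℕP.≤-reflexive (SP.∣⊥∣≡0 M))
  where image⊆∅ : image φ [] ⊆ ∅
        image⊆∅ {w} w∈image with to (image-isImage φ [] w) w∈image
        ... | () , _
∣image∣≤ {suc N} φ (true ∷ F) = begin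
  ∣ image φ (true ∷ F) ∣                   ≤⟨ SP.p⊆q⇒∣p∣≤∣q∣ image⊆ ⟩
  ∣ ⁅ φ Fin.zero ⁆ ∪ image (φ ∘ Fin.suc) F ∣ ≤⟨ ∣∪∣≤ ⁅ φ Fin.zero ⁆ (image (φ ∘ Fin.suc) F) ⟩
  ∣ ⁅ φ Fin.zero ⁆ ∣ ℕ.+ ∣ image (φ ∘ Fin.suc) F ∣ ≡⟨ cong (ℕ._+ ∣ image (φ ∘ Fin.suc) F ∣) (SP.∣⁅x⁆∣≡1 (φ Fin.zero)) ⟩
  suc ∣ image (φ ∘ Fin.suc) F ∣            ≤⟨ s≤s (∣image∣≤ (φ ∘ Fin.suc) F) ⟩
  suc ∣ F ∣ ∎
  where
  open ℕP.≤-Reasoning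
  image⊆ : image φ (true ∷ F) ⊆ ⁅ φ Fin.zero ⁆ ∪ image (φ ∘ Fin.suc) F
  image⊆ {w} w∈image with to (image-isImage φ (true ∷ F) w) w∈image
  ... | Fin.zero  , _   , refl = SP.x∈p∪q⁺ (inj₁ (SP.x∈⁅x⁆ (φ Fin.zero)))
  ... | Fin.suc v , v∈F , φv≡w = SP.x∈p∪q⁺ (inj₂ (from (image-isImage (φ ∘ Fin.suc) F w) (v , SP.drop-there v∈F , φv≡w)))
∣image∣≤ {suc N} φ (false ∷ F) = ℕP.≤-trans (SP.p⊆q⇒∣p∣≤∣q∣ image⊆) (∣image∣≤ (φ ∘ Fin.suc) F)
  where
  image⊆ : image φ (false ∷ F) ⊆ image (φ ∘ Fin.suc) F
  image⊆ {w} w∈image with to (image-isImage φ (false ∷ F) w) w∈image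
  ... | Fin.suc v , v∈F , φv≡w = from (image-isImage (φ ∘ Fin.suc) F w) (v , SP.drop-there v∈F , φv≡w)

module IsoImages {N M} (Γ : Complex N) (Γ′ : Complex M) (Γ-closed : DownClosed Γ) (φ : Fin N → Fin M) (ψ : Fin M → Fin N)
  (ψφ≡id : ∀ v → Vertex Γ v → ψ (φ v) ≡ v) (φ-faces : ∀ F G → IsImage φ F G → Γ F ≡ true → Γ′ G ≡ true) where

  vertex-of-face : ∀ F v → Γ F ≡ true → v ∈ F → Vertex Γ v
  vertex-of-face F v F∈Γ v∈F = Γ-closed ⁅ v ⁆ F (λ u∈⁅v⁆ → subst (_∈ F) (sym (SP.x∈⁅y⁆⇒x≡y v u∈⁅v⁆)) v∈F) F∈Γ

  image-face : ∀ F → Γ F ≡ true → Γ′ (image φ F) ≡ true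
  image-face F = φ-faces F (image φ F) (image-isImage φ F)

  image-image : ∀ F → Γ F ≡ true → image ψ (image φ F) ≡ F
  image-image F F∈Γ = SP.⊆-antisym back forth
    where
    back : image ψ (image φ F) ⊆ F
    back {x} x∈ =
      let w , w∈ , ψw≡x = to (image-isImage ψ (image φ F) x) x∈
          v , v∈F , φv≡w = to (image-isImage φ F w) w∈
      in subst (_∈ F) (trans (sym (ψφ≡id v (vertex-of-face F v F∈Γ v∈F))) (trans (cong ψ φv≡w) ψw≡x)) v∈F
    forth : F ⊆ image ψ (image φ F)
    forth {x} x∈F = from (image-isImage ψ (image φ F) x)
      (φ x , from (image-isImage φ F (φ x)) (x , x∈F , refl) , ψφ≡id x (vertex-of-face F x F∈Γ x∈F))

  ∣image∣≡ : ∀ F → Γ F ≡ true → ∣ image φ F ∣ ≡ ∣ F ∣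
  ∣image∣≡ F F∈Γ = ℕP.≤-antisym (∣image∣≤ φ F) (subst (_≤ ∣ image φ F ∣) (cong ∣_∣ (image-image F F∈Γ)) (∣image∣≤ ψ (image φ F)))

≡true⇔⇒≡ : ∀ {a b} → (a ≡ true → b ≡ true) → (b ≡ true → a ≡ true) → a ≡ b
≡true⇔⇒≡ {true}  {true}  _ _ = refl
≡true⇔⇒≡ {false} {false} _ _ = refl
≡true⇔⇒≡ {true}  {false} a⇒b _ = sym (a⇒b refl)
≡true⇔⇒≡ {false} {true}  _ b⇒a = b⇒a refl

-- Both sides equal the sum over the pairs (F, G) of corresponding faces, G = φ[F] and F = ψ[G].
faceSum-Iso : ∀ {N M} (Γ : Complex N) (Γ′ : Complex M) → Iso Γ Γ′ → DownClosed Γ → DownClosed Γ′ → ∀ (ψ′ : ℕ → ℤ) →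
  faceSum ψ′ Γ ≡ faceSum ψ′ Γ′
faceSum-Iso {N} {M} Γ Γ′ (φ , ψ , ψφ≡id , φψ≡id , φ-faces , ψ-faces) Γ-closed Γ′-closed ψ′ = begin
  ∑ N (λ F → when (Γ F) (ψ′ ∣ F ∣))
    ≡⟨ ∑-cong N (λ F → sym (∑-when-== M (image φ F) (λ _ → when (Γ F) (ψ′ ∣ F ∣)))) ⟩
  ∑ N (λ F → ∑ M (λ G → when (G == image φ F) (when (Γ F) (ψ′ ∣ F ∣))))
    ≡⟨ ∑-comm N M _ ⟩
  ∑ M (λ G → ∑ N (λ F → when (G == image φ F) (when (Γ F) (ψ′ ∣ F ∣))))
    ≡⟨ ∑-cong M (λ G → ∑-cong N (λ F → corresponding F G)) ⟩
  ∑ M (λ G → ∑ N (λ F → when (F == image ψ G) (when (Γ′ G) (ψ′ ∣ G ∣))))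
    ≡⟨ ∑-cong M (λ G → ∑-when-== N (image ψ G) (λ _ → when (Γ′ G) (ψ′ ∣ G ∣))) ⟩
  ∑ M (λ G → when (Γ′ G) (ψ′ ∣ G ∣)) ∎
  where
  open ≡-Reasoning
  module Forth = IsoImages Γ Γ′ Γ-closed φ ψ ψφ≡id φ-faces
  module Back  = IsoImages Γ′ Γ Γ′-closed ψ φ φψ≡id ψ-faces
  forth : ∀ F G → (G == image φ F ∧ Γ F) ≡ true → (F == image ψ G ∧ Γ′ G) ≡ true
  forth F G G≡φF∧F∈Γ with ==-sound {X = G} (∧-conicalˡ (G == image φ F) _ G≡φF∧F∈Γ) | ∧-conicalʳ (G == image φ F) _ G≡φF∧F∈Γ
  ... | refl | F∈Γ rewrite ==-complete {X = F} (sym (Forth.image-image F F∈Γ)) = Forth.image-face F F∈Γ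
  back : ∀ F G → (F == image ψ G ∧ Γ′ G) ≡ true → (G == image φ F ∧ Γ F) ≡ true
  back F G F≡ψG∧G∈Γ′ with ==-sound {X = F} (∧-conicalˡ (F == image ψ G) _ F≡ψG∧G∈Γ′) | ∧-conicalʳ (F == image ψ G) _ F≡ψG∧G∈Γ′
  ... | refl | G∈Γ′ rewrite ==-complete {X = G} (sym (Back.image-image G G∈Γ′)) = Back.image-face G G∈Γ′
  corresponding : ∀ F G → when (G == image φ F) (when (Γ F) (ψ′ ∣ F ∣)) ≡ when (F == image ψ G) (when (Γ′ G) (ψ′ ∣ G ∣))
  corresponding F G rewrite when-when (G == image φ F) (Γ F) (ψ′ ∣ F ∣) | when-when (F == image ψ G) (Γ′ G) (ψ′ ∣ G ∣)
                          | ≡true⇔⇒≡ (forth F G) (back F G) with F == image ψ G ∧ Γ′ G in F↔G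
  ... | false = refl
  ... | true  with back F G F↔G
  ...   | G≡φF∧F∈Γ with ==-sound {X = G} (∧-conicalˡ (G == image φ F) _ G≡φF∧F∈Γ)
  ...     | refl = cong ψ′ (sym (Forth.∣image∣≡ F (∧-conicalʳ (G == image φ F) _ G≡φF∧F∈Γ)))

Iso-≗ : ∀ {N} (Γ Γ′ : Complex N) → (∀ X → Γ X ≡ Γ′ X) → Iso Γ Γ′
Iso-≗ Γ Γ′ Γ≗Γ′ = id , id , (λ _ _ → refl) , (λ _ _ → refl) , forth , back
  where
  image-id : ∀ F G → IsImage id F G → G ≡ F
  image-id F G G≡idF = SP.⊆-antisym (λ {w} w∈G → let v , v∈F , v≡w = to (G≡idF w) w∈G in subst (_∈ F) v≡w v∈F)
                                    (λ {w} w∈F → from (G≡idF w) (w , w∈F , refl))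
  forth : ∀ F G → IsImage id F G → Γ F ≡ true → Γ′ G ≡ true
  forth F G G≡F F∈Γ rewrite image-id F G G≡F = trans (sym (Γ≗Γ′ F)) F∈Γ
  back : ∀ G F → IsImage id G F → Γ′ G ≡ true → Γ F ≡ true
  back G F F≡G G∈Γ′ rewrite image-id G F F≡G = trans (Γ≗Γ′ G) G∈Γ′

-- Flips between Bier spheres

m∸f≡m∸2∸[f∸1]+1 : ∀ m f → 1 ≤ f → f < m → m ∸ f ≡ (m ∸ 2 ∸ (f ∸ 1)) ℕ.+ 1
m∸f≡m∸2∸[f∸1]+1 (suc (suc m)) (suc f) _ (s≤s (s≤s f≤m)) = trans (ℕP.+-∸-assoc 1 f≤m) (ℕP.+-comm 1 (m ∸ f))

-- Adding a minimal non-face F to Δ is a bistellar (∣ F ∣ ∸ 1)-flip of the Bier sphere. A face P ++ Q of Bier Δ is the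
-- pair P ⊆ Y = ∁ Q; with A = {w_j : j ∉ F} and B = {v_i : i ∈ F} the flip removes the faces (P, F) with P ⊊ F and
-- adds the faces (F, Y) with Y ⊋ F.
module AddFace {n} (Δ : Subset n → Bool) (Δ-closed : DownClosed Δ) (F : Subset n) (F∉Δ : Δ F ≡ false)
  (below-F : ∀ X → X ⊂ᵇ F ≡ true → Δ X ≡ true) (1≤∣F∣ : 1 ≤ ∣ F ∣) (∣F∣<n : ∣ F ∣ < n) where

  Δ⁺ : Subset n → Bool
  Δ⁺ X = Δ X ∨ X == F

  A B : Subset (n ℕ.+ n)
  A = ∅ {n} ++ ∁ F
  B = F ++ ∅ {n}

  A∪B≡F++∁F : A ∪ B ≡ F ++ ∁ F
  A∪B≡F++∁F = trans (∪-++ ∅ F (∁ F) ∅) (cong₂ _++_ (SP.∪-identityˡ F) (SP.∪-identityʳ (∁ F)))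

  B∪A≡F++∁F : B ∪ A ≡ F ++ ∁ F
  B∪A≡F++∁F = trans (∪-++ F ∅ ∅ (∁ F)) (cong₂ _++_ (SP.∪-identityʳ F) (SP.∪-identityˡ (∁ F)))

  A⊆∁B : A ⊆ᵇ ∁ B ≡ true
  A⊆∁B rewrite ∁-++ F (∅ {n}) | ∁∅ {n} | ⊆ᵇ-++ (∅ {n}) (∁ F) (∁ F) full | ∅⊆ᵇ (∁ F) = ⊆ᵇ-full (∁ F)

  B⊆∁A : B ⊆ᵇ ∁ A ≡ true
  B⊆∁A = ⊆ᵇ∁-sym A B A⊆∁B

  removedPair addedPair : Subset n → Subset n → Bool
  removedPair P Y = Y ⊆ᵇ F ∧ (P ⊆ᵇ F ∧ F ⊆ᵇ Y) ∧ not (P == F ∧ Y == F)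
  addedPair   P Y = F ⊆ᵇ P ∧ (P ⊆ᵇ F ∧ F ⊆ᵇ Y) ∧ not (P == F ∧ Y == F)

  strictlyBetween-A-B : ∀ P Q → strictlyBetween A B (P ++ Q) ≡ removedPair P (∁ Q)
  strictlyBetween-A-B P Q
    rewrite A∪B≡F++∁F | ⊆ᵇ-++ (∅ {n}) P (∁ F) Q | ∅⊆ᵇ P | ∁⊆ᵇ-swap F Q
          | ⊆ᵇ-++ P F Q (∁ F) | ⊆ᵇ-∁-swap Q F | ==-++ P F Q (∁ F) | ==-∁-swap Q F = refl

  strictlyBetween-B-A : ∀ P Q → strictlyBetween B A (P ++ Q) ≡ addedPair P (∁ Q)
  strictlyBetween-B-A P Q
    rewrite B∪A≡F++∁F | ⊆ᵇ-++ F P (∅ {n}) Q | ∅⊆ᵇ Q | ∧-identityʳ (F ⊆ᵇ P)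
          | ⊆ᵇ-++ P F Q (∁ F) | ⊆ᵇ-∁-swap Q F | ==-++ P F Q (∁ F) | ==-∁-swap Q F = refl

  above-F∉Δ : ∀ Y → F ⊆ᵇ Y ≡ true → Δ Y ≡ false
  above-F∉Δ Y F⊆Y = ¬-not (λ Y∈Δ → true≢false (trans (sym (Δ-closed F Y (⊆ᵇ⇒⊆ F⊆Y) Y∈Δ)) F∉Δ))

  Bier-Δ⁺-pair : ∀ P Y → (Δ⁺ P ∧ not (Δ⁺ Y) ∧ P ⊆ᵇ Y) ≡ ((Δ P ∧ not (Δ Y) ∧ P ⊆ᵇ Y) ∧ not (removedPair P Y) ∨ addedPair P Y)
  Bier-Δ⁺-pair P Y with P == F in P≟F | Y == F in Y≟F
  ... | true  | true  with ==-sound {X = P} P≟F | ==-sound {X = Y} Y≟F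
  ...   | refl | refl rewrite F∉Δ | ⊆ᵇ-refl F | ==-refl F = refl
  Bier-Δ⁺-pair P Y | true | false with ==-sound {X = P} P≟F
  ...   | refl rewrite F∉Δ | ⊆ᵇ-refl F with F ⊆ᵇ Y in F⊆Y
  ...     | false rewrite ∧-zeroʳ (not (Δ Y ∨ false)) = refl
  ...     | true  rewrite above-F∉Δ Y F⊆Y = refl
  Bier-Δ⁺-pair P Y | false | true with ==-sound {X = Y} Y≟F
  ...   | refl
    rewrite F∉Δ | ⊆ᵇ-refl F | ==-refl F | ∨-identityʳ (Δ P)
          | ∧-exclusive₂ (F ⊆ᵇ P) (P ⊆ᵇ F) true (not (false ∧ true)) (λ F⊆P P⊆F → ==-false-antisym P F P≟F P⊆F F⊆P)
    with Δ P | P ⊆ᵇ F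
  ...     | true  | true  = refl
  ...     | true  | false = refl
  ...     | false | true  = refl
  ...     | false | false = refl
  Bier-Δ⁺-pair P Y | false | false
    rewrite ∨-identityʳ (Δ P) | ∨-identityʳ (Δ Y)
          | ∧-exclusive₁ (Y ⊆ᵇ F) (F ⊆ᵇ Y) (P ⊆ᵇ F) (not (false ∧ false)) (==-false-antisym Y F Y≟F)
          | ∧-exclusive₂ (F ⊆ᵇ P) (P ⊆ᵇ F) (F ⊆ᵇ Y) (not (false ∧ false)) (λ F⊆P P⊆F → ==-false-antisym P F P≟F P⊆F F⊆P)
          | ∧-identityʳ (Δ P ∧ not (Δ Y) ∧ P ⊆ᵇ Y) | ∨-identityʳ (Δ P ∧ not (Δ Y) ∧ P ⊆ᵇ Y) = refl

  Δ⁺-closed : DownClosed Δ⁺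
  Δ⁺-closed X Y X⊆Y Y∈Δ⁺ with Δ Y in Y∈?Δ
  ... | true rewrite Δ-closed X Y X⊆Y Y∈?Δ = refl
  ... | false with ==-sound {X = Y} Y∈Δ⁺
  ...   | refl with X == F in X≟F
  ...     | true  = ∨-zeroʳ (Δ X)
  ...     | false rewrite below-F X (⊆ᵇ∧not==⇒⊂ᵇ X F (dec-true (X ⊆? F) X⊆Y) X≟F) = refl

  ∅∈Δ : Δ ∅ ≡ true
  ∅∈Δ = below-F ∅ (∅⊂ᵇ F 1≤∣F∣)

  ∁A≡full++F : ∁ A ≡ full ++ F
  ∁A≡full++F = trans (∁-++ (∅ {n}) (∁ F)) (cong₂ _++_ ∁∅ (∁-involutive F))

  A∪[P++Q] : ∀ P Q → A ∪ (P ++ Q) ≡ P ++ (∁ F ∪ Q)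
  A∪[P++Q] P Q = trans (∪-++ ∅ P (∁ F) Q) (cong (_++ (∁ F ∪ Q)) (SP.∪-identityˡ P))

  ⊆ᵇ∁A : ∀ P Q → (P ++ Q) ⊆ᵇ ∁ A ≡ Q ⊆ᵇ F
  ⊆ᵇ∁A P Q = trans (cong ((P ++ Q) ⊆ᵇ_) ∁A≡full++F) (trans (⊆ᵇ-++ P full Q F) (cong (_∧ Q ⊆ᵇ F) (⊆ᵇ-full P)))

  Bier-A∪[P++Q] : ∀ P Q → Bier Δ (A ∪ (P ++ Q)) ≡ true → Δ P ≡ true × not (Δ (∁ (∁ F ∪ Q))) ≡ true × P ⊆ᵇ ∁ (∁ F ∪ Q) ≡ true
  Bier-A∪[P++Q] P Q A∪[P++Q]∈Bier = ∧-true³ (trans (sym (Bier-++ Δ P (∁ F ∪ Q))) (subst (λ Z → Bier Δ Z ≡ true) (A∪[P++Q] P Q) A∪[P++Q]∈Bier))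

  -- The link of A is ∂B: a face A ∪ (P ++ Q) needs Q = ∅, since otherwise the proper subset ∁ (∁ F ∪ Q) of F lies in Δ.
  link-A : ∀ P Q → (Empty ((P ++ Q) ∩ A) × Bier Δ (A ∪ (P ++ Q)) ≡ true) ⇔ (P ++ Q) ⊂ B
  link-A P Q = mk⇔ link-to link-from
    where
    link-to : Empty ((P ++ Q) ∩ A) × Bier Δ (A ∪ (P ++ Q)) ≡ true → (P ++ Q) ⊂ B
    link-to (disjoint , A∪[P++Q]∈Bier) with Q == ∅ in Q≟∅ | Bier-A∪[P++Q] P Q A∪[P++Q]∈Bier
    ... | false | _ , ∁[∁F∪Q]∉Δ , _ =
      ⊥-elim (true≢false (trans (sym (below-F _ (∁[∁F∪G]⊂ᵇF F Q Q⊆F Q≟∅))) (not≡true⇒≡false ∁[∁F∪Q]∉Δ)))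
      where Q⊆F = trans (sym (⊆ᵇ∁A P Q)) (Empty∩⇒⊆ᵇ∁ (P ++ Q) A disjoint)
    ... | true  | P∈Δ , _ , P⊆∁[∁F∪Q] with ==-sound {X = Q} Q≟∅
    ...   | refl = ⊂ᵇ⇒⊂ P++∅⊂B
      where
      P⊆F : P ⊆ᵇ F ≡ true
      P⊆F = subst (λ Z → P ⊆ᵇ Z ≡ true) (∁[∁F∪∅]≡F F) P⊆∁[∁F∪Q]
      P≠F : P == F ≡ false
      P≠F = ¬-not (λ P≡F → true≢false (trans (sym (subst (λ Z → Δ Z ≡ true) (==-sound {X = P} P≡F) P∈Δ)) F∉Δ))
      P++∅⊂B : (P ++ ∅ {n}) ⊂ᵇ (F ++ ∅ {n}) ≡ true
      P++∅⊂B rewrite ⊂ᵇ≡⊆ᵇ∧not== (P ++ ∅ {n}) (F ++ ∅) | ⊆ᵇ-++ P F (∅ {n}) ∅ | ==-++ P F (∅ {n}) ∅ | P⊆F | P≠F | ∅⊆ᵇ (∅ {n}) = refl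
    link-from : (P ++ Q) ⊂ B → Empty ((P ++ Q) ∩ A) × Bier Δ (A ∪ (P ++ Q)) ≡ true
    link-from P++Q⊂B with dec-true (_ ⊂? _) P++Q⊂B
    ... | P++Q⊂ᵇB rewrite ⊂ᵇ≡⊆ᵇ∧not== (P ++ Q) (F ++ ∅ {n}) | ⊆ᵇ-++ P F Q (∅ {n}) | ==-++ P F Q (∅ {n})
      with ⊆ᵇ∅⇒≡∅ Q (∧-conicalʳ (P ⊆ᵇ F) _ (∧-conicalˡ _ _ P++Q⊂ᵇB))
    ...   | refl rewrite ==-refl (∅ {n}) | ∧-identityʳ (P == F) =
      ⊆ᵇ∁⇒Empty∩ (P ++ ∅) A (trans (⊆ᵇ∁A P ∅) (∅⊆ᵇ F)) ,
      subst (λ Z → Bier Δ Z ≡ true) (sym (A∪[P++Q] P ∅)) (trans (Bier-++ Δ P (∁ F ∪ ∅)) P++∅∈Bier)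
      where
      P⊆F : P ⊆ᵇ F ≡ true
      P⊆F = ∧-conicalˡ _ _ (∧-conicalˡ _ _ P++Q⊂ᵇB)
      P≠F : P == F ≡ false
      P≠F = not≡true⇒≡false (∧-conicalʳ (P ⊆ᵇ F ∧ (∅ {n}) ⊆ᵇ ∅) _ P++Q⊂ᵇB)
      P++∅∈Bier : (Δ P ∧ not (Δ (∁ (∁ F ∪ ∅))) ∧ P ⊆ᵇ ∁ (∁ F ∪ ∅)) ≡ true
      P++∅∈Bier rewrite ∁[∁F∪∅]≡F F | below-F P (⊆ᵇ∧not==⇒⊂ᵇ P F P⊆F P≠F) | F∉Δ | P⊆F = refl

  Bier-Δ⁺ : ∀ X → Bier Δ⁺ X ≡ (Bier Δ X ∧ not (strictlyBetween A B X) ∨ strictlyBetween B A X)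
  Bier-Δ⁺ X
    rewrite take++drop {n} X | Bier-++ Δ⁺ (take n X) (drop n X) | Bier-++ Δ (take n X) (drop n X)
          | strictlyBetween-A-B (take n X) (drop n X) | strictlyBetween-B-A (take n X) (drop n X) =
    Bier-Δ⁺-pair (take n X) (∁ (drop n X))

  Bier-flip : Flip (n ∸ 2) (∣ F ∣ ∸ 1) (Bier Δ) (Bier Δ⁺)
  Bier-flip = record
    { A        = A
    ; B        = B
    ; i≤d      = ℕP.≤-trans (ℕP.∸-monoˡ-≤ 1 (ℕP.∸-monoˡ-≤ 1 ∣F∣<n)) (ℕP.≤-reflexive (ℕP.∸-+-assoc n 1 1))
    ; cardA    = trans (∣++∣ (∅ {n}) (∁ F)) (trans (cong (ℕ._+ ∣ ∁ F ∣) (SP.∣⊥∣≡0 n))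
                       (trans (SP.∣∁p∣≡n∸∣p∣ F) (m∸f≡m∸2∸[f∸1]+1 n ∣ F ∣ 1≤∣F∣ ∣F∣<n)))
    ; cardB    = trans (∣++∣ F (∅ {n})) (trans (cong (∣ F ∣ ℕ.+_) (SP.∣⊥∣≡0 n))
                       (trans (ℕP.+-identityʳ ∣ F ∣) (sym (ℕP.m∸n+n≡m 1≤∣F∣))))
    ; disjoint = ⊆ᵇ∁⇒Empty∩ A B A⊆∁B
    ; A∈Γ      = trans (Bier-++ Δ ∅ (∁ F)) A∈Bier
    ; link     = λ G → subst (λ Z → (Empty (Z ∩ A) × Bier Δ (A ∪ Z) ≡ true) ⇔ Z ⊂ B) (sym (take++drop {n} G))
                             (link-A (take n G) (drop n G))
    ; B∉Γ      = trans (Bier-++ Δ F ∅) B∉Bier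
    ; result   = λ X → mk⇔ (result-to X) (result-from X) }
    where
    A∈Bier : (Δ ∅ ∧ not (Δ (∁ (∁ F))) ∧ ∅ ⊆ᵇ ∁ (∁ F)) ≡ true
    A∈Bier rewrite ∁-involutive F | ∅∈Δ | F∉Δ | ∅⊆ᵇ F = refl
    B∉Bier : (Δ F ∧ not (Δ (∁ ∅)) ∧ F ⊆ᵇ ∁ ∅) ≡ false
    B∉Bier rewrite F∉Δ = refl
    result-to : ∀ X → Bier Δ⁺ X ≡ true → (Bier Δ X ≡ true × ¬ Removed A B X) ⊎ Added A B X
    result-to X X∈Bier⁺ with strictlyBetween B A X in between-B-A | strictlyBetween A B X in between-A-B
    ... | true  | _     = inj₂ (Removed⇒Added A B X (strictlyBetween⇒Removed B A X between-B-A))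
    ... | false | true  = ⊥-elim (true≢false (trans (sym X∈Bier⁺) X∉Bier⁺))
      where
      X∉Bier⁺ : Bier Δ⁺ X ≡ false
      X∉Bier⁺ rewrite Bier-Δ⁺ X | between-A-B | between-B-A | ∧-zeroʳ (Bier Δ X) = refl
    ... | false | false = inj₁ (trans (sym Bier⁺≡Bier) X∈Bier⁺ ,
                                λ removed → true≢false (trans (sym (Removed⇒strictlyBetween A B X A⊆∁B removed)) between-A-B))
      where
      Bier⁺≡Bier : Bier Δ⁺ X ≡ Bier Δ X
      Bier⁺≡Bier rewrite Bier-Δ⁺ X | between-A-B | between-B-A = trans (∨-identityʳ _) (∧-identityʳ _)
    result-from : ∀ X → (Bier Δ X ≡ true × ¬ Removed A B X) ⊎ Added A B X → Bier Δ⁺ X ≡ true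
    result-from X (inj₂ added) rewrite Bier-Δ⁺ X | Removed⇒strictlyBetween B A X B⊆∁A (Added⇒Removed A B X added) = ∨-zeroʳ _
    result-from X (inj₁ (X∈Bier , X-kept)) with strictlyBetween A B X in between-A-B
    ... | true  = ⊥-elim (X-kept (strictlyBetween⇒Removed A B X between-A-B))
    ... | false rewrite Bier-Δ⁺ X | between-A-B | X∈Bier = refl

minimal-witness : ∀ {n} (P : Subset n → Bool) (fuel : ℕ) (X : Subset n) → ∣ X ∣ ≤ fuel → P X ≡ true →
  Σ (Subset n) λ F → P F ≡ true × (∀ Y → P Y ≡ true → ∣ F ∣ ≤ ∣ Y ∣)
minimal-witness P zero    X ∣X∣≤0 PX = X , PX , λ Y _ → ℕP.≤-trans ∣X∣≤0 z≤n
minimal-witness P (suc fuel) X ∣X∣≤fuel PX with count (λ Y → P Y ∧ (∣ Y ∣ <ᵇ ∣ X ∣)) ℕ.≟ 0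
... | no  some = let Y , PY∧Y<X = count≢0⇒witness _ some in
  minimal-witness P fuel Y (ℕP.≤-pred (ℕP.≤-trans (of-does (∣ Y ∣ <? ∣ X ∣) (∧-conicalʳ (P Y) _ PY∧Y<X)) ∣X∣≤fuel))
                  (∧-conicalˡ _ _ PY∧Y<X)
... | yes none = X , PX , λ Y PY → ℕP.≮⇒≥ λ Y<X →
  true≢false (trans (sym (cong₂ _∧_ PY (dec-true (∣ Y ∣ <? ∣ X ∣) Y<X))) (count≡0⇒false _ none Y))

maximal-witness : ∀ {n} (P : Subset n → Bool) (fuel : ℕ) (X : Subset n) → n ∸ ∣ X ∣ ≤ fuel → P X ≡ true →
  Σ (Subset n) λ F → P F ≡ true × (∀ Y → P Y ≡ true → ∣ Y ∣ ≤ ∣ F ∣)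
maximal-witness {n} P fuel X n-X≤fuel PX with count (λ Y → P Y ∧ (∣ X ∣ <ᵇ ∣ Y ∣)) ℕ.≟ 0
... | yes none = X , PX , λ Y PY → ℕP.≮⇒≥ λ X<Y →
  true≢false (trans (sym (cong₂ _∧_ PY (dec-true (∣ X ∣ <? ∣ Y ∣) X<Y))) (count≡0⇒false _ none Y))
maximal-witness {n} P zero X n-X≤0 PX | no some =
  let Y , PY∧X<Y = count≢0⇒witness _ some
  in ⊥-elim (ℕP.n≮0 (ℕP.<-≤-trans (ℕP.∸-monoʳ-< (of-does (∣ X ∣ <? ∣ Y ∣) (∧-conicalʳ (P Y) _ PY∧X<Y)) (SP.∣p∣≤n Y)) n-X≤0))
maximal-witness {n} P (suc fuel) X n-X≤fuel PX | no some =
  let Y , PY∧X<Y = count≢0⇒witness _ some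
  in maximal-witness P fuel Y (ℕP.≤-pred (ℕP.<-≤-trans (ℕP.∸-monoʳ-< (of-does (∣ X ∣ <? ∣ Y ∣) (∧-conicalʳ (P Y) _ PY∧X<Y)) (SP.∣p∣≤n Y)) n-X≤fuel))
                     (∧-conicalˡ _ _ PY∧X<Y)

newFaces : ∀ {n} → (Subset n → Bool) → (Subset n → Bool) → Subset n → Bool
newFaces Δ₀ Δ₁ X = Δ₁ X ∧ not (Δ₀ X)

no-newFaces⇒≗ : ∀ {n} (Δ₀ Δ₁ : Subset n → Bool) → (∀ X → Δ₀ X ≡ true → Δ₁ X ≡ true) →
  count (newFaces Δ₀ Δ₁) ≡ 0 → ∀ X → Δ₀ X ≡ Δ₁ X
no-newFaces⇒≗ Δ₀ Δ₁ Δ₀⊆Δ₁ none X with Δ₀ X in X∈?Δ₀ | Δ₁ X in X∈?Δ₁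
... | true  | true  = refl
... | false | false = refl
... | true  | false = trans (sym (Δ₀⊆Δ₁ X X∈?Δ₀)) X∈?Δ₁
... | false | true  = ⊥-elim (true≢false (trans (sym (cong₂ (λ a b → a ∧ not b) X∈?Δ₁ X∈?Δ₀)) (count≡0⇒false _ none X)))

newFace-bounds : ∀ {n} (Δ₀ Δ₁ : Subset n → Bool) → Δ₁ full ≡ false → Δ₀ ∅ ≡ true → ∀ F → newFaces Δ₀ Δ₁ F ≡ true →
  1 ≤ ∣ F ∣ × ∣ F ∣ < n
newFace-bounds {n} Δ₀ Δ₁ full∉Δ₁ ∅∈Δ₀ F F-new = nonempty , proper
  where
  F∈Δ₁ = ∧-conicalˡ _ _ F-new
  F∉Δ₀ = not≡true⇒≡false (∧-conicalʳ (Δ₁ F) _ F-new)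
  nonempty : 1 ≤ ∣ F ∣
  nonempty with ∣ F ∣ in ∣F∣≡
  ... | suc _ = s≤s z≤n
  ... | zero  = ⊥-elim (true≢false (trans (sym (subst (λ Z → Δ₀ Z ≡ true) (sym (∣X∣≡0⇒X≡∅ F ∣F∣≡)) ∅∈Δ₀)) F∉Δ₀))
  proper : ∣ F ∣ < n
  proper = ℕP.≤∧≢⇒< (SP.∣p∣≤n F) (λ ∣F∣≡n → true≢false (trans (sym (subst (λ Z → Δ₁ Z ≡ true) (SP.∣p∣≡n⇒p≡⊤ ∣F∣≡n) F∈Δ₁)) full∉Δ₁))

below-minimal-newFace : ∀ {n} (Δ₀ Δ₁ : Subset n → Bool) → DownClosed Δ₁ → ∀ F → Δ₁ F ≡ true →
  (∀ Y → newFaces Δ₀ Δ₁ Y ≡ true → ∣ F ∣ ≤ ∣ Y ∣) → ∀ X → X ⊂ᵇ F ≡ true → Δ₀ X ≡ true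
below-minimal-newFace Δ₀ Δ₁ Δ₁-closed F F∈Δ₁ F-minimal X X⊂ᵇF with Δ₀ X in X∈?Δ₀
... | true  = refl
... | false = ⊥-elim (ℕP.<⇒≱ (SP.p⊂q⇒∣p∣<∣q∣ X⊂F) (F-minimal X X-new))
  where
  X⊂F : X ⊂ F
  X⊂F = ⊂ᵇ⇒⊂ X⊂ᵇF
  X-new : newFaces Δ₀ Δ₁ X ≡ true
  X-new rewrite Δ₁-closed X F (SP.p⊂q⇒p⊆q X⊂F) F∈Δ₁ | X∈?Δ₀ = refl

remove-maximal-newFace-closed : ∀ {n} (Δ₀ Δ₁ : Subset n → Bool) → DownClosed Δ₀ → DownClosed Δ₁ → ∀ F → Δ₀ F ≡ false →
  (∀ Y → newFaces Δ₀ Δ₁ Y ≡ true → ∣ Y ∣ ≤ ∣ F ∣) → DownClosed (λ X → Δ₁ X ∧ not (X == F))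
remove-maximal-newFace-closed Δ₀ Δ₁ Δ₀-closed Δ₁-closed F F∉Δ₀ F-maximal X Y X⊆Y Y∈Δ₁⁻ with X == F in X≟F
... | false rewrite Δ₁-closed X Y X⊆Y (∧-conicalˡ (Δ₁ Y) _ Y∈Δ₁⁻) = refl
... | true with ==-sound {X = X} X≟F
...   | refl = ⊥-elim (ℕP.<⇒≱ (SP.p⊂q⇒∣p∣<∣q∣ F⊂Y) (F-maximal Y Y-new))
  where
  F≢Y : F ≢ Y
  F≢Y refl = true≢false (trans (sym (==-refl F)) (not≡true⇒≡false (∧-conicalʳ (Δ₁ F) _ Y∈Δ₁⁻)))
  F⊂Y : F ⊂ Y
  F⊂Y = ⊂ᵇ⇒⊂ (⊆ᵇ∧not==⇒⊂ᵇ F Y (dec-true (F ⊆? Y) X⊆Y) (¬-not (F≢Y ∘ ==-sound {X = F})))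
  Y-new : newFaces Δ₀ Δ₁ Y ≡ true
  Y-new with Δ₀ Y in Y∈?Δ₀
  ... | true  = ⊥-elim (true≢false (trans (sym (Δ₀-closed F Y X⊆Y Y∈?Δ₀)) F∉Δ₀))
  ... | false = trans (∧-identityʳ (Δ₁ Y)) (∧-conicalˡ (Δ₁ Y) _ Y∈Δ₁⁻)

flips-adding-faces : ∀ {n} m c (Δ₀ Δ₁ : Subset n → Bool) → DownClosed Δ₀ → DownClosed Δ₁ → (∀ X → Δ₀ X ≡ true → Δ₁ X ≡ true) →
  Δ₁ full ≡ false → Δ₀ ∅ ≡ true → (∀ X → newFaces Δ₀ Δ₁ X ≡ true → ∣ X ∣ ∸ 1 ≤ m) → count (newFaces Δ₀ Δ₁) ≡ c →
  Σ (Complex (n ℕ.+ n)) λ Γ → Flips (n ∸ 2) m (Bier Δ₀) Γ × (∀ X → Γ X ≡ Bier Δ₁ X)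
flips-adding-faces m zero Δ₀ Δ₁ _ _ Δ₀⊆Δ₁ _ _ _ none = Bier Δ₀ , done , Bier-cong Δ₀ Δ₁ (no-newFaces⇒≗ Δ₀ Δ₁ Δ₀⊆Δ₁ none)
flips-adding-faces {n} m (suc c) Δ₀ Δ₁ Δ₀-closed Δ₁-closed Δ₀⊆Δ₁ full∉Δ₁ ∅∈Δ₀ small count≡1+c =
  let Γ , flips , Γ≗Bier = flips-adding-faces m c Δ⁺ Δ₁ AF.Δ⁺-closed Δ₁-closed Δ⁺⊆Δ₁ full∉Δ₁ ∅∈Δ⁺ small⁺ count⁺
  in Γ , step (∣ F ∣ ∸ 1) (small F F-new) AF.Bier-flip flips , Γ≗Bier
  where
  X₀ = count≢0⇒witness (newFaces Δ₀ Δ₁) (λ none → ℕP.0≢1+n (trans (sym none) count≡1+c))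
  minimal = minimal-witness (newFaces Δ₀ Δ₁) ∣ proj₁ X₀ ∣ (proj₁ X₀) ℕP.≤-refl (proj₂ X₀)
  F = proj₁ minimal
  F-new = proj₁ (proj₂ minimal)
  F∈Δ₁ = ∧-conicalˡ _ _ F-new
  F∉Δ₀ = not≡true⇒≡false (∧-conicalʳ (Δ₁ F) _ F-new)
  bounds = newFace-bounds Δ₀ Δ₁ full∉Δ₁ ∅∈Δ₀ F F-new
  module AF = AddFace Δ₀ Δ₀-closed F F∉Δ₀ (below-minimal-newFace Δ₀ Δ₁ Δ₁-closed F F∈Δ₁ (proj₂ (proj₂ minimal)))
                      (proj₁ bounds) (proj₂ bounds)
  Δ⁺ = AF.Δ⁺
  Δ⁺⊆Δ₁ : ∀ X → Δ⁺ X ≡ true → Δ₁ X ≡ true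
  Δ⁺⊆Δ₁ X X∈Δ⁺ with Δ₀ X in X∈?Δ₀
  ... | true  = Δ₀⊆Δ₁ X X∈?Δ₀
  ... | false rewrite ==-sound {X = X} X∈Δ⁺ = F∈Δ₁
  ∅∈Δ⁺ : Δ⁺ ∅ ≡ true
  ∅∈Δ⁺ rewrite ∅∈Δ₀ = refl
  small⁺ : ∀ X → newFaces Δ⁺ Δ₁ X ≡ true → ∣ X ∣ ∸ 1 ≤ m
  small⁺ X X-new⁺ with Δ₀ X in X∈?Δ₀
  ... | true  = ⊥-elim (true≢false (trans (sym X-new⁺) (∧-zeroʳ (Δ₁ X))))
  ... | false = small X (subst (λ b → Δ₁ X ∧ not b ≡ true) (sym X∈?Δ₀) (trans (∧-identityʳ (Δ₁ X)) (∧-conicalˡ (Δ₁ X) _ X-new⁺)))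
  count⁺ : count (newFaces Δ⁺ Δ₁) ≡ c
  count⁺ = sym (ℕP.suc-injective (trans (sym count≡1+c) (count-δ (newFaces Δ₀ Δ₁) F F-new (newFaces Δ⁺ Δ₁)
    (λ X X≠F → cong (λ b → Δ₁ X ∧ not b) (trans (cong (Δ₀ X ∨_) X≠F) (∨-identityʳ (Δ₀ X))))
    (trans (cong (λ b → Δ₁ F ∧ not b) (trans (cong (Δ₀ F ∨_) (==-refl F)) (∨-zeroʳ (Δ₀ F)))) (∧-zeroʳ (Δ₁ F))))))

flips-removing-faces : ∀ {n} m c (Δ₀ Δ₁ : Subset n → Bool) → DownClosed Δ₀ → DownClosed Δ₁ → (∀ X → Δ₀ X ≡ true → Δ₁ X ≡ true) →
  Δ₁ full ≡ false → Δ₀ ∅ ≡ true → (∀ X → newFaces Δ₀ Δ₁ X ≡ true → n ∸ 2 ∸ (∣ X ∣ ∸ 1) ≤ m) → count (newFaces Δ₀ Δ₁) ≡ c →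
  Σ (Complex (n ℕ.+ n)) λ Γ → Flips (n ∸ 2) m (Bier Δ₁) Γ × (∀ X → Γ X ≡ Bier Δ₀ X)
flips-removing-faces m zero Δ₀ Δ₁ _ _ Δ₀⊆Δ₁ _ _ _ none =
  Bier Δ₁ , done , λ X → sym (Bier-cong Δ₀ Δ₁ (no-newFaces⇒≗ Δ₀ Δ₁ Δ₀⊆Δ₁ none) X)
flips-removing-faces {n} m (suc c) Δ₀ Δ₁ Δ₀-closed Δ₁-closed Δ₀⊆Δ₁ full∉Δ₁ ∅∈Δ₀ small count≡1+c =
  let Γ , flips , Γ≗Bier = flips-removing-faces m c Δ₀ Δ₁⁻ Δ₀-closed Δ₁⁻-closed Δ₀⊆Δ₁⁻ full∉Δ₁⁻ ∅∈Δ₀ small⁻ count⁻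
  in Γ , step (n ∸ 2 ∸ (∣ F ∣ ∸ 1)) (small F F-new) removal flips , Γ≗Bier
  where
  X₀ = count≢0⇒witness (newFaces Δ₀ Δ₁) (λ none → ℕP.0≢1+n (trans (sym none) count≡1+c))
  maximal = maximal-witness (newFaces Δ₀ Δ₁) (n ∸ ∣ proj₁ X₀ ∣) (proj₁ X₀) ℕP.≤-refl (proj₂ X₀)
  F = proj₁ maximal
  F-new = proj₁ (proj₂ maximal)
  F∈Δ₁ = ∧-conicalˡ _ _ F-new
  F∉Δ₀ = not≡true⇒≡false (∧-conicalʳ (Δ₁ F) _ F-new)
  bounds = newFace-bounds Δ₀ Δ₁ full∉Δ₁ ∅∈Δ₀ F F-new
  Δ₁⁻ : Subset n → Bool
  Δ₁⁻ X = Δ₁ X ∧ not (X == F)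
  Δ₁⁻-closed : DownClosed Δ₁⁻
  Δ₁⁻-closed = remove-maximal-newFace-closed Δ₀ Δ₁ Δ₀-closed Δ₁-closed F F∉Δ₀ (proj₂ (proj₂ maximal))
  F∉Δ₁⁻ : Δ₁⁻ F ≡ false
  F∉Δ₁⁻ rewrite ==-refl F = ∧-zeroʳ (Δ₁ F)
  below : ∀ X → X ⊂ᵇ F ≡ true → Δ₁⁻ X ≡ true
  below X X⊂F rewrite Δ₁-closed X F (SP.p⊂q⇒p⊆q (⊂ᵇ⇒⊂ X⊂F)) F∈Δ₁ | ⊂ᵇ⇒not== X F X⊂F = refl
  module AF = AddFace Δ₁⁻ Δ₁⁻-closed F F∉Δ₁⁻ below (proj₁ bounds) (proj₂ bounds)
  Δ₁⁻⁺≗Δ₁ : ∀ X → AF.Δ⁺ X ≡ Δ₁ X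
  Δ₁⁻⁺≗Δ₁ X with X == F in X≟F
  ... | false = trans (∨-identityʳ _) (∧-identityʳ (Δ₁ X))
  ... | true rewrite ==-sound {X = X} X≟F = trans (∨-zeroʳ _) (sym F∈Δ₁)
  removal : Flip (n ∸ 2) (n ∸ 2 ∸ (∣ F ∣ ∸ 1)) (Bier Δ₁) (Bier Δ₁⁻)
  removal = Flip-congˡ (Bier-cong AF.Δ⁺ Δ₁ Δ₁⁻⁺≗Δ₁) (Flip-reverse AF.Bier-flip (Bier-closed Δ₁⁻ Δ₁⁻-closed))
  Δ₀⊆Δ₁⁻ : ∀ X → Δ₀ X ≡ true → Δ₁⁻ X ≡ true
  Δ₀⊆Δ₁⁻ X X∈Δ₀ with X == F in X≟F
  ... | false rewrite Δ₀⊆Δ₁ X X∈Δ₀ = refl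
  ... | true rewrite ==-sound {X = X} X≟F = ⊥-elim (true≢false (trans (sym X∈Δ₀) F∉Δ₀))
  full∉Δ₁⁻ : Δ₁⁻ full ≡ false
  full∉Δ₁⁻ rewrite full∉Δ₁ = refl
  small⁻ : ∀ X → newFaces Δ₀ Δ₁⁻ X ≡ true → n ∸ 2 ∸ (∣ X ∣ ∸ 1) ≤ m
  small⁻ X X-new⁻ = small X (drop-middle (Δ₁ X) (X == F) (Δ₀ X) X-new⁻)
    where drop-middle : ∀ a b c → (a ∧ not b) ∧ not c ≡ true → a ∧ not c ≡ true
          drop-middle true false false _ = refl
  count⁻ : count (newFaces Δ₀ Δ₁⁻) ≡ c
  count⁻ = sym (ℕP.suc-injective (trans (sym count≡1+c) (count-δ (newFaces Δ₀ Δ₁) F F-new (newFaces Δ₀ Δ₁⁻)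
    (λ X X≠F → trans (cong (λ b → (Δ₁ X ∧ not b) ∧ not (Δ₀ X)) X≠F) (cong (_∧ not (Δ₀ X)) (∧-identityʳ (Δ₁ X))))
    (trans (cong (λ b → (Δ₁ F ∧ not b) ∧ not (Δ₀ F)) (==-refl F)) (cong (_∧ not (Δ₀ F)) (∧-zeroʳ (Δ₁ F)))))))

Bier-⁅∅⁆≡∂ : ∀ n X → Bier {n} (_== ∅) X ≡ BoundarySimplex (∅ {n} ++ full {n}) X
Bier-⁅∅⁆≡∂ n X
  rewrite take++drop {n} X | Bier-++ (_== ∅) (take n X) (drop n X)
        | ⊂ᵇ≡⊆ᵇ∧not== (take n X ++ drop n X) (∅ {n} ++ full {n}) | ⊆ᵇ-++ (take n X) ∅ (drop n X) full
        | ==-++ (take n X) ∅ (drop n X) full | ⊆ᵇ∅≡==∅ (take n X) | ⊆ᵇ-full (drop n X) | ∁==∅ (drop n X)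
  with take n X == ∅ in tX≟∅
... | false = refl
... | true rewrite ==-sound {X = take n X} tX≟∅ | ∅⊆ᵇ (∁ (drop n X)) with drop n X == full
...   | true  = refl
...   | false = refl

Bier-all-but-full≡∂ : ∀ n X → Bier {n} (λ Y → not (Y == full)) X ≡ BoundarySimplex (full {n} ++ ∅ {n}) X
Bier-all-but-full≡∂ n X
  rewrite take++drop {n} X | Bier-++ (λ Y → not (Y == full)) (take n X) (drop n X)
        | ⊂ᵇ≡⊆ᵇ∧not== (take n X ++ drop n X) (full {n} ++ ∅ {n}) | ⊆ᵇ-++ (take n X) full (drop n X) ∅
        | ==-++ (take n X) full (drop n X) ∅ | ⊆ᵇ∅≡==∅ (drop n X) | ⊆ᵇ-full (take n X) | ∁==full (drop n X)
  with drop n X == ∅ in dX≟∅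
... | false = ∧-zeroʳ _
... | true rewrite ==-sound {X = drop n X} dX≟∅ | ∁∅ {n} | ⊆ᵇ-full (take n X) with take n X == full
...   | true  = refl
...   | false = refl

ObtainedByFlips : (n m : ℕ) → ∀ {M} → Complex M → Set
ObtainedByFlips n m Γ′ = Σ ℕ λ N → Σ (Subset N) λ S → ∣ S ∣ ≡ n × Σ (Complex N) λ Γ →
  Flips (n ∸ 2) m (BoundarySimplex S) Γ × Iso Γ Γ′

ObtainedByFlips-Bier : ∀ {n m} (Δ₀ Δ : Subset n → Bool) (S : Subset (n ℕ.+ n)) → ∣ S ∣ ≡ n →
  (∀ X → Bier Δ₀ X ≡ BoundarySimplex S X) →
  (Σ (Complex (n ℕ.+ n)) λ Γ → Flips (n ∸ 2) m (Bier Δ₀) Γ × (∀ X → Γ X ≡ Bier Δ X)) → ObtainedByFlips n m (Bier Δ)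
ObtainedByFlips-Bier {n} Δ₀ Δ S ∣S∣≡n Bier≗∂ (Γ , flips , Γ≗Bier) =
  let Γ′ , flips′ , Γ′≗Γ = Flips-congˡ Bier≗∂ flips
  in n ℕ.+ n , S , ∣S∣≡n , Γ′ , flips′ , Iso-≗ Γ′ (Bier Δ) (λ X → trans (Γ′≗Γ X) (Γ≗Bier X))

f≡0⇒ObtainedByFlips : ∀ {n} (Δ : Subset n → Bool) → ProperIdeal Δ → ∀ m → f Δ (suc (suc m)) ≡ 0 →
  ObtainedByFlips n m (Bier Δ)
f≡0⇒ObtainedByFlips {n} Δ (Δ-closed , ∅∈Δ , full∉Δ) m f≡0 =
  ObtainedByFlips-Bier (_== ∅) Δ (∅ {n} ++ full {n}) ∣S∣≡n (Bier-⁅∅⁆≡∂ n)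
    (flips-adding-faces m _ (_== ∅) Δ ⁅∅⁆-closed Δ-closed ⁅∅⁆⊆Δ full∉Δ (==-refl (∅ {n})) small refl)
  where
  ∣S∣≡n : ∣ ∅ {n} ++ full {n} ∣ ≡ n
  ∣S∣≡n = trans (∣++∣ (∅ {n}) full) (trans (cong (ℕ._+ ∣ full {n} ∣) (SP.∣⊥∣≡0 n)) (SP.∣⊤∣≡n n))
  ⁅∅⁆-closed : DownClosed (_== ∅)
  ⁅∅⁆-closed X Y X⊆Y Y≡∅ rewrite ==-sound {X = Y} Y≡∅ = ==-complete {X = X} (SP.⊆-antisym X⊆Y (SP.⊆-min X))
  ⁅∅⁆⊆Δ : ∀ X → X == ∅ ≡ true → Δ X ≡ true
  ⁅∅⁆⊆Δ X X≡∅ rewrite ==-sound {X = X} X≡∅ = ∅∈Δ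
  small : ∀ X → newFaces (_== ∅) Δ X ≡ true → ∣ X ∣ ∸ 1 ≤ m
  small X X-new = ℕP.∸-monoˡ-≤ 1 (ℕP.≤-pred (ℕP.≰⇒> too-big))
    where
    too-big : ¬ (suc (suc m) ≤ ∣ X ∣)
    too-big K≤∣X∣ = true≢false (trans (sym (∧-conicalˡ _ _ X-new))
                                      (f≡0⇒none-of-size Δ ∣ X ∣ (f≡0-upward Δ Δ-closed K≤∣X∣ f≡0) X refl))

n∸2∸[x∸1]≤m : ∀ n m x → suc (suc m) ≤ n → n ∸ suc (suc m) < x → n ∸ 2 ∸ (x ∸ 1) ≤ m
n∸2∸[x∸1]≤m n m (suc x) K≤n (s≤s n-K≤x) = subst (_≤ m) (sym (ℕP.∸-+-assoc n 2 x)) (ℕP.m≤n+o⇒m∸n≤o n (2 ℕ.+ x) n≤2+x+m)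
  where
  regroup : ∀ a b → a ℕ.+ suc (suc b) ≡ (2 ℕ.+ a) ℕ.+ b
  regroup = ℕ-solve-∀
  n≤2+x+m : n ≤ (2 ℕ.+ x) ℕ.+ m
  n≤2+x+m = ℕP.≤-trans (ℕP.≤-reflexive (sym (ℕP.m∸n+n≡m K≤n))) (ℕP.≤-trans (ℕP.+-monoˡ-≤ (suc (suc m)) n-K≤x) (ℕP.≤-reflexive (regroup x m)))

f≡C⇒ObtainedByFlips : ∀ {n} (Δ : Subset n → Bool) → ProperIdeal Δ → ∀ m → suc (suc m) ≤ n →
  f Δ (n ∸ suc (suc m)) ≡ n C suc (suc m) → ObtainedByFlips n m (Bier Δ)
f≡C⇒ObtainedByFlips {n} Δ (Δ-closed , ∅∈Δ , full∉Δ) m K≤n f≡C =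
  ObtainedByFlips-Bier (λ Y → not (Y == full)) Δ (full {n} ++ ∅ {n}) ∣S∣≡n (Bier-all-but-full≡∂ n)
    (flips-removing-faces m _ Δ (λ Y → not (Y == full)) Δ-closed proper-closed Δ⊆proper (cong not (==-refl (full {n}))) ∅∈Δ small refl)
  where
  K = suc (suc m)
  ∣S∣≡n : ∣ full {n} ++ ∅ {n} ∣ ≡ n
  ∣S∣≡n = trans (∣++∣ (full {n}) ∅) (trans (cong (∣ full {n} ∣ ℕ.+_) (SP.∣⊥∣≡0 n)) (trans (ℕP.+-identityʳ _) (SP.∣⊤∣≡n n)))
  proper-closed : DownClosed (λ Y → not (Y == full))
  proper-closed X Y X⊆Y Y≠full with X == full in X≟full
  ... | false = refl
  ... | true  = ⊥-elim (true≢false (trans (sym (==-complete {X = Y} Y≡full)) (not≡true⇒≡false Y≠full)))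
    where Y≡full : Y ≡ full
          Y≡full = SP.⊆-antisym SP.⊆⊤ (subst (_⊆ Y) (==-sound {X = X} X≟full) X⊆Y)
  Δ⊆proper : ∀ X → Δ X ≡ true → not (X == full) ≡ true
  Δ⊆proper X X∈Δ with X == full in X≟full
  ... | false = refl
  ... | true rewrite ==-sound {X = X} X≟full = ⊥-elim (true≢false (trans (sym X∈Δ) full∉Δ))
  small : ∀ X → newFaces Δ (λ Y → not (Y == full)) X ≡ true → n ∸ 2 ∸ (∣ X ∣ ∸ 1) ≤ m
  small X X-new = n∸2∸[x∸1]≤m n m ∣ X ∣ K≤n (ℕP.≰⇒> too-small)
    where
    too-small : ¬ (∣ X ∣ ≤ n ∸ K)
    too-small ∣X∣≤n-K = true≢false (trans (sym X∈Δ) (not≡true⇒≡false (∧-conicalʳ (not (X == full)) _ X-new)))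
      where X∈Δ = f≡C⇒all-of-size Δ ∣ X ∣ (f≡C-downward Δ Δ-closed ∣X∣≤n-K (ℕP.m∸n≤m n K)
                                              (trans f≡C (nCk≡nC[n∸k] K≤n))) X refl

ObtainedByFlips⇒g≡0 : ∀ {n} (Δ : Subset n → Bool) → DownClosed Δ → ∀ m → suc (suc m) ℕ.+ suc (suc m) < n →
  ObtainedByFlips n m (Bier Δ) → g n (Bier Δ) (suc (suc m)) ≡ + 0
ObtainedByFlips⇒g≡0 {n} Δ Δ-closed m 2K<n (N , S , ∣S∣≡n , Γ , flips , Γ≅Bier) =
  let Γ-closed , same = faceSum-gWeight-flips 2K<n flips (BoundarySimplex-closed S) in begin
  g n (Bier Δ) (suc (suc m))                           ≡⟨ g≡faceSum n (Bier Δ) (suc m) (ℕP.∸-monoˡ-≤ 1 K<n) ⟩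
  faceSum (gWeight n (suc m)) (Bier Δ)                 ≡⟨ sym (faceSum-Iso Γ (Bier Δ) Γ≅Bier Γ-closed (Bier-closed Δ Δ-closed) (gWeight n (suc m))) ⟩
  faceSum (gWeight n (suc m)) Γ                        ≡⟨ same ⟩
  faceSum (gWeight n (suc m)) (BoundarySimplex S)      ≡⟨ faceSum-gWeight-boundary n (suc m) K<n S ∣S∣≡n ⟩
  + 0 ∎
  where
  open ≡-Reasoning
  K<n : suc (suc m) < n
  K<n = ℕP.<-≤-trans (ℕP.m<m+n (suc (suc m)) (s≤s z≤n)) (ℕP.<⇒≤ 2K<n)

k≤⌊n∸1/2⌋⇒k+k<n : ∀ n k → 1 ≤ n → k ≤ ⌊ n ∸ 1 /2⌋ → k ℕ.+ k < n
k≤⌊n∸1/2⌋⇒k+k<n n k 1≤n k≤ = subst (k ℕ.+ k <_) (trans (ℕP.+-comm 1 (n ∸ 1)) (ℕP.m∸n+n≡m 1≤n)) (s≤s k+k≤n-1)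
  where
  k+k≤n-1 : k ℕ.+ k ≤ n ∸ 1
  k+k≤n-1 = ℕP.≤-trans (ℕP.+-mono-≤ k≤ (ℕP.≤-trans k≤ (ℕP.⌊n/2⌋≤⌈n/2⌉ (n ∸ 1)))) (ℕP.≤-reflexive (ℕP.⌊n/2⌋+⌈n/2⌉≡n (n ∸ 1)))

corollary5p7 : (n : ℕ) → 1 ≤ n → (Δ : Subset n → Bool) → ProperIdeal Δ →
    (k : ℕ) → 2 ≤ k → k ≤ ⌊ n ∸ 1 /2⌋ →
    ((g n (Bier Δ) k ≡ + 0) ⇔ (f Δ k ≡ 0 ⊎ f Δ (n ∸ k) ≡ n C k))
    × ((g n (Bier Δ) k ≡ + 0) ⇔
       (Σ ℕ λ N → Σ (Subset N) λ S → ∣ S ∣ ≡ n × Σ (Complex N) λ Γ →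
          Flips (n ∸ 2) (k ∸ 2) (BoundarySimplex S) Γ × Iso Γ (Bier Δ)))
corollary5p7 n 1≤n Δ ideal@(Δ-closed , _ , _) k@(suc (suc m)) (s≤s (s≤s z≤n)) k≤ = g≡0⇔extremal , g≡0⇔flips
  where
  k+k<n = k≤⌊n∸1/2⌋⇒k+k<n n k 1≤n k≤
  k<n-k : k < n ∸ k
  k<n-k = subst (_≤ n ∸ k) (ℕP.m+n∸n≡m (suc k) k) (ℕP.∸-monoˡ-≤ k k+k<n)
  k≤n : k ≤ n
  k≤n = ℕP.≤-trans (ℕP.m≤m+n k k) (ℕP.<⇒≤ k+k<n)
  g≡0⇔extremal : (g n (Bier Δ) k ≡ + 0) ⇔ (f Δ k ≡ 0 ⊎ f Δ (n ∸ k) ≡ n C k)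
  g≡0⇔extremal = ⇔-trans (g-Bier≡0⇔f-balanced Δ Δ-closed (suc m) (ℕP.<-≤-trans (s≤s (ℕP.m≤m+n k k)) k+k<n))
                         (f-balanced⇔extremal Δ Δ-closed k k<n-k)
  g≡0⇔flips : (g n (Bier Δ) k ≡ + 0) ⇔ ObtainedByFlips n m (Bier Δ)
  g≡0⇔flips = mk⇔ (λ g≡0 → [ f≡0⇒ObtainedByFlips Δ ideal m , f≡C⇒ObtainedByFlips Δ ideal m k≤n ]′ (to g≡0⇔extremal g≡0))
                  (ObtainedByFlips⇒g≡0 Δ Δ-closed m k+k<n)
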